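{- Suppose that $f(x) \in \mathbf{Z}[x]$ is squarefree as an element of $\mathbf{Q}[x]$, and that $\deg f \ge 2$. Fix $q \in \mathbf{Q}^*$ with $q \ne 1$. Then the number of pairs of integers $(m,n)$ with $1 \le m, n \le B$ satisfying $f(m)= q f(n)$ is $o(B)$ as $B \to \infty$. -}

module Defs where

open import Data.Nat as ℕ using (ℕ; zero; suc)
open import Data.Integer as ℤ using (ℤ; +_)
open import Data.Rational as ℚ using (ℚ; 0ℚ; _/_)
open import Data.Rational.Properties using () renaming (_≟_ to _≟ℚ_)
open import Data.List using (List; []; _∷_; map; length; filter; concatMap)
open import Data.Product using (_×_; _,_; Σ; ∃)
open import Relation.Binary.PropositionalEquality using (_≡_; _≢_)

-- Polynomials are coefficient lists, lowest degree first:
-- a₀ ∷ a₁ ∷ … represents a₀ + a₁ x + …  (trailing zeros allowed).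

ℤ→ℚ : ℤ → ℚ
ℤ→ℚ z = z / 1

ℕ→ℚ : ℕ → ℚ
ℕ→ℚ n = (+ n) / 1

evalℤ : List ℤ → ℤ → ℤ
evalℤ []      x = + 0
evalℤ (a ∷ p) x = a ℤ.+ x ℤ.* evalℤ p x

coeffℤ : List ℤ → ℕ → ℤ
coeffℤ []      k       = + 0
coeffℤ (a ∷ p) zero    = a
coeffℤ (a ∷ p) (suc k) = coeffℤ p k

coeffℚ : List ℚ → ℕ → ℚ
coeffℚ []      k       = 0ℚ
coeffℚ (a ∷ p) zero    = a
coeffℚ (a ∷ p) (suc k) = coeffℚ p k

padd : List ℚ → List ℚ → List ℚ
padd []      q       = q
padd p       []      = p
padd (a ∷ p) (b ∷ q) = (a ℚ.+ b) ∷ padd p q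

pmul : List ℚ → List ℚ → List ℚ
pmul []      q = []
pmul (a ∷ p) q = padd (map (a ℚ.*_) q) (0ℚ ∷ pmul p q)

_≈ₚ_ : List ℚ → List ℚ → Set
p ≈ₚ q = ∀ k → coeffℚ p k ≡ coeffℚ q k

_∣ₚ_ : List ℚ → List ℚ → Set
g ∣ₚ f = Σ (List ℚ) λ h → pmul g h ≈ₚ f

NonConstantℚ : List ℚ → Set
NonConstantℚ g = ∃ λ k → (1 ℕ.≤ k) × (coeffℚ g k ≢ 0ℚ)

SquarefreeQ : List ℚ → Set
SquarefreeQ f = ∀ g → NonConstantℚ g → (pmul g g ∣ₚ f → Data.Empty.⊥)
  where import Data.Empty

toℚpoly : List ℤ → List ℚ
toℚpoly = map ℤ→ℚ

DegreeAtLeast : ℕ → List ℤ → Set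
DegreeAtLeast d f = ∃ λ k → (d ℕ.≤ k) × (coeffℤ f k ≢ + 0)

range1 : ℕ → List ℕ
range1 zero    = []
range1 (suc B) = range1 B Data.List.++ (suc B ∷ [])
  where import Data.List

pairs : ℕ → List (ℕ × ℕ)
pairs B = concatMap (λ m → map (λ n → (m , n)) (range1 B)) (range1 B)

count : List ℤ → ℚ → ℕ → ℕ
count f q B = length (filter (λ { (m , n) →
  ℤ→ℚ (evalℤ f (+ m)) ≟ℚ (q ℚ.* ℤ→ℚ (evalℤ f (+ n))) }) (pairs B))

LittleO-B : (ℕ → ℕ) → Set
LittleO-B F = ∀ (ε : ℚ) → 0ℚ ℚ.< ε →
  ∃ λ B₀ → ∀ B → B₀ ℕ.≤ B → ℕ→ℚ (F B) ℚ.≤ ε ℚ.* ℕ→ℚ B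

{-# OPTIONS --safe #-}

-- Write q = a / b.  After truncating f at its degree D ≥ 2 and fixing its sign, f is
-- positive and strictly increasing beyond some x₀, so a large m has at most one partner n
-- with b f(m) = a f(n), and then m and n are comparable.  Let (m, n) and (m + j, n + k) be
-- two solutions with 1 ≤ j ≤ K.  Comparing increments bounds k, and cross-multiplying
-- f(m + j) f(n) = f(m) f(n + k) bounds w = j n - k m.  Hence n is an integer root of
-- Q(y) = b k^D f((j y - w) / k) - a k^D f(y), which is not the zero polynomial: otherwise
-- f(ρ y + s) = q f(y) with ρ = j / k, which forces ρ^D = q ≠ 1, and comparing coefficients
-- around the fixed point y₀ of y ↦ ρ y + s gives f = c (y - y₀)^D, contradicting
-- squarefreeness.  As only finitely many (j, k, w) occur, n and m are bounded.  So for
-- every K the large m admitting a solution are more than K apart, and the number of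
-- solutions with m, n ≤ B is at most B / (K + 1) + O_K(1).

module Submission where

open import Defs
open import Data.Integer using (ℤ)
open import Data.Rational using (ℚ; 0ℚ; 1ℚ)
open import Data.List using (List)
open import Relation.Binary.PropositionalEquality using (_≢_)

module IntegerPolynomials where

  open import Data.Nat as ℕ using (ℕ; zero; suc; z≤n; s≤s)
  import Data.Nat.Properties as ℕP
  import Data.Nat.Tactic.RingSolver as ℕSolver
  open import Data.Integer as ℤ using (ℤ; +_; ∣_∣; _+_; _*_; _-_; -_; _^_)
  import Data.Integer.Properties as ℤP
  open import Data.Integer.Tactic.RingSolver using (solve-∀)
  open import Data.List using (List; []; _∷_; map; length; take; drop)
  open import Data.Product using (_×_; _,_; ∃; proj₁)
  open import Data.Sum using (_⊎_; inj₁; inj₂)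
  open import Data.Empty using (⊥-elim)
  open import Relation.Nullary using (yes; no)
  open import Relation.Binary.PropositionalEquality
  open import Algebra.Properties.AbelianGroup ℤP.+-0-abelianGroup using (inverseʳ-unique)
  open import Defs using (evalℤ; coeffℤ)

  paddℤ : List ℤ → List ℤ → List ℤ
  paddℤ []      q       = q
  paddℤ (a ∷ p) []      = a ∷ p
  paddℤ (a ∷ p) (b ∷ q) = (a + b) ∷ paddℤ p q

  pmulℤ : List ℤ → List ℤ → List ℤ
  pmulℤ []      q = []
  pmulℤ (a ∷ p) q = paddℤ (map (a *_) q) (+ 0 ∷ pmulℤ p q)

  evalℤ-allZero : ∀ p x → (∀ i → coeffℤ p i ≡ + 0) → evalℤ p x ≡ + 0
  evalℤ-allZero []      x z = refl
  evalℤ-allZero (a ∷ p) x z rewrite z 0 | evalℤ-allZero p x (λ i → z (suc i)) | ℤP.*-zeroʳ x = refl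

  evalℤ-cong-coeff : ∀ p r x → (∀ i → coeffℤ p i ≡ coeffℤ r i) → evalℤ p x ≡ evalℤ r x
  evalℤ-cong-coeff []      r       x h = sym (evalℤ-allZero r x (λ i → sym (h i)))
  evalℤ-cong-coeff (a ∷ p) []      x h = evalℤ-allZero (a ∷ p) x h
  evalℤ-cong-coeff (a ∷ p) (b ∷ r) x h =
    cong₂ (λ u v → u + x * v) (h 0) (evalℤ-cong-coeff p r x (λ i → h (suc i)))

  coeffℤ-padd : ∀ p q i → coeffℤ (paddℤ p q) i ≡ coeffℤ p i + coeffℤ q i
  coeffℤ-padd []      q       i       = sym (ℤP.+-identityˡ _)
  coeffℤ-padd (a ∷ p) []      zero    = sym (ℤP.+-identityʳ _)
  coeffℤ-padd (a ∷ p) []      (suc i) = sym (ℤP.+-identityʳ _)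
  coeffℤ-padd (a ∷ p) (b ∷ q) zero    = refl
  coeffℤ-padd (a ∷ p) (b ∷ q) (suc i) = coeffℤ-padd p q i

  coeffℤ-scale : ∀ s p i → coeffℤ (map (s *_) p) i ≡ s * coeffℤ p i
  coeffℤ-scale s []      i       = sym (ℤP.*-zeroʳ s)
  coeffℤ-scale s (a ∷ p) zero    = refl
  coeffℤ-scale s (a ∷ p) (suc i) = coeffℤ-scale s p i

  coeffℤ-pmul-const : ∀ v r i → coeffℤ (pmulℤ (v ∷ []) r) i ≡ v * coeffℤ r i
  coeffℤ-pmul-const v r i = begin
    coeffℤ (pmulℤ (v ∷ []) r) i                    ≡⟨ coeffℤ-padd (map (v *_) r) (+ 0 ∷ []) i ⟩
    coeffℤ (map (v *_) r) i + coeffℤ (+ 0 ∷ []) i  ≡⟨ cong₂ _+_ (coeffℤ-scale v r i) (zeroPoly i) ⟩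
    v * coeffℤ r i + + 0                           ≡⟨ ℤP.+-identityʳ _ ⟩
    v * coeffℤ r i                                 ∎
    where
    open ≡-Reasoning
    zeroPoly : ∀ i → coeffℤ (+ 0 ∷ []) i ≡ + 0
    zeroPoly zero    = refl
    zeroPoly (suc i) = refl

  coeffℤ-pmul-linear : ∀ u v r i →
    coeffℤ (pmulℤ (u ∷ v ∷ []) r) (suc i) ≡ u * coeffℤ r (suc i) + v * coeffℤ r i
  coeffℤ-pmul-linear u v r i =
    trans (coeffℤ-padd (map (u *_) r) (+ 0 ∷ pmulℤ (v ∷ []) r) (suc i))
          (cong₂ _+_ (coeffℤ-scale u r (suc i)) (coeffℤ-pmul-const v r i))

  HasDegree : List ℤ → ℕ → Set
  HasDegree p d = (coeffℤ p d ≢ + 0) × (∀ t → d ℕ.< t → coeffℤ p t ≡ + 0)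

  zero⊎hasDegree : ∀ p → (∀ i → coeffℤ p i ≡ + 0) ⊎ ∃ (HasDegree p)
  zero⊎hasDegree [] = inj₁ (λ i → refl)
  zero⊎hasDegree (a ∷ p) with zero⊎hasDegree p
  ... | inj₂ (d , top , above) = inj₂ (suc d , top , λ { (suc t) (s≤s lt) → above t lt })
  ... | inj₁ z with a ℤ.≟ + 0
  ...   | yes a≡0 = inj₁ (λ { zero → a≡0 ; (suc i) → z i })
  ...   | no  a≢0 = inj₂ (0 , a≢0 , λ { (suc t) _ → z t })

  hasDegree-≥ : ∀ p d i → coeffℤ p i ≢ + 0 → HasDegree p d → i ℕ.≤ d
  hasDegree-≥ p d i nz (_ , above) with ℕP.≤-<-connex i d
  ... | inj₁ i≤d = i≤d
  ... | inj₂ d<i = ⊥-elim (nz (above i d<i))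

  evalℤ-split : ∀ d p x → evalℤ p x ≡ evalℤ (take d p) x + x ^ d * evalℤ (drop d p) x
  evalℤ-split zero    p       x = sym (trans (ℤP.+-identityˡ _) (ℤP.*-identityˡ _))
  evalℤ-split (suc d) []      x = sym (trans (ℤP.+-identityˡ _) (ℤP.*-zeroʳ (x ^ suc d)))
  evalℤ-split (suc d) (a ∷ p) x rewrite evalℤ-split d p x =
    ring a x (evalℤ (take d p) x) (x ^ d) (evalℤ (drop d p) x)
    where
    ring : ∀ a x T Xd R → a + x * (T + Xd * R) ≡ a + x * T + x * Xd * R
    ring = solve-∀

  coeffℤ-drop : ∀ d p t → coeffℤ (drop d p) t ≡ coeffℤ p (d ℕ.+ t)
  coeffℤ-drop zero    p       t = refl
  coeffℤ-drop (suc d) []      t = refl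
  coeffℤ-drop (suc d) (a ∷ p) t = coeffℤ-drop d p t

  evalℤ-constant : ∀ p x → (∀ t → coeffℤ p (suc t) ≡ + 0) → evalℤ p x ≡ coeffℤ p 0
  evalℤ-constant []      x z = refl
  evalℤ-constant (a ∷ p) x z rewrite evalℤ-allZero p x z | ℤP.*-zeroʳ x = ℤP.+-identityʳ a

  evalℤ-leading : ∀ p d x → HasDegree p d → evalℤ p x ≡ evalℤ (take d p) x + x ^ d * coeffℤ p d
  evalℤ-leading p d x (_ , above) = trans (evalℤ-split d p x)
    (cong (λ z → evalℤ (take d p) x + x ^ d * z) (trans
      (evalℤ-constant (drop d p) x (λ t → trans (coeffℤ-drop d p (suc t)) (above (d ℕ.+ suc t) (ℕP.m<m+n d (s≤s z≤n)))))
      (trans (coeffℤ-drop d p 0) (cong (coeffℤ p) (ℕP.+-identityʳ d)))))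

  length-take≤ : ∀ d (p : List ℤ) → length (take d p) ℕ.≤ d
  length-take≤ zero    p       = z≤n
  length-take≤ (suc d) []      = z≤n
  length-take≤ (suc d) (a ∷ p) = s≤s (length-take≤ d p)

  +-^ : ∀ x n → (+ x) ^ n ≡ + (x ℕ.^ n)
  +-^ x zero    = refl
  +-^ x (suc n) rewrite +-^ x n = sym (ℤP.pos-* x (x ℕ.^ n))

  sumAbs : List ℤ → ℕ
  sumAbs []      = 0
  sumAbs (a ∷ p) = ∣ a ∣ ℕ.+ sumAbs p

  sumAbs-take : ∀ d p → sumAbs (take d p) ℕ.≤ sumAbs p
  sumAbs-take zero    p       = z≤n
  sumAbs-take (suc d) []      = z≤n
  sumAbs-take (suc d) (a ∷ p) = ℕP.+-monoʳ-≤ ∣ a ∣ (sumAbs-take d p)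

  ∣evalℤ∣≤sumAbs*x^ : ∀ s p x → length p ℕ.≤ suc s → 1 ℕ.≤ x → ∣ evalℤ p (+ x) ∣ ℕ.≤ sumAbs p ℕ.* x ℕ.^ s
  ∣evalℤ∣≤sumAbs*x^ s       []          x _ _ = z≤n
  ∣evalℤ∣≤sumAbs*x^ zero    (a ∷ [])    x _ _
    rewrite ℤP.*-zeroʳ (+ x) | ℤP.+-identityʳ a | ℕP.+-identityʳ ∣ a ∣ | ℕP.*-identityʳ ∣ a ∣ = ℕP.≤-refl
  ∣evalℤ∣≤sumAbs*x^ zero    (a ∷ b ∷ p) x (s≤s ()) _
  ∣evalℤ∣≤sumAbs*x^ (suc s) (a ∷ p)     x (s≤s len) x≥1 = begin
    ∣ a + + x * evalℤ p (+ x) ∣                    ≤⟨ ℤP.∣i+j∣≤∣i∣+∣j∣ a _ ⟩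
    ∣ a ∣ ℕ.+ ∣ + x * evalℤ p (+ x) ∣              ≡⟨ cong (∣ a ∣ ℕ.+_) (ℤP.abs-* (+ x) (evalℤ p (+ x))) ⟩
    ∣ a ∣ ℕ.+ x ℕ.* ∣ evalℤ p (+ x) ∣              ≤⟨ ℕP.+-mono-≤ (ℕP.m≤m*n ∣ a ∣ (x ℕ.^ suc s) {{ℕ.>-nonZero x^s+1>0}})
                                                                   (ℕP.*-monoʳ-≤ x (∣evalℤ∣≤sumAbs*x^ s p x len x≥1)) ⟩
    ∣ a ∣ ℕ.* x ℕ.^ suc s ℕ.+ x ℕ.* (sumAbs p ℕ.* x ℕ.^ s) ≡⟨ ring ∣ a ∣ x (sumAbs p) (x ℕ.^ s) ⟩
    (∣ a ∣ ℕ.+ sumAbs p) ℕ.* x ℕ.^ suc s           ∎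
    where
    open ℕP.≤-Reasoning
    x^s+1>0 = ℕP.m^n>0 x {{ℕ.>-nonZero x≥1}} (suc s)
    ring : ∀ A x S P → A ℕ.* (x ℕ.* P) ℕ.+ x ℕ.* (S ℕ.* P) ≡ (A ℕ.+ S) ℕ.* (x ℕ.* P)
    ring = ℕSolver.solve-∀

  evalℤ-constant-length : ∀ p y z → length p ℕ.≤ 1 → evalℤ p y ≡ evalℤ p z
  evalℤ-constant-length []          y z _ = refl
  evalℤ-constant-length (a ∷ [])    y z _ rewrite ℤP.*-zeroʳ y | ℤP.*-zeroʳ z = refl
  evalℤ-constant-length (a ∷ b ∷ p) y z (s≤s ())

  -- p(x + d) - p(x) = (x + d)(p′(x + d) - p′(x)) + d p′(x) for p = a + y p′.
  ∣evalℤ-increment∣≤-∷ : ∀ a p x d → ∣ evalℤ (a ∷ p) (+ (x ℕ.+ d)) - evalℤ (a ∷ p) (+ x) ∣ ℕ.≤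
    (x ℕ.+ d) ℕ.* ∣ evalℤ p (+ (x ℕ.+ d)) - evalℤ p (+ x) ∣ ℕ.+ d ℕ.* ∣ evalℤ p (+ x) ∣
  ∣evalℤ-increment∣≤-∷ a p x d = begin
    ∣ evalℤ (a ∷ p) Y - evalℤ (a ∷ p) X ∣
      ≡⟨ cong ∣_∣ (split a Y X (evalℤ p Y) (evalℤ p X)) ⟩
    ∣ Y * (evalℤ p Y - evalℤ p X) + (Y - X) * evalℤ p X ∣
      ≤⟨ ℤP.∣i+j∣≤∣i∣+∣j∣ (Y * (evalℤ p Y - evalℤ p X)) ((Y - X) * evalℤ p X) ⟩
    ∣ Y * (evalℤ p Y - evalℤ p X) ∣ ℕ.+ ∣ (Y - X) * evalℤ p X ∣
      ≡⟨ cong₂ ℕ._+_ (ℤP.abs-* Y _) (trans (ℤP.abs-* (Y - X) _) (cong (λ z → ∣ z ∣ ℕ.* ∣ evalℤ p X ∣) Y-X≡d)) ⟩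
    (x ℕ.+ d) ℕ.* ∣ evalℤ p Y - evalℤ p X ∣ ℕ.+ d ℕ.* ∣ evalℤ p X ∣ ∎
    where
    open ℕP.≤-Reasoning
    Y = + (x ℕ.+ d)
    X = + x
    split : ∀ a Y X P Q → (a + Y * P) - (a + X * Q) ≡ Y * (P - Q) + (Y - X) * Q
    split = solve-∀
    Y-X≡d : Y - X ≡ + d
    Y-X≡d rewrite ℤP.pos-+ x d = cancel (+ x) (+ d)
      where
      cancel : ∀ X D → X + D - X ≡ D
      cancel = solve-∀

  ∣evalℤ-increment∣≤ : ∀ t p x d → length p ℕ.≤ suc (suc t) → 1 ℕ.≤ x →
    ∣ evalℤ p (+ (x ℕ.+ d)) - evalℤ p (+ x) ∣ ℕ.≤ sumAbs p ℕ.* suc t ℕ.* d ℕ.* (x ℕ.+ d) ℕ.^ t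
  ∣evalℤ-increment∣≤ t       []      x d _         _   = z≤n
  ∣evalℤ-increment∣≤ zero    (a ∷ p) x d (s≤s len) x≥1 = begin
    ∣ evalℤ (a ∷ p) (+ (x ℕ.+ d)) - evalℤ (a ∷ p) (+ x) ∣       ≤⟨ ∣evalℤ-increment∣≤-∷ a p x d ⟩
    (x ℕ.+ d) ℕ.* ∣ evalℤ p (+ (x ℕ.+ d)) - evalℤ p (+ x) ∣ ℕ.+ d ℕ.* ∣ evalℤ p (+ x) ∣
      ≡⟨ cong (λ z → (x ℕ.+ d) ℕ.* ∣ z ∣ ℕ.+ d ℕ.* ∣ evalℤ p (+ x) ∣)
              (trans (cong (_- evalℤ p (+ x)) (evalℤ-constant-length p _ (+ x) len)) (ℤP.+-inverseʳ (evalℤ p (+ x)))) ⟩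
    (x ℕ.+ d) ℕ.* 0 ℕ.+ d ℕ.* ∣ evalℤ p (+ x) ∣                  ≤⟨ ℕP.+-mono-≤ (ℕP.≤-reflexive (ℕP.*-zeroʳ (x ℕ.+ d)))
                                                                        (ℕP.*-monoʳ-≤ d (∣evalℤ∣≤sumAbs*x^ 0 p x len x≥1)) ⟩
    d ℕ.* (sumAbs p ℕ.* 1)                                       ≤⟨ ℕP.*-monoʳ-≤ d (ℕP.*-monoˡ-≤ 1 (ℕP.m≤n+m (sumAbs p) ∣ a ∣)) ⟩
    d ℕ.* (sumAbs (a ∷ p) ℕ.* 1)                                 ≡⟨ ring (sumAbs (a ∷ p)) d ⟩
    sumAbs (a ∷ p) ℕ.* 1 ℕ.* d ℕ.* 1                             ∎
    where
    open ℕP.≤-Reasoning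
    ring : ∀ S d → d ℕ.* (S ℕ.* 1) ≡ S ℕ.* 1 ℕ.* d ℕ.* 1
    ring = ℕSolver.solve-∀
  ∣evalℤ-increment∣≤ (suc t) (a ∷ p) x d (s≤s len) x≥1 = begin
    ∣ evalℤ (a ∷ p) (+ Y) - evalℤ (a ∷ p) (+ x) ∣       ≤⟨ ∣evalℤ-increment∣≤-∷ a p x d ⟩
    Y ℕ.* ∣ evalℤ p (+ Y) - evalℤ p (+ x) ∣ ℕ.+ d ℕ.* ∣ evalℤ p (+ x) ∣
      ≤⟨ ℕP.+-mono-≤ (ℕP.*-monoʳ-≤ Y (∣evalℤ-increment∣≤ t p x d len x≥1))
                     (ℕP.*-monoʳ-≤ d (ℕP.≤-trans (∣evalℤ∣≤sumAbs*x^ (suc t) p x len x≥1)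
                        (ℕP.*-monoʳ-≤ (sumAbs p) (ℕP.^-monoˡ-≤ (suc t) (ℕP.m≤m+n x d))))) ⟩
    Y ℕ.* (sumAbs p ℕ.* suc t ℕ.* d ℕ.* Y ℕ.^ t) ℕ.+ d ℕ.* (sumAbs p ℕ.* Y ℕ.^ suc t)
      ≡⟨ ring Y (sumAbs p) t d (Y ℕ.^ t) ⟩
    sumAbs p ℕ.* suc (suc t) ℕ.* d ℕ.* Y ℕ.^ suc t
      ≤⟨ ℕP.*-monoˡ-≤ (Y ℕ.^ suc t) (ℕP.*-monoˡ-≤ d (ℕP.*-monoˡ-≤ (suc (suc t)) (ℕP.m≤n+m (sumAbs p) ∣ a ∣))) ⟩
    sumAbs (a ∷ p) ℕ.* suc (suc t) ℕ.* d ℕ.* Y ℕ.^ suc t ∎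
    where
    open ℕP.≤-Reasoning
    Y = x ℕ.+ d
    ring : ∀ Y S t d P → Y ℕ.* (S ℕ.* suc t ℕ.* d ℕ.* P) ℕ.+ d ℕ.* (S ℕ.* (Y ℕ.* P))
                       ≡ S ℕ.* suc (suc t) ℕ.* d ℕ.* (Y ℕ.* P)
    ring = ℕSolver.solve-∀

  root≤sumAbs : ∀ p d x → HasDegree p d → 1 ℕ.≤ x → evalℤ p (+ x) ≡ + 0 → x ℕ.≤ sumAbs p
  root≤sumAbs p zero x deg x≥1 root = ⊥-elim (proj₁ deg (begin
    coeffℤ p 0                        ≡⟨ sym (trans (ℤP.+-identityˡ _) (ℤP.*-identityˡ _)) ⟩
    evalℤ [] (+ x) + + 1 * coeffℤ p 0 ≡⟨ sym (evalℤ-leading p 0 (+ x) deg) ⟩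
    evalℤ p (+ x)                     ≡⟨ root ⟩
    + 0                               ∎))
    where open ≡-Reasoning
  root≤sumAbs p (suc t) x deg x≥1 root =
    ℕP.*-cancelʳ-≤ x (sumAbs p) (x ℕ.^ t) {{ℕP.m^n≢0 x t {{ℕ.>-nonZero x≥1}}}} (begin
      x ℕ.* x ℕ.^ t              ≤⟨ ℕP.m≤m*n (x ℕ.^ suc t) ∣ c ∣ {{ℕ.≢-nonZero (λ e → proj₁ deg (ℤP.∣i∣≡0⇒i≡0 e))}} ⟩
      x ℕ.^ suc t ℕ.* ∣ c ∣      ≡⟨ sym (trans (ℤP.abs-* ((+ x) ^ suc t) c)
                                              (cong (λ z → ∣ z ∣ ℕ.* ∣ c ∣) (+-^ x (suc t)))) ⟩
      ∣ (+ x) ^ suc t * c ∣      ≡⟨ cong ∣_∣ leading≡-lower ⟩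
      ∣ - T ∣                    ≡⟨ ℤP.∣-i∣≡∣i∣ T ⟩
      ∣ T ∣                      ≤⟨ ∣evalℤ∣≤sumAbs*x^ t (take (suc t) p) x (length-take≤ (suc t) p) x≥1 ⟩
      sumAbs (take (suc t) p) ℕ.* x ℕ.^ t ≤⟨ ℕP.*-monoˡ-≤ (x ℕ.^ t) (sumAbs-take (suc t) p) ⟩
      sumAbs p ℕ.* x ℕ.^ t       ∎)
    where
    open ℕP.≤-Reasoning
    c = coeffℤ p (suc t)
    T = evalℤ (take (suc t) p) (+ x)
    leading≡-lower : (+ x) ^ suc t * c ≡ - T
    leading≡-lower = inverseʳ-unique T _ (trans (sym (evalℤ-leading p (suc t) (+ x) deg)) root)

  -- homComp k ℓ e p represents k^e · p(ℓ(y) / k), which has integer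
  -- coefficients as long as deg p ≤ e.
  homComp : ℕ → List ℤ → ℕ → List ℤ → List ℤ
  homComp k ℓ e []      = []
  homComp k ℓ e (a ∷ p) = paddℤ (a * + (k ℕ.^ e) ∷ []) (pmulℤ ℓ (homComp k ℓ (e ℕ.∸ 1) p))

  module _ (k : ℕ) (u v : ℤ) where

    private
      ℓ = u ∷ v ∷ []

    coeffℤ-homComp-suc : ∀ e a p i → coeffℤ (homComp k ℓ (suc e) (a ∷ p)) (suc i)
                                    ≡ u * coeffℤ (homComp k ℓ e p) (suc i) + v * coeffℤ (homComp k ℓ e p) i
    coeffℤ-homComp-suc e a p i =
      trans (coeffℤ-padd (a * + (k ℕ.^ suc e) ∷ []) (pmulℤ ℓ (homComp k ℓ e p)) (suc i))
            (trans (ℤP.+-identityˡ _) (coeffℤ-pmul-linear u v (homComp k ℓ e p) i))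

    coeffℤ-homComp-above : ∀ e p → length p ℕ.≤ suc e → ∀ i → e ℕ.< i → coeffℤ (homComp k ℓ e p) i ≡ + 0
    coeffℤ-homComp-above e       []          _         i       _        = refl
    coeffℤ-homComp-above zero    (a ∷ [])    _         (suc zero)    _ = refl
    coeffℤ-homComp-above zero    (a ∷ [])    _         (suc (suc i)) _ = refl
    coeffℤ-homComp-above zero    (a ∷ b ∷ p) (s≤s ())  i       _
    coeffℤ-homComp-above (suc e) (a ∷ p)     (s≤s len) (suc i) (s≤s e<i) = begin
      coeffℤ (homComp k ℓ (suc e) (a ∷ p)) (suc i)            ≡⟨ coeffℤ-homComp-suc e a p i ⟩
      u * coeffℤ (homComp k ℓ e p) (suc i) + v * coeffℤ (homComp k ℓ e p) i
        ≡⟨ cong₂ (λ r s → u * r + v * s) (coeffℤ-homComp-above e p len (suc i) (ℕP.m<n⇒m<1+n e<i))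
                                          (coeffℤ-homComp-above e p len i e<i) ⟩
      u * + 0 + v * + 0                                       ≡⟨ cong₂ _+_ (ℤP.*-zeroʳ u) (ℤP.*-zeroʳ v) ⟩
      + 0                                                     ∎
      where open ≡-Reasoning

    coeffℤ-homComp-top : ∀ e p → length p ℕ.≤ suc e → coeffℤ (homComp k ℓ e p) e ≡ coeffℤ p e * v ^ e
    coeffℤ-homComp-top e       []          _         = sym (ℤP.*-zeroˡ (v ^ e))
    coeffℤ-homComp-top zero    (a ∷ [])    _         = ℤP.+-identityʳ _
    coeffℤ-homComp-top zero    (a ∷ b ∷ p) (s≤s ())
    coeffℤ-homComp-top (suc e) (a ∷ p)     (s≤s len) = begin
      coeffℤ (homComp k ℓ (suc e) (a ∷ p)) (suc e)            ≡⟨ coeffℤ-homComp-suc e a p e ⟩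
      u * coeffℤ (homComp k ℓ e p) (suc e) + v * coeffℤ (homComp k ℓ e p) e
        ≡⟨ cong₂ (λ r s → u * r + v * s) (coeffℤ-homComp-above e p len (suc e) (ℕP.n<1+n e))
                                          (coeffℤ-homComp-top e p len) ⟩
      u * + 0 + v * (coeffℤ p e * v ^ e)                      ≡⟨ ring u v (coeffℤ p e) (v ^ e) ⟩
      coeffℤ p e * (v * v ^ e)                                ∎
      where
      open ≡-Reasoning
      ring : ∀ u v c V → u * + 0 + v * (c * V) ≡ c * (v * V)
      ring = solve-∀

  coeffℤ-take-< : ∀ n p i → i ℕ.< n → coeffℤ (take n p) i ≡ coeffℤ p i
  coeffℤ-take-< (suc n) []      i       _         = refl
  coeffℤ-take-< (suc n) (a ∷ p) zero    _         = refl
  coeffℤ-take-< (suc n) (a ∷ p) (suc i) (s≤s i<n) = coeffℤ-take-< n p i i<n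

  coeffℤ-take-≥ : ∀ n p i → n ℕ.≤ i → coeffℤ (take n p) i ≡ + 0
  coeffℤ-take-≥ zero    p       i       _         = refl
  coeffℤ-take-≥ (suc n) []      i       _         = refl
  coeffℤ-take-≥ (suc n) (a ∷ p) (suc i) (s≤s n≤i) = coeffℤ-take-≥ n p i n≤i

  coeffℤ-truncate : ∀ p d → HasDegree p d → ∀ i → coeffℤ (take (suc d) p) i ≡ coeffℤ p i
  coeffℤ-truncate p d (_ , above) i with ℕP.≤-<-connex i d
  ... | inj₁ i≤d = coeffℤ-take-< (suc d) p i (s≤s i≤d)
  ... | inj₂ d<i = trans (coeffℤ-take-≥ (suc d) p i d<i) (sym (above i d<i))

  hasDegree-cong : ∀ p r {d} → (∀ i → coeffℤ p i ≡ coeffℤ r i) → HasDegree p d → HasDegree r d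
  hasDegree-cong p r {d} p≗r (top , above) = (λ eq → top (trans (p≗r d) eq)) , (λ t d<t → trans (sym (p≗r t)) (above t d<t))

  coeffℤ-neg : ∀ p i → coeffℤ (map -_ p) i ≡ - coeffℤ p i
  coeffℤ-neg []      i       = refl
  coeffℤ-neg (a ∷ p) zero    = refl
  coeffℤ-neg (a ∷ p) (suc i) = coeffℤ-neg p i

  hasDegree-neg : ∀ p {d} → HasDegree p d → HasDegree (map -_ p) d
  hasDegree-neg p {d} (top , above) =
    (λ eq → top (trans (sym (ℤP.neg-involutive _)) (trans (cong -_ (trans (sym (coeffℤ-neg p d)) eq)) refl))) ,
    (λ t d<t → trans (coeffℤ-neg p t) (cong -_ (above t d<t)))

  evalℤ-neg : ∀ p x → evalℤ (map -_ p) x ≡ - evalℤ p x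
  evalℤ-neg []      x = refl
  evalℤ-neg (a ∷ p) x rewrite evalℤ-neg p x = ring a x (evalℤ p x)
    where
    ring : ∀ a x P → - a + x * - P ≡ - (a + x * P)
    ring = solve-∀

module RationalPolynomials where

  open import Data.Nat as ℕ using (ℕ; zero; suc; s≤s)
  open import Data.Integer as ℤ using (ℤ; +_; -[1+_]; ∣_∣)
  import Data.Integer.Properties as ℤP
  open import Data.Rational as ℚ using (ℚ; mkℚ; 0ℚ; 1ℚ; _+_; _*_; _-_; -_; 1/_)
  import Data.Rational.Properties as ℚP
  open import Data.List using (List; []; _∷_; map; length)
  open import Data.Maybe using (Maybe; nothing; just)
  open import Level using (0ℓ)
  open import Relation.Nullary using (yes; no)
  open import Relation.Binary.PropositionalEquality
  import Data.Nat.Coprimality as Coprimality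
  import Tactic.RingSolver as RingSolver
  open import Tactic.RingSolver.Core.AlmostCommutativeRing using (AlmostCommutativeRing; fromCommutativeRing)
  open import Algebra.Bundles using (CommutativeRing)
  open import Algebra.Properties.CommutativeSemiring.Exp (CommutativeRing.commutativeSemiring ℚP.+-*-commutativeRing) public using (_^_; ^-distrib-*)
  open import Algebra.Properties.Group ℚP.+-0-group using (x∙y⁻¹≈ε⇒x≈y)
  open import Defs
  open IntegerPolynomials

  ℚ-ring : AlmostCommutativeRing 0ℓ 0ℓ
  ℚ-ring = fromCommutativeRing ℚP.+-*-commutativeRing isZero
    where
    isZero : ∀ x → Maybe (0ℚ ≡ x)
    isZero x with 0ℚ ℚP.≟ x
    ... | yes p = just p
    ... | no _  = nothing

  x-y≡0⇒x≡y : ∀ x y → x - y ≡ 0ℚ → x ≡ y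
  x-y≡0⇒x≡y = x∙y⁻¹≈ε⇒x≈y

  x*y≡0⇒y≡0 : ∀ x y → x ≢ 0ℚ → x * y ≡ 0ℚ → y ≡ 0ℚ
  x*y≡0⇒y≡0 x y x≢0 xy≡0 = begin
    y                  ≡⟨ sym (ℚP.*-identityˡ y) ⟩
    1ℚ * y             ≡⟨ cong (_* y) (sym (ℚP.*-inverseˡ x)) ⟩
    1/ x * x * y       ≡⟨ ℚP.*-assoc (1/ x) x y ⟩
    1/ x * (x * y)     ≡⟨ cong (1/ x *_) xy≡0 ⟩
    1/ x * 0ℚ          ≡⟨ ℚP.*-zeroʳ (1/ x) ⟩
    0ℚ                 ∎
    where
    open ≡-Reasoning
    instance _ = ℚ.≢-nonZero x≢0

  *-cancelˡ-≢0 : ∀ x {y z} → x ≢ 0ℚ → x * y ≡ x * z → y ≡ z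
  *-cancelˡ-≢0 x {y} {z} x≢0 xy≡xz = x-y≡0⇒x≡y y z (x*y≡0⇒y≡0 x (y - z) x≢0 (begin
    x * (y - z)         ≡⟨ ring x y z ⟩
    x * y - x * z       ≡⟨ cong (_- x * z) xy≡xz ⟩
    x * z - x * z       ≡⟨ ℚP.+-inverseʳ (x * z) ⟩
    0ℚ                  ∎))
    where
    open ≡-Reasoning
    ring : ∀ x y z → x * (y - z) ≡ x * y - x * z
    ring = RingSolver.solve-∀ ℚ-ring

  1^n≡1 : ∀ n → 1ℚ ^ n ≡ 1ℚ
  1^n≡1 zero    = refl
  1^n≡1 (suc n) = trans (ℚP.*-identityˡ _) (1^n≡1 n)

  ι : ℤ → ℚ
  ι = ℤ→ℚ

  coprime-1 : ∀ n → Coprimality.Coprime n 1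
  coprime-1 n = Coprimality.sym (Coprimality.1-coprimeTo n)

  ι-mkℚ : ∀ z → ι z ≡ mkℚ z 0 (coprime-1 ∣ z ∣)
  ι-mkℚ (+ n)    = ℚP.normalize-coprime (coprime-1 n)
  ι-mkℚ -[1+ n ] = cong -_ (ℚP.normalize-coprime (coprime-1 (suc n)))

  ι-+ : ∀ x y → ι (x ℤ.+ y) ≡ ι x + ι y
  ι-+ x y rewrite ι-mkℚ x | ι-mkℚ y = ℚP./-cong {p₁ = x ℤ.+ y} {q₁ = 1}
    (sym (cong₂ ℤ._+_ (ℤP.*-identityʳ x) (ℤP.*-identityʳ y))) refl

  ι-* : ∀ x y → ι (x ℤ.* y) ≡ ι x * ι y
  ι-* x y rewrite ι-mkℚ x | ι-mkℚ y = refl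

  ι-neg : ∀ x → ι (ℤ.- x) ≡ - ι x
  ι-neg x = begin
    ι (ℤ.- x)              ≡⟨ ring (ι (ℤ.- x)) (ι x) ⟩
    ι (ℤ.- x) + ι x - ι x  ≡⟨ cong (_- ι x) (sym (ι-+ (ℤ.- x) x)) ⟩
    ι (ℤ.- x ℤ.+ x) - ι x  ≡⟨ cong (λ z → ι z - ι x) (ℤP.+-inverseˡ x) ⟩
    0ℚ - ι x               ≡⟨ ℚP.+-identityˡ (- ι x) ⟩
    - ι x                  ∎
    where
    open ≡-Reasoning
    ring : ∀ a b → a ≡ a + b - b
    ring = RingSolver.solve-∀ ℚ-ring

  ι-injective : ∀ {x y} → ι x ≡ ι y → x ≡ y
  ι-injective {x} {y} eq = cong ℚ.↥_ (trans (sym (ι-mkℚ x)) (trans eq (ι-mkℚ y)))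

  ι-^ : ∀ x n → ι (x ℤ.^ n) ≡ ι x ^ n
  ι-^ x zero    = refl
  ι-^ x (suc n) = trans (ι-* x (x ℤ.^ n)) (cong (ι x *_) (ι-^ x n))

  ι-+^ : ∀ x n → ι (+ (x ℕ.^ n)) ≡ ι (+ x) ^ n
  ι-+^ x n = trans (cong ι (sym (+-^ x n))) (ι-^ (+ x) n)

  ι-pos≢0 : ∀ n → 1 ℕ.≤ n → ι (+ n) ≢ 0ℚ
  ι-pos≢0 (suc n) _ eq with ι-injective {+ suc n} {+ 0} eq
  ... | ()

  evalQ : List ℚ → ℚ → ℚ
  evalQ []      x = 0ℚ
  evalQ (a ∷ p) x = a + x * evalQ p x

  evalQ-padd : ∀ p q x → evalQ (padd p q) x ≡ evalQ p x + evalQ q x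
  evalQ-padd []      q       x = sym (ℚP.+-identityˡ _)
  evalQ-padd (a ∷ p) []      x = sym (ℚP.+-identityʳ _)
  evalQ-padd (a ∷ p) (b ∷ q) x rewrite evalQ-padd p q x = ring a b x (evalQ p x) (evalQ q x)
    where
    ring : ∀ a b x P Q → a + b + x * (P + Q) ≡ a + x * P + (b + x * Q)
    ring = RingSolver.solve-∀ ℚ-ring

  evalQ-scale : ∀ s p x → evalQ (map (s *_) p) x ≡ s * evalQ p x
  evalQ-scale s []      x = sym (ℚP.*-zeroʳ s)
  evalQ-scale s (a ∷ p) x rewrite evalQ-scale s p x = ring s a x (evalQ p x)
    where
    ring : ∀ s a x P → s * a + x * (s * P) ≡ s * (a + x * P)
    ring = RingSolver.solve-∀ ℚ-ring

  evalQ-pmul : ∀ p q x → evalQ (pmul p q) x ≡ evalQ p x * evalQ q x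
  evalQ-pmul []      q x = sym (ℚP.*-zeroˡ (evalQ q x))
  evalQ-pmul (a ∷ p) q x
    rewrite evalQ-padd (map (a *_) q) (0ℚ ∷ pmul p q) x | evalQ-scale a q x | evalQ-pmul p q x
    = ring a x (evalQ p x) (evalQ q x)
    where
    ring : ∀ a x P Q → a * Q + (0ℚ + x * (P * Q)) ≡ (a + x * P) * Q
    ring = RingSolver.solve-∀ ℚ-ring

  evalQ-allZero : ∀ p x → (∀ i → coeffℚ p i ≡ 0ℚ) → evalQ p x ≡ 0ℚ
  evalQ-allZero []      x z = refl
  evalQ-allZero (a ∷ p) x z rewrite z 0 | evalQ-allZero p x (λ i → z (suc i)) | ℚP.*-zeroʳ x = refl

  evalQ-cong-coeff : ∀ p r y → (∀ i → coeffℚ p i ≡ coeffℚ r i) → evalQ p y ≡ evalQ r y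
  evalQ-cong-coeff []      r       y h = sym (evalQ-allZero r y (λ i → sym (h i)))
  evalQ-cong-coeff (a ∷ p) []      y h = evalQ-allZero (a ∷ p) y h
  evalQ-cong-coeff (a ∷ p) (b ∷ r) y h =
    cong₂ (λ u v → u + y * v) (h 0) (evalQ-cong-coeff p r y (λ i → h (suc i)))

  coeffℚ-padd : ∀ p q i → coeffℚ (padd p q) i ≡ coeffℚ p i + coeffℚ q i
  coeffℚ-padd []      q       i       = sym (ℚP.+-identityˡ _)
  coeffℚ-padd (a ∷ p) []      zero    = sym (ℚP.+-identityʳ _)
  coeffℚ-padd (a ∷ p) []      (suc i) = sym (ℚP.+-identityʳ _)
  coeffℚ-padd (a ∷ p) (b ∷ q) zero    = refl
  coeffℚ-padd (a ∷ p) (b ∷ q) (suc i) = coeffℚ-padd p q i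

  coeffℚ-scale : ∀ s p i → coeffℚ (map (s *_) p) i ≡ s * coeffℚ p i
  coeffℚ-scale s []      i       = sym (ℚP.*-zeroʳ s)
  coeffℚ-scale s (a ∷ p) zero    = refl
  coeffℚ-scale s (a ∷ p) (suc i) = coeffℚ-scale s p i

  toℚpoly-padd : ∀ p q → toℚpoly (paddℤ p q) ≡ padd (toℚpoly p) (toℚpoly q)
  toℚpoly-padd []      q       = refl
  toℚpoly-padd (a ∷ p) []      = refl
  toℚpoly-padd (a ∷ p) (b ∷ q) = cong₂ _∷_ (ι-+ a b) (toℚpoly-padd p q)

  toℚpoly-scale : ∀ s p → toℚpoly (map (s ℤ.*_) p) ≡ map (ι s *_) (toℚpoly p)
  toℚpoly-scale s []      = refl
  toℚpoly-scale s (a ∷ p) = cong₂ _∷_ (ι-* s a) (toℚpoly-scale s p)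

  toℚpoly-pmul : ∀ p q → toℚpoly (pmulℤ p q) ≡ pmul (toℚpoly p) (toℚpoly q)
  toℚpoly-pmul []      q = refl
  toℚpoly-pmul (a ∷ p) q = trans (toℚpoly-padd (map (a ℤ.*_) q) (+ 0 ∷ pmulℤ p q))
    (cong₂ padd (toℚpoly-scale a q) (cong (0ℚ ∷_) (toℚpoly-pmul p q)))

  coeffℚ-toℚpoly : ∀ p i → coeffℚ (toℚpoly p) i ≡ ι (coeffℤ p i)
  coeffℚ-toℚpoly []      i       = refl
  coeffℚ-toℚpoly (a ∷ p) zero    = refl
  coeffℚ-toℚpoly (a ∷ p) (suc i) = coeffℚ-toℚpoly p i

  evalQ-toℚpoly-ι : ∀ p x → evalQ (toℚpoly p) (ι x) ≡ ι (evalℤ p x)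
  evalQ-toℚpoly-ι []      x = refl
  evalQ-toℚpoly-ι (a ∷ p) x rewrite evalQ-toℚpoly-ι p x =
    sym (trans (ι-+ a _) (cong (λ z → ι a + z) (ι-* x (evalℤ p x))))

  module _ (p q : List ℤ) (y : ℚ) where

    evalQ-toℚpoly-padd : evalQ (toℚpoly (paddℤ p q)) y ≡ evalQ (toℚpoly p) y + evalQ (toℚpoly q) y
    evalQ-toℚpoly-padd = trans (cong (λ r → evalQ r y) (toℚpoly-padd p q)) (evalQ-padd (toℚpoly p) (toℚpoly q) y)

    evalQ-toℚpoly-pmul : evalQ (toℚpoly (pmulℤ p q)) y ≡ evalQ (toℚpoly p) y * evalQ (toℚpoly q) y
    evalQ-toℚpoly-pmul = trans (cong (λ r → evalQ r y) (toℚpoly-pmul p q)) (evalQ-pmul (toℚpoly p) (toℚpoly q) y)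

  evalQ-toℚpoly-scale : ∀ s p y → evalQ (toℚpoly (map (s ℤ.*_) p)) y ≡ ι s * evalQ (toℚpoly p) y
  evalQ-toℚpoly-scale s p y = trans (cong (λ r → evalQ r y) (toℚpoly-scale s p)) (evalQ-scale (ι s) (toℚpoly p) y)

  evalQ-homComp : ∀ k ℓ e p y t → length p ℕ.≤ suc e → ι (+ k) * t ≡ evalQ (toℚpoly ℓ) y →
    evalQ (toℚpoly (homComp k ℓ e p)) y ≡ ι (+ (k ℕ.^ e)) * evalQ (toℚpoly p) t
  evalQ-homComp k ℓ e       []          y t _ _ = sym (ℚP.*-zeroʳ (ι (+ (k ℕ.^ e))))
  evalQ-homComp k ℓ zero    (a ∷ [])    y t _ _ = begin
    evalQ (toℚpoly (homComp k ℓ 0 (a ∷ []))) y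
      ≡⟨ evalQ-toℚpoly-padd (a ℤ.* + 1 ∷ []) (pmulℤ ℓ []) y ⟩
    ι (a ℤ.* + 1) + y * 0ℚ + evalQ (toℚpoly (pmulℤ ℓ [])) y
      ≡⟨ cong₂ (λ u v → u + y * 0ℚ + v) (ι-* a (+ 1)) (evalQ-toℚpoly-pmul ℓ [] y) ⟩
    ι a * 1ℚ + y * 0ℚ + evalQ (toℚpoly ℓ) y * 0ℚ
      ≡⟨ ring (ι a) y t (evalQ (toℚpoly ℓ) y) ⟩
    1ℚ * (ι a + t * 0ℚ) ∎
    where
    open ≡-Reasoning
    ring : ∀ a y t L → a * 1ℚ + y * 0ℚ + L * 0ℚ ≡ 1ℚ * (a + t * 0ℚ)
    ring = RingSolver.solve-∀ ℚ-ring
  evalQ-homComp k ℓ zero    (a ∷ b ∷ p) y t (s≤s ()) _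
  evalQ-homComp k ℓ (suc e) (a ∷ p)     y t (s≤s len) ℓ[y]≡kt = begin
    evalQ (toℚpoly (homComp k ℓ (suc e) (a ∷ p))) y
      ≡⟨ evalQ-toℚpoly-padd (a ℤ.* + (k ℕ.^ suc e) ∷ []) (pmulℤ ℓ r) y ⟩
    ι (a ℤ.* + (k ℕ.^ suc e)) + y * 0ℚ + evalQ (toℚpoly (pmulℤ ℓ r)) y
      ≡⟨ cong₂ (λ u v → u + y * 0ℚ + v) (trans (ι-* a _) (cong (ι a *_) ι[kᵉ⁺¹])) (evalQ-toℚpoly-pmul ℓ r y) ⟩
    ι a * (K * Kᵉ) + y * 0ℚ + evalQ (toℚpoly ℓ) y * evalQ (toℚpoly r) y
      ≡⟨ cong₂ (λ u v → ι a * (K * Kᵉ) + y * 0ℚ + u * v) (sym ℓ[y]≡kt) (evalQ-homComp k ℓ e p y t len ℓ[y]≡kt) ⟩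
    ι a * (K * Kᵉ) + y * 0ℚ + K * t * (Kᵉ * evalQ (toℚpoly p) t)
      ≡⟨ ring (ι a) y t K Kᵉ (evalQ (toℚpoly p) t) ⟩
    K * Kᵉ * (ι a + t * evalQ (toℚpoly p) t)
      ≡⟨ cong (_* evalQ (toℚpoly (a ∷ p)) t) (sym ι[kᵉ⁺¹]) ⟩
    ι (+ (k ℕ.^ suc e)) * evalQ (toℚpoly (a ∷ p)) t ∎
    where
    open ≡-Reasoning
    r = homComp k ℓ e p
    K = ι (+ k)
    Kᵉ = ι (+ (k ℕ.^ e))
    ι[kᵉ⁺¹] : ι (+ (k ℕ.^ suc e)) ≡ K * Kᵉ
    ι[kᵉ⁺¹] = trans (cong ι (ℤP.pos-* k (k ℕ.^ e))) (ι-* (+ k) (+ (k ℕ.^ e)))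
    ring : ∀ a y t K Kᵉ P → a * (K * Kᵉ) + y * 0ℚ + K * t * (Kᵉ * P) ≡ K * Kᵉ * (a + t * P)
    ring = RingSolver.solve-∀ ℚ-ring

  evalQ-toℚpoly-neg : ∀ p y → evalQ (toℚpoly (map ℤ.-_ p)) y ≡ - evalQ (toℚpoly p) y
  evalQ-toℚpoly-neg []      y = refl
  evalQ-toℚpoly-neg (a ∷ p) y rewrite evalQ-toℚpoly-neg p y | ι-neg a = ring (ι a) y (evalQ (toℚpoly p) y)
    where
    ring : ∀ a y P → - a + y * - P ≡ - (a + y * P)
    ring = RingSolver.solve-∀ ℚ-ring

module AffineInvariance where

  open import Data.Nat as ℕ using (ℕ; zero; suc; z≤n; s≤s)
  import Data.Nat.Properties as ℕP
  import Data.Integer.Properties as ℤP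
  open import Data.Rational as ℚ using (ℚ; 0ℚ; 1ℚ; _+_; _*_; _-_; -_; 1/_)
  import Data.Rational.Properties as ℚP
  open import Data.List using (List; []; _∷_; map; length)
  open import Data.Product using (_×_; _,_; Σ; proj₁; proj₂)
  open import Relation.Nullary using (¬_)
  open import Relation.Binary.PropositionalEquality
  import Tactic.RingSolver as RingSolver
  open import Defs
  open RationalPolynomials

  divide : ℚ → List ℚ → List ℚ × ℚ
  divide a []          = [] , 0ℚ
  divide a (c ∷ [])    = [] , c
  divide a (c ∷ d ∷ p) with divide a (d ∷ p)
  ... | quo , rem = rem ∷ quo , c + a * rem

  quotient : ℚ → List ℚ → List ℚ
  quotient a p = proj₁ (divide a p)

  remainder : ℚ → List ℚ → ℚ
  remainder a p = proj₂ (divide a p)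

  evalQ-divide : ∀ a p x → evalQ p x ≡ (x - a) * evalQ (quotient a p) x + remainder a p
  evalQ-divide a []          x = sym (trans (ℚP.+-identityʳ _) (ℚP.*-zeroʳ (x - a)))
  evalQ-divide a (c ∷ [])    x = ring a c x
    where
    ring : ∀ a c x → c + x * 0ℚ ≡ (x - a) * 0ℚ + c
    ring = RingSolver.solve-∀ ℚ-ring
  evalQ-divide a (c ∷ d ∷ p) x rewrite evalQ-divide a (d ∷ p) x =
    ring a c x (evalQ (quotient a (d ∷ p)) x) (remainder a (d ∷ p))
    where
    ring : ∀ a c x Q r → c + x * ((x - a) * Q + r) ≡ (x - a) * (r + x * Q) + (c + a * r)
    ring = RingSolver.solve-∀ ℚ-ring

  coeffℚ-divide-zero : ∀ a p → coeffℚ p 0 ≡ remainder a p - a * coeffℚ (quotient a p) 0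
  coeffℚ-divide-zero a []          = sym (cong (λ z → 0ℚ - z) (ℚP.*-zeroʳ a))
  coeffℚ-divide-zero a (c ∷ [])    = sym (trans (cong (λ z → c - z) (ℚP.*-zeroʳ a)) (ℚP.+-identityʳ c))
  coeffℚ-divide-zero a (c ∷ d ∷ p) = ring a c (remainder a (d ∷ p))
    where
    ring : ∀ a c r → c ≡ c + a * r - a * r
    ring = RingSolver.solve-∀ ℚ-ring

  coeffℚ-divide-suc : ∀ a p i → coeffℚ p (suc i) ≡ coeffℚ (quotient a p) i - a * coeffℚ (quotient a p) (suc i)
  coeffℚ-divide-suc a []          i       = sym (cong (λ z → 0ℚ - z) (ℚP.*-zeroʳ a))
  coeffℚ-divide-suc a (c ∷ [])    i       = sym (cong (λ z → 0ℚ - z) (ℚP.*-zeroʳ a))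
  coeffℚ-divide-suc a (c ∷ d ∷ p) zero    = coeffℚ-divide-zero a (d ∷ p)
  coeffℚ-divide-suc a (c ∷ d ∷ p) (suc i) = coeffℚ-divide-suc a (d ∷ p) i

  length-quotient : ∀ a c p → length (quotient a (c ∷ p)) ≡ length p
  length-quotient a c []      = refl
  length-quotient a c (d ∷ p) = cong suc (length-quotient a d p)

  ℕ→ℚ-injective : ∀ {m n} → ℕ→ℚ m ≡ ℕ→ℚ n → m ≡ n
  ℕ→ℚ-injective eq = ℤP.+-injective (ι-injective eq)

  -- Induction on the length: the remainder at N is p(N) = 0, and the quotient
  -- vanishes from N + 1 on.
  vanishesFrom⇒zero : ∀ n p N → length p ℕ.≤ n → (∀ m → N ℕ.≤ m → evalQ p (ℕ→ℚ m) ≡ 0ℚ) →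
                      ∀ i → coeffℚ p i ≡ 0ℚ
  vanishesFrom⇒zero n       []      N _         _     i = refl
  vanishesFrom⇒zero zero    (c ∷ p) N ()        _     i
  vanishesFrom⇒zero (suc n) (c ∷ p) N (s≤s len) roots = coeffs
    where
    a = ℕ→ℚ N
    quo = quotient a (c ∷ p)
    rem = remainder a (c ∷ p)
    rem≡0 : rem ≡ 0ℚ
    rem≡0 = begin
      rem                           ≡⟨ sym (ℚP.+-identityˡ rem) ⟩
      0ℚ + rem                      ≡⟨ cong (_+ rem) (sym (ℚP.*-zeroˡ (evalQ quo a))) ⟩
      0ℚ * evalQ quo a + rem        ≡⟨ cong (λ z → z * evalQ quo a + rem) (sym (ℚP.+-inverseʳ a)) ⟩
      (a - a) * evalQ quo a + rem   ≡⟨ sym (evalQ-divide a (c ∷ p) a) ⟩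
      evalQ (c ∷ p) a               ≡⟨ roots N ℕP.≤-refl ⟩
      0ℚ                            ∎
      where open ≡-Reasoning
    quo-roots : ∀ m → suc N ℕ.≤ m → evalQ quo (ℕ→ℚ m) ≡ 0ℚ
    quo-roots m N<m = x*y≡0⇒y≡0 (ℕ→ℚ m - a) (evalQ quo (ℕ→ℚ m))
      (λ eq → ℕP.<-irrefl (sym (ℕ→ℚ-injective (x-y≡0⇒x≡y _ _ eq))) N<m)
      (begin
        (ℕ→ℚ m - a) * evalQ quo (ℕ→ℚ m)         ≡⟨ sym (ℚP.+-identityʳ _) ⟩
        (ℕ→ℚ m - a) * evalQ quo (ℕ→ℚ m) + 0ℚ    ≡⟨ cong (λ z → (ℕ→ℚ m - a) * evalQ quo (ℕ→ℚ m) + z) (sym rem≡0) ⟩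
        (ℕ→ℚ m - a) * evalQ quo (ℕ→ℚ m) + rem   ≡⟨ sym (evalQ-divide a (c ∷ p) (ℕ→ℚ m)) ⟩
        evalQ (c ∷ p) (ℕ→ℚ m)                  ≡⟨ roots m (ℕP.<⇒≤ N<m) ⟩
        0ℚ                                     ∎)
      where open ≡-Reasoning
    quo≡0 : ∀ i → coeffℚ quo i ≡ 0ℚ
    quo≡0 = vanishesFrom⇒zero n quo (suc N) (ℕP.≤-trans (ℕP.≤-reflexive (length-quotient a c p)) len) quo-roots
    combine : ∀ {x y} → x ≡ 0ℚ → y ≡ 0ℚ → x - a * y ≡ 0ℚ
    combine refl refl = cong (λ z → 0ℚ - z) (ℚP.*-zeroʳ a)
    coeffs : ∀ i → coeffℚ (c ∷ p) i ≡ 0ℚ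
    coeffs zero    = trans (coeffℚ-divide-zero a (c ∷ p)) (combine rem≡0 (quo≡0 0))
    coeffs (suc i) = trans (coeffℚ-divide-suc a (c ∷ p) i) (combine (quo≡0 i) (quo≡0 (suc i)))

  vanishes⇒zero : ∀ p → (∀ x → evalQ p x ≡ 0ℚ) → ∀ i → coeffℚ p i ≡ 0ℚ
  vanishes⇒zero p roots = vanishesFrom⇒zero (length p) p 0 ℕP.≤-refl (λ m _ → roots (ℕ→ℚ m))

  evalQ-ext⇒≈ₚ : ∀ p q → (∀ x → evalQ p x ≡ evalQ q x) → p ≈ₚ q
  evalQ-ext⇒≈ₚ p q eq k = begin
    coeffℚ p k                                        ≡⟨ ring (coeffℚ p k) (coeffℚ q k) ⟩
    coeffℚ p k + - 1ℚ * coeffℚ q k + coeffℚ q k       ≡⟨ cong (_+ coeffℚ q k) diff≡0 ⟩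
    0ℚ + coeffℚ q k                                   ≡⟨ ℚP.+-identityˡ _ ⟩
    coeffℚ q k                                        ∎
    where
    open ≡-Reasoning
    ring : ∀ a b → a ≡ a + - 1ℚ * b + b
    ring = RingSolver.solve-∀ ℚ-ring
    cancel : ∀ a → a + - 1ℚ * a ≡ 0ℚ
    cancel = RingSolver.solve-∀ ℚ-ring
    diff = padd p (map (- 1ℚ *_) q)
    roots : ∀ x → evalQ diff x ≡ 0ℚ
    roots x = trans (evalQ-padd p (map (- 1ℚ *_) q) x)
      (trans (cong (λ z → evalQ p x + z) (evalQ-scale (- 1ℚ) q x))
      (trans (cong (λ z → evalQ p x + - 1ℚ * z) (sym (eq x))) (cancel (evalQ p x))))
    diff≡0 : coeffℚ p k + - 1ℚ * coeffℚ q k ≡ 0ℚ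
    diff≡0 = trans (sym (trans (coeffℚ-padd p (map (- 1ℚ *_) q) k) (cong (λ z → coeffℚ p k + z) (coeffℚ-scale (- 1ℚ) q k))))
                   (vanishes⇒zero diff roots k)

  shift : ℚ → List ℚ → List ℚ
  shift y₀ []      = []
  shift y₀ (a ∷ p) = padd (a ∷ []) (pmul (y₀ ∷ 1ℚ ∷ []) (shift y₀ p))

  evalQ-shift : ∀ y₀ p z → evalQ (shift y₀ p) z ≡ evalQ p (y₀ + z)
  evalQ-shift y₀ []      z = refl
  evalQ-shift y₀ (a ∷ p) z
    rewrite evalQ-padd (a ∷ []) (pmul (y₀ ∷ 1ℚ ∷ []) (shift y₀ p)) z
          | evalQ-pmul (y₀ ∷ 1ℚ ∷ []) (shift y₀ p) z
          | evalQ-shift y₀ p z = ring a z y₀ (evalQ p (y₀ + z))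
    where
    ring : ∀ a z y₀ P → a + z * 0ℚ + (y₀ + z * (1ℚ + z * 0ℚ)) * P ≡ a + (y₀ + z) * P
    ring = RingSolver.solve-∀ ℚ-ring

  dilate : ℚ → List ℚ → List ℚ
  dilate ρ []      = []
  dilate ρ (a ∷ p) = a ∷ map (ρ *_) (dilate ρ p)

  evalQ-dilate : ∀ ρ p z → evalQ (dilate ρ p) z ≡ evalQ p (ρ * z)
  evalQ-dilate ρ []      z = refl
  evalQ-dilate ρ (a ∷ p) z rewrite evalQ-scale ρ (dilate ρ p) z | evalQ-dilate ρ p z =
    ring a z ρ (evalQ p (ρ * z))
    where
    ring : ∀ a z ρ P → a + z * (ρ * P) ≡ a + ρ * z * P
    ring = RingSolver.solve-∀ ℚ-ring

  coeffℚ-dilate : ∀ ρ p i → coeffℚ (dilate ρ p) i ≡ ρ ^ i * coeffℚ p i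
  coeffℚ-dilate ρ []      i       = sym (ℚP.*-zeroʳ (ρ ^ i))
  coeffℚ-dilate ρ (a ∷ p) zero    = sym (ℚP.*-identityˡ a)
  coeffℚ-dilate ρ (a ∷ p) (suc i) rewrite coeffℚ-scale ρ (dilate ρ p) i | coeffℚ-dilate ρ p i =
    sym (ℚP.*-assoc ρ (ρ ^ i) (coeffℚ p i))

  evalQ-monomial : ∀ p D z → (∀ i → i ≢ D → coeffℚ p i ≡ 0ℚ) → evalQ p z ≡ coeffℚ p D * z ^ D
  evalQ-monomial []      D       z _ = sym (ℚP.*-zeroˡ (z ^ D))
  evalQ-monomial (a ∷ p) zero    z h
    rewrite evalQ-allZero p z (λ i → h (suc i) (λ ())) | ℚP.*-zeroʳ z | ℚP.*-identityʳ a = ℚP.+-identityʳ a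
  evalQ-monomial (a ∷ p) (suc D) z h
    rewrite h 0 (λ ()) | evalQ-monomial p D z (λ i i≢D → h (suc i) (λ e → i≢D (ℕP.suc-injective e))) =
    ring z (coeffℚ p D) (z ^ D)
    where
    ring : ∀ z c P → 0ℚ + z * (c * P) ≡ c * (z * P)
    ring = RingSolver.solve-∀ ℚ-ring

  ppow : List ℚ → ℕ → List ℚ
  ppow g zero    = 1ℚ ∷ []
  ppow g (suc n) = pmul g (ppow g n)

  evalQ-ppow : ∀ g n z → evalQ (ppow g n) z ≡ evalQ g z ^ n
  evalQ-ppow g zero    z = trans (cong (1ℚ +_) (ℚP.*-zeroʳ z)) (ℚP.+-identityʳ 1ℚ)
  evalQ-ppow g (suc n) z = trans (evalQ-pmul g (ppow g n) z) (cong (evalQ g z *_) (evalQ-ppow g n z))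

  ShiftedPower : ℕ → List ℚ → Set
  ShiftedPower D P = Σ ℚ λ c → Σ ℚ λ y₀ → ∀ y → evalQ P y ≡ c * (y - y₀) ^ D

  -- c (y - y₀)^D is divisible by the square of y - y₀.
  squarefree⇒¬shiftedPower : ∀ P {D} → SquarefreeQ P → 2 ℕ.≤ D → ¬ ShiftedPower D P
  squarefree⇒¬shiftedPower P {suc zero}    _      (s≤s ())
  squarefree⇒¬shiftedPower P {suc (suc e)} sqfree _ (c , y₀ , P≡) =
    sqfree g (1 , s≤s z≤n , λ ()) (h , evalQ-ext⇒≈ₚ (pmul (pmul g g) h) P evals)
    where
    g = - y₀ ∷ 1ℚ ∷ []
    h = map (c *_) (ppow g e)
    evalQ-g : ∀ y → evalQ g y ≡ y - y₀
    evalQ-g y = ring y y₀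
      where
      ring : ∀ y y₀ → - y₀ + y * (1ℚ + y * 0ℚ) ≡ y - y₀
      ring = RingSolver.solve-∀ ℚ-ring
    evals : ∀ y → evalQ (pmul (pmul g g) (map (c *_) (ppow g e))) y ≡ evalQ P y
    evals y = begin
      evalQ (pmul (pmul g g) (map (c *_) (ppow g e))) y
        ≡⟨ evalQ-pmul (pmul g g) h y ⟩
      evalQ (pmul g g) y * evalQ (map (c *_) (ppow g e)) y
        ≡⟨ cong₂ _*_ (evalQ-pmul g g y) (trans (evalQ-scale c (ppow g e) y) (cong (c *_) (evalQ-ppow g e y))) ⟩
      evalQ g y * evalQ g y * (c * evalQ g y ^ e)
        ≡⟨ ring (evalQ g y) c (evalQ g y ^ e) ⟩
      c * evalQ g y ^ suc (suc e)
        ≡⟨ cong (λ z → c * z ^ suc (suc e)) (evalQ-g y) ⟩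
      c * (y - y₀) ^ suc (suc e)
        ≡⟨ sym (P≡ y) ⟩
      evalQ P y ∎
      where
      open ≡-Reasoning
      ring : ∀ G c P → G * G * (c * P) ≡ c * (G * (G * P))
      ring = RingSolver.solve-∀ ℚ-ring

  dilation-eigen⇒sparse : ∀ G ρ q → (∀ z → evalQ G (ρ * z) ≡ q * evalQ G z) →
                          ∀ i → ρ ^ i ≢ q → coeffℚ G i ≡ 0ℚ
  dilation-eigen⇒sparse G ρ q eigen i ρⁱ≢q =
    x*y≡0⇒y≡0 (ρ ^ i - q) (coeffℚ G i) (λ eq → ρⁱ≢q (x-y≡0⇒x≡y _ _ eq)) (begin
      (ρ ^ i - q) * coeffℚ G i                              ≡⟨ ring (ρ ^ i) q (coeffℚ G i) ⟩
      ρ ^ i * coeffℚ G i + - q * coeffℚ G i                 ≡⟨ cong₂ _+_ (sym (coeffℚ-dilate ρ G i)) (sym (coeffℚ-scale (- q) G i)) ⟩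
      coeffℚ (dilate ρ G) i + coeffℚ (map (- q *_) G) i     ≡⟨ sym (coeffℚ-padd (dilate ρ G) (map (- q *_) G) i) ⟩
      coeffℚ Ψ i                                            ≡⟨ vanishes⇒zero Ψ Ψ-roots i ⟩
      0ℚ                                                    ∎)
    where
    open ≡-Reasoning
    Ψ = padd (dilate ρ G) (map (- q *_) G)
    ring : ∀ r q g → (r - q) * g ≡ r * g + - q * g
    ring = RingSolver.solve-∀ ℚ-ring
    cancel : ∀ q g → q * g + - q * g ≡ 0ℚ
    cancel = RingSolver.solve-∀ ℚ-ring
    Ψ-roots : ∀ z → evalQ Ψ z ≡ 0ℚ
    Ψ-roots z = begin
      evalQ Ψ z                                           ≡⟨ evalQ-padd (dilate ρ G) (map (- q *_) G) z ⟩
      evalQ (dilate ρ G) z + evalQ (map (- q *_) G) z     ≡⟨ cong₂ _+_ (evalQ-dilate ρ G z) (evalQ-scale (- q) G z) ⟩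
      evalQ G (ρ * z) + - q * evalQ G z                   ≡⟨ cong (_+ - q * evalQ G z) (eigen z) ⟩
      q * evalQ G z + - q * evalQ G z                     ≡⟨ cancel q (evalQ G z) ⟩
      0ℚ                                                  ∎

  -- Conjugating by a translation to the fixed point y₀ of y ↦ ρ y + s turns the
  -- affine substitution into the dilation z ↦ ρ z.
  affine-eigen⇒shiftedPower : ∀ P ρ s q D → ρ ≢ 1ℚ → (∀ i → i ≢ D → ρ ^ i ≢ q) →
                              (∀ y → evalQ P (ρ * y + s) ≡ q * evalQ P y) → ShiftedPower D P
  affine-eigen⇒shiftedPower P ρ s q D ρ≢1 ρⁱ≢q eigen = coeffℚ G D , y₀ , P≡
    where
    open ≡-Reasoning
    1-ρ≢0 : 1ℚ - ρ ≢ 0ℚ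
    1-ρ≢0 eq = ρ≢1 (sym (x-y≡0⇒x≡y 1ℚ ρ eq))
    instance _ = ℚ.≢-nonZero 1-ρ≢0
    y₀ = s * 1/ (1ℚ - ρ)
    fixed : ρ * y₀ + s ≡ y₀
    fixed = begin
      ρ * y₀ + s                                    ≡⟨ cong (ρ * y₀ +_) (sym (ℚP.*-identityʳ s)) ⟩
      ρ * y₀ + s * 1ℚ                               ≡⟨ cong (λ z → ρ * y₀ + s * z) (sym (ℚP.*-inverseˡ (1ℚ - ρ))) ⟩
      ρ * y₀ + s * (1/ (1ℚ - ρ) * (1ℚ - ρ))         ≡⟨ ring ρ s (1/ (1ℚ - ρ)) ⟩
      y₀                                            ∎
      where
      ring : ∀ ρ s i → ρ * (s * i) + s * (i * (1ℚ - ρ)) ≡ s * i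
      ring = RingSolver.solve-∀ ℚ-ring
    G = shift y₀ P
    G-eigen : ∀ z → evalQ G (ρ * z) ≡ q * evalQ G z
    G-eigen z = begin
      evalQ G (ρ * z)            ≡⟨ evalQ-shift y₀ P (ρ * z) ⟩
      evalQ P (y₀ + ρ * z)       ≡⟨ cong (λ y → evalQ P (y + ρ * z)) (sym fixed) ⟩
      evalQ P (ρ * y₀ + s + ρ * z) ≡⟨ cong (evalQ P) (ring ρ y₀ s z) ⟩
      evalQ P (ρ * (y₀ + z) + s) ≡⟨ eigen (y₀ + z) ⟩
      q * evalQ P (y₀ + z)       ≡⟨ cong (q *_) (sym (evalQ-shift y₀ P z)) ⟩
      q * evalQ G z              ∎
      where
      ring : ∀ ρ y₀ s z → ρ * y₀ + s + ρ * z ≡ ρ * (y₀ + z) + s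
      ring = RingSolver.solve-∀ ℚ-ring
    P≡ : ∀ y → evalQ P y ≡ coeffℚ G D * (y - y₀) ^ D
    P≡ y = begin
      evalQ P y                  ≡⟨ cong (evalQ P) (ring y y₀) ⟩
      evalQ P (y₀ + (y - y₀))    ≡⟨ sym (evalQ-shift y₀ P (y - y₀)) ⟩
      evalQ G (y - y₀)           ≡⟨ evalQ-monomial G D (y - y₀) (λ i i≢D → dilation-eigen⇒sparse G ρ q G-eigen i (ρⁱ≢q i i≢D)) ⟩
      coeffℚ G D * (y - y₀) ^ D  ∎
      where
      ring : ∀ y y₀ → y ≡ y₀ + (y - y₀)
      ring = RingSolver.solve-∀ ℚ-ring

  shiftedPower-cong : ∀ D P P′ → (∀ y → evalQ P′ y ≡ evalQ P y) → ShiftedPower D P → ShiftedPower D P′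
  shiftedPower-cong D P P′ P′≗P (c , y₀ , P≡) = c , y₀ , λ y → trans (P′≗P y) (P≡ y)

  shiftedPower-neg : ∀ D P P′ → (∀ y → evalQ P′ y ≡ - evalQ P y) → ShiftedPower D P → ShiftedPower D P′
  shiftedPower-neg D P P′ P′≗-P (c , y₀ , P≡) = - c , y₀ , λ y →
    trans (P′≗-P y) (trans (cong -_ (P≡ y)) (ℚP.neg-distribˡ-* c ((y - y₀) ^ D)))

module AuxiliaryPolynomials where

  open import Data.Nat as ℕ using (ℕ; suc; z≤n; s≤s)
  import Data.Nat.Properties as ℕP
  import Data.Nat.Tactic.RingSolver as ℕSolver
  open import Data.Integer as ℤ using (ℤ; +_)
  import Data.Integer.Properties as ℤP
  open import Data.Integer.Tactic.RingSolver using (solve-∀)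
  open import Data.Rational as ℚ using (ℚ; mkℚ; 0ℚ; 1ℚ; _+_; _*_; _-_; -_; 1/_)
  import Data.Rational.Properties as ℚP
  import Data.Rational.Unnormalised as ℚᵘ
  import Data.Rational.Unnormalised.Properties as ℚᵘP
  open import Data.List using (List; []; _∷_; map; length)
  open import Data.Empty using (⊥-elim)
  open import Relation.Nullary using (¬_)
  open import Relation.Binary.Definitions using (tri<; tri≈; tri>)
  open import Relation.Binary.PropositionalEquality
  import Tactic.RingSolver as RingSolver
  open import Defs
  open IntegerPolynomials
  open RationalPolynomials
  open AffineInvariance

  ^-cancelʳ-≡ : ∀ e {m n} → m ℕ.^ suc e ≡ n ℕ.^ suc e → m ≡ n
  ^-cancelʳ-≡ e {m} {n} eq with ℕP.<-cmp m n
  ... | tri< m<n _ _ = ⊥-elim (ℕP.<-irrefl eq (ℕP.^-monoˡ-< (suc e) m<n))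
  ... | tri≈ _ m≡n _ = m≡n
  ... | tri> _ _ n<m = ⊥-elim (ℕP.<-irrefl (sym eq) (ℕP.^-monoˡ-< (suc e) n<m))

  ^-cross-cancel< : ∀ {i D} j k → i ℕ.< D → 1 ℕ.≤ j → 1 ℕ.≤ k →
                    j ℕ.^ i ℕ.* k ℕ.^ D ≡ j ℕ.^ D ℕ.* k ℕ.^ i → j ≡ k
  ^-cross-cancel< {i} {D} j k i<D j≥1 k≥1 eq = sym (^-cancelʳ-≡ e
    (ℕP.*-cancelˡ-≡ _ _ (j ℕ.^ i ℕ.* k ℕ.^ i)
      {{ℕP.m*n≢0 _ _ {{ℕP.m^n≢0 j i {{ℕ.>-nonZero j≥1}}}} {{ℕP.m^n≢0 k i {{ℕ.>-nonZero k≥1}}}}}}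
      (begin
        j ℕ.^ i ℕ.* k ℕ.^ i ℕ.* k ℕ.^ suc e   ≡⟨ ring (j ℕ.^ i) (k ℕ.^ i) (k ℕ.^ suc e) ⟩
        j ℕ.^ i ℕ.* (k ℕ.^ i ℕ.* k ℕ.^ suc e) ≡⟨ cong (j ℕ.^ i ℕ.*_) (sym (ℕP.^-distribˡ-+-* k i (suc e))) ⟩
        j ℕ.^ i ℕ.* k ℕ.^ (i ℕ.+ suc e)       ≡⟨ cong (λ d → j ℕ.^ i ℕ.* k ℕ.^ d) D≡ ⟩
        j ℕ.^ i ℕ.* k ℕ.^ D                   ≡⟨ eq ⟩
        j ℕ.^ D ℕ.* k ℕ.^ i                   ≡⟨ cong (λ d → j ℕ.^ d ℕ.* k ℕ.^ i) (sym D≡) ⟩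
        j ℕ.^ (i ℕ.+ suc e) ℕ.* k ℕ.^ i       ≡⟨ cong (ℕ._* k ℕ.^ i) (ℕP.^-distribˡ-+-* j i (suc e)) ⟩
        j ℕ.^ i ℕ.* j ℕ.^ suc e ℕ.* k ℕ.^ i   ≡⟨ ring′ (j ℕ.^ i) (j ℕ.^ suc e) (k ℕ.^ i) ⟩
        j ℕ.^ i ℕ.* k ℕ.^ i ℕ.* j ℕ.^ suc e   ∎)))
    where
    open ≡-Reasoning
    e = D ℕ.∸ suc i
    D≡ : i ℕ.+ suc e ≡ D
    D≡ = trans (ℕP.+-suc i e) (ℕP.m+[n∸m]≡n i<D)
    ring : ∀ A B C → A ℕ.* B ℕ.* C ≡ A ℕ.* (B ℕ.* C)
    ring = ℕSolver.solve-∀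
    ring′ : ∀ A C B → A ℕ.* C ℕ.* B ≡ A ℕ.* B ℕ.* C
    ring′ = ℕSolver.solve-∀

  ^-cross-cancel : ∀ {i D} j k → i ≢ D → 1 ℕ.≤ j → 1 ℕ.≤ k →
                   j ℕ.^ i ℕ.* k ℕ.^ D ≡ j ℕ.^ D ℕ.* k ℕ.^ i → j ≡ k
  ^-cross-cancel {i} {D} j k i≢D j≥1 k≥1 eq with ℕP.<-cmp i D
  ... | tri< i<D _ _ = ^-cross-cancel< j k i<D j≥1 k≥1 eq
  ... | tri≈ _ i≡D _ = ⊥-elim (i≢D i≡D)
  ... | tri> _ _ D<i = ^-cross-cancel< j k D<i j≥1 k≥1 (sym eq)

  q*↧q≡↥q : ∀ q → q * ι (ℚ.↧ q) ≡ ι (ℚ.↥ q)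
  q*↧q≡↥q q@(mkℚ n d _) rewrite ι-mkℚ (+ suc d) | ι-mkℚ n =
    ℚP.toℚᵘ-injective (ℚᵘP.≃-trans (ℚP.toℚᵘ-homo-* q (mkℚ (+ suc d) 0 (coprime-1 (suc d)))) (ℚᵘ.*≡* eq))
    where
    eq : (n ℤ.* + suc d) ℤ.* + 1 ≡ n ℤ.* + suc (d ℕ.* 1)
    eq rewrite ℕP.*-identityʳ d = ℤP.*-identityʳ (n ℤ.* + suc d)

  line : ℤ → ℕ → List ℤ
  line w j = ℤ.- w ∷ + j ∷ []

  module AuxiliaryPolynomial (F : List ℤ) (D : ℕ) (lenF : length F ℕ.≤ suc D) (q : ℚ) where

    a : ℤ
    a = ℚ.↥ q

    b : ℕ
    b = ℚ.↧ₙ q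

    q*b≡a : q * ι (+ b) ≡ ι a
    q*b≡a = q*↧q≡↥q q

    -- Q j k w (y) = b k^D F((j y - w) / k) - a k^D F(y): an integer root n of Q
    -- comes from every solution b F(m) = a F(n) with k m = j n - w.
    Q : ℕ → ℕ → ℤ → List ℤ
    Q j k w = paddℤ (map (+ b ℤ.*_) (homComp k (line w j) D F)) (map (ℤ.- (a ℤ.* + (k ℕ.^ D)) ℤ.*_) F)

    Fq : ℚ → ℚ
    Fq = evalQ (toℚpoly F)

    evalQ-Q : ∀ j k w y t → ι (+ k) * t ≡ evalQ (toℚpoly (line w j)) y →
              evalQ (toℚpoly (Q j k w)) y ≡ ι (+ (k ℕ.^ D)) * (ι (+ b) * Fq t - ι a * Fq y)
    evalQ-Q j k w y t kt≡line = begin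
      evalQ (toℚpoly (Q j k w)) y
        ≡⟨ evalQ-toℚpoly-padd (map (+ b ℤ.*_) H) (map (ℤ.- (a ℤ.* K) ℤ.*_) F) y ⟩
      evalQ (toℚpoly (map (+ b ℤ.*_) H)) y + evalQ (toℚpoly (map (ℤ.- (a ℤ.* K) ℤ.*_) F)) y
        ≡⟨ cong₂ _+_ (evalQ-toℚpoly-scale (+ b) H y) (evalQ-toℚpoly-scale (ℤ.- (a ℤ.* K)) F y) ⟩
      ι (+ b) * evalQ (toℚpoly H) y + ι (ℤ.- (a ℤ.* K)) * Fq y
        ≡⟨ cong₂ (λ u v → ι (+ b) * u + v * Fq y) (evalQ-homComp k (line w j) D F y t lenF kt≡line)
                                                   (trans (ι-neg (a ℤ.* K)) (cong -_ (ι-* a K))) ⟩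
      ι (+ b) * (ι K * Fq t) + - (ι a * ι K) * Fq y
        ≡⟨ ring (ι (+ b)) (ι K) (Fq t) (ι a) (Fq y) ⟩
      ι K * (ι (+ b) * Fq t - ι a * Fq y) ∎
      where
      open ≡-Reasoning
      H = homComp k (line w j) D F
      K = + (k ℕ.^ D)
      ring : ∀ B K X A Y → B * (K * X) + - (A * K) * Y ≡ K * (B * X - A * Y)
      ring = RingSolver.solve-∀ ℚ-ring

    Q-root : ∀ j k w m n → + b ℤ.* evalℤ F (+ m) ≡ a ℤ.* evalℤ F (+ n) →
             + k ℤ.* + m ≡ evalℤ (line w j) (+ n) → evalℤ (Q j k w) (+ n) ≡ + 0
    Q-root j k w m n sol km≡line = ι-injective (begin
      ι (evalℤ (Q j k w) (+ n))                    ≡⟨ sym (evalQ-toℚpoly-ι (Q j k w) (+ n)) ⟩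
      evalQ (toℚpoly (Q j k w)) (ι (+ n))          ≡⟨ evalQ-Q j k w (ι (+ n)) (ι (+ m)) kt≡line ⟩
      K * (ι (+ b) * Fq (ι (+ m)) - ι a * Fq (ι (+ n)))
        ≡⟨ cong₂ (λ u v → K * (ι (+ b) * u - ι a * v)) (evalQ-toℚpoly-ι F (+ m)) (evalQ-toℚpoly-ι F (+ n)) ⟩
      K * (ι (+ b) * ι (evalℤ F (+ m)) - ι a * ι (evalℤ F (+ n)))
        ≡⟨ cong (λ u → K * (u - ι a * ι (evalℤ F (+ n))))
                (trans (sym (ι-* (+ b) (evalℤ F (+ m)))) (trans (cong ι sol) (ι-* a (evalℤ F (+ n))))) ⟩
      K * (ι a * ι (evalℤ F (+ n)) - ι a * ι (evalℤ F (+ n)))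
        ≡⟨ cong (K *_) (ℚP.+-inverseʳ (ι a * ι (evalℤ F (+ n)))) ⟩
      K * 0ℚ                                       ≡⟨ ℚP.*-zeroʳ K ⟩
      0ℚ                                           ∎)
      where
      open ≡-Reasoning
      K = ι (+ (k ℕ.^ D))
      kt≡line : ι (+ k) * ι (+ m) ≡ evalQ (toℚpoly (line w j)) (ι (+ n))
      kt≡line = trans (sym (ι-* (+ k) (+ m))) (trans (cong ι km≡line) (sym (evalQ-toℚpoly-ι (line w j) (+ n))))

    coeffℤ-Q-top : ∀ j k w → coeffℤ (Q j k w) D ≡ coeffℤ F D ℤ.* (+ b ℤ.* (+ j) ℤ.^ D ℤ.- a ℤ.* + (k ℕ.^ D))
    coeffℤ-Q-top j k w = begin
      coeffℤ (Q j k w) D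
        ≡⟨ coeffℤ-padd (map (+ b ℤ.*_) H) (map (ℤ.- (a ℤ.* K) ℤ.*_) F) D ⟩
      coeffℤ (map (+ b ℤ.*_) H) D ℤ.+ coeffℤ (map (ℤ.- (a ℤ.* K) ℤ.*_) F) D
        ≡⟨ cong₂ ℤ._+_ (coeffℤ-scale (+ b) H D) (coeffℤ-scale (ℤ.- (a ℤ.* K)) F D) ⟩
      + b ℤ.* coeffℤ H D ℤ.+ ℤ.- (a ℤ.* K) ℤ.* coeffℤ F D
        ≡⟨ cong (λ u → + b ℤ.* u ℤ.+ ℤ.- (a ℤ.* K) ℤ.* coeffℤ F D) (coeffℤ-homComp-top k (ℤ.- w) (+ j) D F lenF) ⟩
      + b ℤ.* (coeffℤ F D ℤ.* (+ j) ℤ.^ D) ℤ.+ ℤ.- (a ℤ.* K) ℤ.* coeffℤ F D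
        ≡⟨ ring (+ b) (coeffℤ F D) ((+ j) ℤ.^ D) a K ⟩
      coeffℤ F D ℤ.* (+ b ℤ.* (+ j) ℤ.^ D ℤ.- a ℤ.* K) ∎
      where
      open ≡-Reasoning
      H = homComp k (line w j) D F
      K = + (k ℕ.^ D)
      ring : ∀ B c J A K → B ℤ.* (c ℤ.* J) ℤ.+ ℤ.- (A ℤ.* K) ℤ.* c ≡ c ℤ.* (B ℤ.* J ℤ.- A ℤ.* K)
      ring = solve-∀

    module _ {j k : ℕ} {w : ℤ} (q≢1 : q ≢ 1ℚ) (c≢0 : coeffℤ F D ≢ + 0) (j≥1 : 1 ℕ.≤ j) (k≥1 : 1 ℕ.≤ k)
             (Q≡0 : ∀ i → coeffℤ (Q j k w) i ≡ + 0) where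

      private
        instance
          k≢0 : ℚ.NonZero (ι (+ k))
          k≢0 = ℚ.≢-nonZero (ι-pos≢0 k k≥1)
        open ≡-Reasoning
        b≢0 = ι-pos≢0 b (s≤s z≤n)
        kᴰ≢0 = ι-pos≢0 (k ℕ.^ D) (ℕP.m^n>0 k {{ℕ.>-nonZero k≥1}} D)

      ρ s : ℚ
      ρ = ι (+ j) * 1/ ι (+ k)
      s = ι (ℤ.- w) * 1/ ι (+ k)

      j≡ρk : ι (+ j) ≡ ρ * ι (+ k)
      j≡ρk = sym (trans (ℚP.*-assoc (ι (+ j)) _ _) (trans (cong (ι (+ j) *_) (ℚP.*-inverseˡ (ι (+ k)))) (ℚP.*-identityʳ _)))

      F-eigen : ∀ y → Fq (ρ * y + s) ≡ q * Fq y
      F-eigen y = *-cancelˡ-≢0 (ι (+ b)) b≢0 (begin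
        ι (+ b) * Fq t         ≡⟨ x-y≡0⇒x≡y _ _ (x*y≡0⇒y≡0 _ _ kᴰ≢0 (trans (sym (evalQ-Q j k w y t kt≡line)) Q[y]≡0)) ⟩
        ι a * Fq y             ≡⟨ cong (_* Fq y) (sym q*b≡a) ⟩
        q * ι (+ b) * Fq y     ≡⟨ ring q (ι (+ b)) (Fq y) ⟩
        ι (+ b) * (q * Fq y)   ∎)
        where
        t = ρ * y + s
        ring : ∀ q B X → q * B * X ≡ B * (q * X)
        ring = RingSolver.solve-∀ ℚ-ring
        ring′ : ∀ K κ J W y → K * (J * κ * y + W * κ) ≡ K * κ * (W + y * (J + y * 0ℚ))
        ring′ = RingSolver.solve-∀ ℚ-ring
        kt≡line : ι (+ k) * t ≡ evalQ (toℚpoly (line w j)) y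
        kt≡line = trans (ring′ (ι (+ k)) (1/ ι (+ k)) (ι (+ j)) (ι (ℤ.- w)) y)
                        (trans (cong (_* evalQ (toℚpoly (line w j)) y) (ℚP.*-inverseʳ (ι (+ k)))) (ℚP.*-identityˡ _))
        Q[y]≡0 : evalQ (toℚpoly (Q j k w)) y ≡ 0ℚ
        Q[y]≡0 = evalQ-allZero (toℚpoly (Q j k w)) y (λ i → trans (coeffℚ-toℚpoly (Q j k w) i) (cong ι (Q≡0 i)))

      b*jᴰ≡a*kᴰ : + b ℤ.* (+ j) ℤ.^ D ≡ a ℤ.* + (k ℕ.^ D)
      b*jᴰ≡a*kᴰ = ℤP.i-j≡0⇒i≡j _ _ (ℤP.*-cancelˡ-≡ (coeffℤ F D) _ (+ 0) {{ℤ.≢-nonZero c≢0}}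
        (trans (sym (coeffℤ-Q-top j k w)) (trans (Q≡0 D) (sym (ℤP.*-zeroʳ (coeffℤ F D))))))

      ρᴰ≡q : ρ ^ D ≡ q
      ρᴰ≡q = *-cancelˡ-≢0 (ι (+ b)) b≢0 (begin
        ι (+ b) * ρ ^ D                                      ≡⟨ cong (ι (+ b) *_) (^-distrib-* (ι (+ j)) κ D) ⟩
        ι (+ b) * (ι (+ j) ^ D * κ ^ D)                      ≡⟨ sym (ℚP.*-assoc (ι (+ b)) _ _) ⟩
        ι (+ b) * ι (+ j) ^ D * κ ^ D                        ≡⟨ cong (λ u → ι (+ b) * u * κ ^ D) (sym (ι-^ (+ j) D)) ⟩
        ι (+ b) * ι ((+ j) ℤ.^ D) * κ ^ D                    ≡⟨ cong (_* κ ^ D) (sym (ι-* (+ b) ((+ j) ℤ.^ D))) ⟩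
        ι (+ b ℤ.* (+ j) ℤ.^ D) * κ ^ D                      ≡⟨ cong (λ u → ι u * κ ^ D) b*jᴰ≡a*kᴰ ⟩
        ι (a ℤ.* + (k ℕ.^ D)) * κ ^ D                        ≡⟨ cong (_* κ ^ D) (trans (ι-* a (+ (k ℕ.^ D))) (cong (ι a *_) (ι-+^ k D))) ⟩
        ι a * ι (+ k) ^ D * κ ^ D                            ≡⟨ ℚP.*-assoc (ι a) _ _ ⟩
        ι a * (ι (+ k) ^ D * κ ^ D)                          ≡⟨ cong (ι a *_) (sym (^-distrib-* (ι (+ k)) κ D)) ⟩
        ι a * (ι (+ k) * κ) ^ D                              ≡⟨ cong (λ u → ι a * u ^ D) (ℚP.*-inverseʳ (ι (+ k))) ⟩
        ι a * 1ℚ ^ D                                         ≡⟨ cong (ι a *_) (1^n≡1 D) ⟩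
        ι a * 1ℚ                                             ≡⟨ ℚP.*-identityʳ (ι a) ⟩
        ι a                                                  ≡⟨ trans (sym q*b≡a) (ℚP.*-comm q _) ⟩
        ι (+ b) * q                                          ∎)
        where κ = 1/ ι (+ k)

      ρ≢1 : ρ ≢ 1ℚ
      ρ≢1 ρ≡1 = q≢1 (trans (sym ρᴰ≡q) (trans (cong (_^ D) ρ≡1) (1^n≡1 D)))

      ρⁱ≢q : ∀ i → i ≢ D → ρ ^ i ≢ q
      ρⁱ≢q i i≢D ρⁱ≡q = ρ≢1 (begin
        ρ                      ≡⟨ cong (λ x → ι (+ x) * 1/ ι (+ k)) j≡k ⟩
        ι (+ k) * 1/ ι (+ k)   ≡⟨ ℚP.*-inverseʳ (ι (+ k)) ⟩
        1ℚ                     ∎)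
        where
        K = ι (+ k)
        ι-^*^ : ∀ x y m n → ι (+ (x ℕ.^ m ℕ.* y ℕ.^ n)) ≡ ι (+ x) ^ m * ι (+ y) ^ n
        ι-^*^ x y m n = trans (cong ι (ℤP.pos-* (x ℕ.^ m) (y ℕ.^ n)))
                              (trans (ι-* (+ (x ℕ.^ m)) (+ (y ℕ.^ n))) (cong₂ _*_ (ι-+^ x m) (ι-+^ y n)))
        ring : ∀ R A B → R * A * B ≡ R * B * A
        ring = RingSolver.solve-∀ ℚ-ring
        cross : ι (+ (j ℕ.^ i ℕ.* k ℕ.^ D)) ≡ ι (+ (j ℕ.^ D ℕ.* k ℕ.^ i))
        cross = begin
          ι (+ (j ℕ.^ i ℕ.* k ℕ.^ D))  ≡⟨ ι-^*^ j k i D ⟩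
          ι (+ j) ^ i * K ^ D          ≡⟨ cong (λ u → u ^ i * K ^ D) j≡ρk ⟩
          (ρ * K) ^ i * K ^ D          ≡⟨ cong (_* K ^ D) (^-distrib-* ρ K i) ⟩
          ρ ^ i * K ^ i * K ^ D        ≡⟨ cong (λ u → u * K ^ i * K ^ D) (trans ρⁱ≡q (sym ρᴰ≡q)) ⟩
          ρ ^ D * K ^ i * K ^ D        ≡⟨ ring (ρ ^ D) (K ^ i) (K ^ D) ⟩
          ρ ^ D * K ^ D * K ^ i        ≡⟨ cong (_* K ^ i) (sym (^-distrib-* ρ K D)) ⟩
          (ρ * K) ^ D * K ^ i          ≡⟨ cong (λ u → u ^ D * K ^ i) (sym j≡ρk) ⟩
          ι (+ j) ^ D * K ^ i          ≡⟨ sym (ι-^*^ j k D i) ⟩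
          ι (+ (j ℕ.^ D ℕ.* k ℕ.^ i))  ∎
        j≡k : j ≡ k
        j≡k = ^-cross-cancel j k i≢D j≥1 k≥1 (ℤP.+-injective (ι-injective cross))

      shiftedPower : ShiftedPower D (toℚpoly F)
      shiftedPower = affine-eigen⇒shiftedPower (toℚpoly F) ρ s q D ρ≢1 ρⁱ≢q F-eigen

    Q≢0 : q ≢ 1ℚ → coeffℤ F D ≢ + 0 → ¬ ShiftedPower D (toℚpoly F) →
          ∀ {j k w} → 1 ℕ.≤ j → 1 ℕ.≤ k → ¬ (∀ i → coeffℤ (Q j k w) i ≡ + 0)
    Q≢0 q≢1 c≢0 ¬power j≥1 k≥1 Q≡0 = ¬power (shiftedPower q≢1 c≢0 j≥1 k≥1 Q≡0)

module Growth where

  open import Data.Nat as ℕ using (ℕ; zero; suc; z≤n; s≤s; _≤_; _<_; _+_; _*_; _^_; _∸_)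
  import Data.Nat.Properties as ℕP
  import Data.Nat.Tactic.RingSolver as ℕSolver
  open import Data.Integer as ℤ using (ℤ; +_; -[1+_]; ∣_∣)
  import Data.Integer.Properties as ℤP
  open import Data.Integer.Tactic.RingSolver using (solve-∀)
  open import Data.List using (List; take)
  open import Data.Sum using (inj₁; inj₂)
  open import Relation.Nullary using (contradiction)
  open import Relation.Binary.Definitions using (tri<; tri≈; tri>)
  open import Relation.Binary.PropositionalEquality
  open import Defs using (evalℤ; coeffℤ)
  open IntegerPolynomials

  ^-distribʳ-* : ∀ x y n → (x * y) ^ n ≡ x ^ n * y ^ n
  ^-distribʳ-* x y zero    = refl
  ^-distribʳ-* x y (suc n) rewrite ^-distribʳ-* x y n = ring x y (x ^ n) (y ^ n)
    where
    ring : ∀ x y X Y → x * y * (X * Y) ≡ x * X * (y * Y)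
    ring = ℕSolver.solve-∀

  m≤m^[1+n] : ∀ m n → 1 ≤ m → m ≤ m ^ suc n
  m≤m^[1+n] m n m≥1 = ℕP.m≤m*n m (m ^ n) {{ℕ.>-nonZero (ℕP.m^n>0 m {{ℕ.>-nonZero m≥1}} n)}}

  ^-root-≤ : ∀ e m n L → 1 ≤ L → m ^ suc e ≤ L * n ^ suc e → m ≤ L * n
  ^-root-≤ e m n L L≥1 h with ℕP.≤-<-connex m (L * n)
  ... | inj₁ m≤Ln = m≤Ln
  ... | inj₂ Ln<m = contradiction h (ℕP.<⇒≱ (begin-strict
    L * n ^ suc e          ≤⟨ ℕP.*-monoˡ-≤ (n ^ suc e) (m≤m^[1+n] L e L≥1) ⟩
    L ^ suc e * n ^ suc e  ≡⟨ sym (^-distribʳ-* L n (suc e)) ⟩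
    (L * n) ^ suc e        <⟨ ℕP.^-monoˡ-< (suc e) Ln<m ⟩
    m ^ suc e              ∎))
    where
    open ℕP.≤-Reasoning

  [x+d]^[1+t]-lower : ∀ t x d → x ^ suc t + d * (x + d) ^ t ≤ (x + d) ^ suc t
  [x+d]^[1+t]-lower t x d = begin
    x * x ^ t + d * (x + d) ^ t       ≤⟨ ℕP.+-monoˡ-≤ _ (ℕP.*-monoʳ-≤ x (ℕP.^-monoˡ-≤ t (ℕP.m≤m+n x d))) ⟩
    x * (x + d) ^ t + d * (x + d) ^ t ≡⟨ sym (ℕP.*-distribʳ-+ ((x + d) ^ t) x d) ⟩
    (x + d) ^ suc t                   ∎
    where open ℕP.≤-Reasoning

  [x+d]^[1+t]-upper : ∀ t x d → (x + d) ^ suc t ≤ x ^ suc t + suc t * d * (x + d) ^ t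
  [x+d]^[1+t]-upper zero    x d = ℕP.≤-reflexive (ring x d)
    where
    ring : ∀ x d → (x + d) * 1 ≡ x * 1 + 1 * d * 1
    ring = ℕSolver.solve-∀
  [x+d]^[1+t]-upper (suc t) x d = begin
    (x + d) * (x + d) ^ suc t
      ≤⟨ ℕP.*-monoʳ-≤ (x + d) ([x+d]^[1+t]-upper t x d) ⟩
    (x + d) * (x ^ suc t + suc t * d * (x + d) ^ t)
      ≡⟨ ring x d (x ^ suc t) t ((x + d) ^ t) ⟩
    x * x ^ suc t + d * x ^ suc t + suc t * d * ((x + d) * (x + d) ^ t)
      ≤⟨ ℕP.+-monoˡ-≤ _ (ℕP.+-monoʳ-≤ (x * x ^ suc t) (ℕP.*-monoʳ-≤ d (ℕP.^-monoˡ-≤ (suc t) (ℕP.m≤m+n x d)))) ⟩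
    x * x ^ suc t + d * (x + d) ^ suc t + suc t * d * (x + d) ^ suc t
      ≡⟨ ring′ (x * x ^ suc t) d ((x + d) ^ suc t) t ⟩
    x ^ suc (suc t) + suc (suc t) * d * (x + d) ^ suc t ∎
    where
    open ℕP.≤-Reasoning
    ring : ∀ x d X t P → (x + d) * (X + suc t * d * P) ≡ x * X + d * X + suc t * d * ((x + d) * P)
    ring = ℕSolver.solve-∀
    ring′ : ∀ A d Q t → A + d * Q + suc t * d * Q ≡ A + suc (suc t) * d * Q
    ring′ = ℕSolver.solve-∀

  0≤r+B : ∀ r B → ∣ r ∣ ≤ B → + 0 ℤ.≤ r ℤ.+ + B
  0≤r+B (+ n)    B _    = ℤ.+≤+ z≤n
  0≤r+B -[1+ n ] B ∣r∣≤B rewrite ℤP.⊖-≥ ∣r∣≤B = ℤ.+≤+ z≤n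

  r≤B : ∀ r B → ∣ r ∣ ≤ B → r ℤ.≤ + B
  r≤B (+ n)    B ∣r∣≤B = ℤ.+≤+ ∣r∣≤B
  r≤B -[1+ n ] B _     = ℤ.-≤+

  module _ (r : ℤ) (T X Y : ℕ) {B} (∣r∣≤B : ∣ r ∣ ≤ B) (Y-X≡r+T : + Y ℤ.- + X ≡ r ℤ.+ + T) where

    +Y-+X≡r+T⇒X+T≤Y+B : X + T ≤ Y + B
    +Y-+X≡r+T⇒X+T≤Y+B = ℤP.drop‿+≤+ (begin
      + (X + T)                 ≡⟨ ℤP.pos-+ X T ⟩
      + X ℤ.+ + T               ≡⟨ sym (ℤP.+-identityʳ _) ⟩
      + X ℤ.+ + T ℤ.+ + 0       ≤⟨ ℤP.+-monoʳ-≤ (+ X ℤ.+ + T) (0≤r+B r B ∣r∣≤B) ⟩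
      + X ℤ.+ + T ℤ.+ (r ℤ.+ + B) ≡⟨ ring (+ X) (+ T) r (+ B) ⟩
      + X ℤ.+ (r ℤ.+ + T) ℤ.+ + B ≡⟨ cong (λ z → + X ℤ.+ z ℤ.+ + B) (sym Y-X≡r+T) ⟩
      + X ℤ.+ (+ Y ℤ.- + X) ℤ.+ + B ≡⟨ ring′ (+ X) (+ Y) (+ B) ⟩
      + Y ℤ.+ + B               ≡⟨ sym (ℤP.pos-+ Y B) ⟩
      + (Y + B)                 ∎)
      where
      open ℤP.≤-Reasoning
      ring : ∀ X T r B → X ℤ.+ T ℤ.+ (r ℤ.+ B) ≡ X ℤ.+ (r ℤ.+ T) ℤ.+ B
      ring = solve-∀
      ring′ : ∀ X Y B → X ℤ.+ (Y ℤ.- X) ℤ.+ B ≡ Y ℤ.+ B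
      ring′ = solve-∀

    +Y-+X≡r+T⇒Y≤X+T+B : Y ≤ X + T + B
    +Y-+X≡r+T⇒Y≤X+T+B = ℤP.drop‿+≤+ (begin
      + Y                       ≡⟨ ring (+ X) (+ Y) ⟩
      + X ℤ.+ (+ Y ℤ.- + X)     ≡⟨ cong (λ z → + X ℤ.+ z) Y-X≡r+T ⟩
      + X ℤ.+ (r ℤ.+ + T)       ≡⟨ ring′ (+ X) r (+ T) ⟩
      + X ℤ.+ + T ℤ.+ r         ≤⟨ ℤP.+-monoʳ-≤ (+ X ℤ.+ + T) (r≤B r B ∣r∣≤B) ⟩
      + X ℤ.+ + T ℤ.+ + B       ≡⟨ cong (ℤ._+ + B) (sym (ℤP.pos-+ X T)) ⟩
      + (X + T) ℤ.+ + B         ≡⟨ sym (ℤP.pos-+ (X + T) B) ⟩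
      + (X + T + B)             ∎)
      where
      open ℤP.≤-Reasoning
      ring : ∀ X Y → Y ≡ X ℤ.+ (Y ℤ.- X)
      ring = solve-∀
      ring′ : ∀ X r T → X ℤ.+ (r ℤ.+ T) ≡ X ℤ.+ T ℤ.+ r
      ring′ = solve-∀

  m≤n+o⇒2o≤m⇒m≤2n : ∀ {m} n o → m ≤ n + o → 2 * o ≤ m → m ≤ 2 * n
  m≤n+o⇒2o≤m⇒m≤2n {m} n o m≤n+o 2o≤m = ℕP.+-cancelʳ-≤ m m (2 * n) (begin
    m + m              ≤⟨ ℕP.+-mono-≤ m≤n+o m≤n+o ⟩
    (n + o) + (n + o)  ≡⟨ ring n o ⟩
    2 * n + 2 * o      ≤⟨ ℕP.+-monoʳ-≤ (2 * n) 2o≤m ⟩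
    2 * n + m          ∎)
    where
    open ℕP.≤-Reasoning
    ring : ∀ n o → (n + o) + (n + o) ≡ 2 * n + 2 * o
    ring = ℕSolver.solve-∀

  module GrowthOf (F : List ℤ) (e c : ℕ) (deg : HasDegree F (suc (suc e))) (lead : coeffℤ F (suc (suc e)) ≡ + suc c) where

    D lc : ℕ
    D = suc (suc e)
    lc = suc c

    R : List ℤ
    R = take D F

    C : ℕ
    C = sumAbs R

    Fv Rv : ℕ → ℤ
    Fv x = evalℤ F (+ x)
    Rv x = evalℤ R (+ x)

    f : ℕ → ℕ
    f x = ∣ Fv x ∣

    Fv≡Rv+lcxᴰ : ∀ x → Fv x ≡ Rv x ℤ.+ + (lc * x ^ D)
    Fv≡Rv+lcxᴰ x = trans (evalℤ-leading F D (+ x) deg) (cong (λ z → Rv x ℤ.+ z) (begin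
      (+ x) ℤ.^ D ℤ.* coeffℤ F D  ≡⟨ cong₂ ℤ._*_ (+-^ x D) lead ⟩
      + (x ^ D) ℤ.* + lc          ≡⟨ sym (ℤP.pos-* (x ^ D) lc) ⟩
      + (x ^ D * lc)              ≡⟨ cong +_ (ℕP.*-comm (x ^ D) lc) ⟩
      + (lc * x ^ D)              ∎))
      where open ≡-Reasoning

    x₀ : ℕ
    x₀ = suc (2 * (C * D))

    x₀≤x⇒1≤x : ∀ {x} → x₀ ≤ x → 1 ≤ x
    x₀≤x⇒1≤x {suc x} _ = s≤s z≤n

    ∣Rv∣≤ : ∀ x → x₀ ≤ x → ∣ Rv x ∣ ≤ C * x ^ suc e
    ∣Rv∣≤ x x₀≤x = ∣evalℤ∣≤sumAbs*x^ (suc e) R x (length-take≤ D F) (x₀≤x⇒1≤x x₀≤x)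

    ∣ΔRv∣≤ : ∀ x d → x₀ ≤ x → ∣ Rv (x + d) ℤ.- Rv x ∣ ≤ C * suc e * d * (x + d) ^ e
    ∣ΔRv∣≤ x d x₀≤x = ∣evalℤ-increment∣≤ e R x d (length-take≤ D F) (x₀≤x⇒1≤x x₀≤x)

    2Cxᴰ⁻¹≤xᴰ : ∀ x → x₀ ≤ x → 2 * (C * x ^ suc e) ≤ x ^ D
    2Cxᴰ⁻¹≤xᴰ x x₀≤x = begin
      2 * (C * x ^ suc e)  ≡⟨ sym (ℕP.*-assoc 2 C _) ⟩
      2 * C * x ^ suc e    ≤⟨ ℕP.*-monoˡ-≤ (x ^ suc e) (ℕP.≤-trans (ℕP.*-monoʳ-≤ 2 (ℕP.m≤m*n C D)) (ℕP.<⇒≤ x₀≤x)) ⟩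
      x * x ^ suc e        ∎
      where open ℕP.≤-Reasoning

    Cxᴰ⁻¹≤lcxᴰ : ∀ x → x₀ ≤ x → C * x ^ suc e ≤ lc * x ^ D
    Cxᴰ⁻¹≤lcxᴰ x x₀≤x =
      ℕP.≤-trans (ℕP.m≤n*m _ 2) (ℕP.≤-trans (2Cxᴰ⁻¹≤xᴰ x x₀≤x) (ℕP.m≤n*m (x ^ D) lc))

    Fv≡+f : ∀ x → x₀ ≤ x → Fv x ≡ + f x
    Fv≡+f x x₀≤x = sym (ℤP.0≤i⇒+∣i∣≡i (subst (+ 0 ℤ.≤_) (sym (Fv≡Rv+lcxᴰ x)) (ℤP.≤-trans
      (0≤r+B (Rv x) _ (∣Rv∣≤ x x₀≤x)) (ℤP.+-monoʳ-≤ (Rv x) (ℤ.+≤+ (Cxᴰ⁻¹≤lcxᴰ x x₀≤x))))))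

    private
      +f-+0≡Rv+lcxᴰ : ∀ x → x₀ ≤ x → + f x ℤ.- + 0 ≡ Rv x ℤ.+ + (lc * x ^ D)
      +f-+0≡Rv+lcxᴰ x x₀≤x = trans (ℤP.+-identityʳ _) (trans (sym (Fv≡+f x x₀≤x)) (Fv≡Rv+lcxᴰ x))

    lcxᴰ≤f+Cxᴰ⁻¹ : ∀ x → x₀ ≤ x → lc * x ^ D ≤ f x + C * x ^ suc e
    lcxᴰ≤f+Cxᴰ⁻¹ x x₀≤x =
      +Y-+X≡r+T⇒X+T≤Y+B (Rv x) (lc * x ^ D) 0 (f x) (∣Rv∣≤ x x₀≤x) (+f-+0≡Rv+lcxᴰ x x₀≤x)

    f≤lcxᴰ+Cxᴰ⁻¹ : ∀ x → x₀ ≤ x → f x ≤ lc * x ^ D + C * x ^ suc e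
    f≤lcxᴰ+Cxᴰ⁻¹ x x₀≤x =
      +Y-+X≡r+T⇒Y≤X+T+B (Rv x) (lc * x ^ D) 0 (f x) (∣Rv∣≤ x x₀≤x) (+f-+0≡Rv+lcxᴰ x x₀≤x)

    xᴰ≤2f : ∀ x → x₀ ≤ x → x ^ D ≤ 2 * f x
    xᴰ≤2f x x₀≤x = m≤n+o⇒2o≤m⇒m≤2n (f x) (C * x ^ suc e)
      (ℕP.≤-trans (ℕP.m≤n*m (x ^ D) lc) (lcxᴰ≤f+Cxᴰ⁻¹ x x₀≤x)) (2Cxᴰ⁻¹≤xᴰ x x₀≤x)

    f≥1 : ∀ x → x₀ ≤ x → 1 ≤ f x
    f≥1 x x₀≤x with f x | xᴰ≤2f x x₀≤x
    ... | zero  | xᴰ≤0 = contradiction xᴰ≤0 (ℕP.<⇒≱ (ℕP.m^n>0 x {{ℕ.>-nonZero (x₀≤x⇒1≤x x₀≤x)}} D))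
    ... | suc _ | _    = s≤s z≤n

    f≤[lc+C]xᴰ : ∀ x → x₀ ≤ x → f x ≤ (lc + C) * x ^ D
    f≤[lc+C]xᴰ x x₀≤x = begin
      f x                          ≤⟨ f≤lcxᴰ+Cxᴰ⁻¹ x x₀≤x ⟩
      lc * x ^ D + C * x ^ suc e   ≤⟨ ℕP.+-monoʳ-≤ (lc * x ^ D) (ℕP.*-monoʳ-≤ C xᴰ⁻¹≤xᴰ) ⟩
      lc * x ^ D + C * x ^ D       ≡⟨ sym (ℕP.*-distribʳ-+ (x ^ D) lc C) ⟩
      (lc + C) * x ^ D             ∎
      where
      open ℕP.≤-Reasoning
      xᴰ⁻¹≤xᴰ = ℕP.m≤n*m (x ^ suc e) x {{ℕ.>-nonZero (x₀≤x⇒1≤x x₀≤x)}}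

    private
      Δ[lcxᴰ] : ℕ → ℕ → ℕ
      Δ[lcxᴰ] x d = lc * (x + d) ^ D ∸ lc * x ^ D

    Δf≡ΔRv+Δ[lcxᴰ] : ∀ x d → x₀ ≤ x → + f (x + d) ℤ.- + f x ≡ (Rv (x + d) ℤ.- Rv x) ℤ.+ + Δ[lcxᴰ] x d
    Δf≡ΔRv+Δ[lcxᴰ] x d x₀≤x = begin
      + f (x + d) ℤ.- + f x
        ≡⟨ cong₂ ℤ._-_ (sym (Fv≡+f (x + d) (ℕP.≤-trans x₀≤x (ℕP.m≤m+n x d)))) (sym (Fv≡+f x x₀≤x)) ⟩
      Fv (x + d) ℤ.- Fv x
        ≡⟨ cong₂ ℤ._-_ (Fv≡Rv+lcxᴰ (x + d)) (Fv≡Rv+lcxᴰ x) ⟩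
      (Rv (x + d) ℤ.+ + (lc * (x + d) ^ D)) ℤ.- (Rv x ℤ.+ + (lc * x ^ D))
        ≡⟨ ring (Rv (x + d)) (+ (lc * (x + d) ^ D)) (Rv x) (+ (lc * x ^ D)) ⟩
      (Rv (x + d) ℤ.- Rv x) ℤ.+ (+ (lc * (x + d) ^ D) ℤ.- + (lc * x ^ D))
        ≡⟨ cong (λ z → (Rv (x + d) ℤ.- Rv x) ℤ.+ z) (trans (ℤP.m-n≡m⊖n (lc * (x + d) ^ D) (lc * x ^ D)) (ℤP.⊖-≥ lcxᴰ≤)) ⟩
      (Rv (x + d) ℤ.- Rv x) ℤ.+ + Δ[lcxᴰ] x d ∎
      where
      open ≡-Reasoning
      lcxᴰ≤ : lc * x ^ D ≤ lc * (x + d) ^ D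
      lcxᴰ≤ = ℕP.*-monoʳ-≤ lc (ℕP.^-monoˡ-≤ D (ℕP.m≤m+n x d))
      ring : ∀ a b c d → (a ℤ.+ b) ℤ.- (c ℤ.+ d) ≡ (a ℤ.- c) ℤ.+ (b ℤ.- d)
      ring = solve-∀

    private
      f+Δ≤f[x+d]+B : ∀ x d → x₀ ≤ x → f x + Δ[lcxᴰ] x d ≤ f (x + d) + C * suc e * d * (x + d) ^ e
      f+Δ≤f[x+d]+B x d x₀≤x =
        +Y-+X≡r+T⇒X+T≤Y+B (Rv (x + d) ℤ.- Rv x) (Δ[lcxᴰ] x d) (f x) (f (x + d)) (∣ΔRv∣≤ x d x₀≤x) (Δf≡ΔRv+Δ[lcxᴰ] x d x₀≤x)

      f[x+d]≤f+Δ+B : ∀ x d → x₀ ≤ x → f (x + d) ≤ f x + Δ[lcxᴰ] x d + C * suc e * d * (x + d) ^ e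
      f[x+d]≤f+Δ+B x d x₀≤x =
        +Y-+X≡r+T⇒Y≤X+T+B (Rv (x + d) ℤ.- Rv x) (Δ[lcxᴰ] x d) (f x) (f (x + d)) (∣ΔRv∣≤ x d x₀≤x) (Δf≡ΔRv+Δ[lcxᴰ] x d x₀≤x)

    2f+d[x+d]ᴰ⁻¹≤2f : ∀ x d → x₀ ≤ x → 2 * f x + d * (x + d) ^ suc e ≤ 2 * f (x + d)
    2f+d[x+d]ᴰ⁻¹≤2f x d x₀≤x = ℕP.+-cancelʳ-≤ E _ _ (begin
      2 * f x + E + E      ≡⟨ ring (f x) E ⟩
      2 * (f x + E)        ≤⟨ ℕP.*-monoʳ-≤ 2 (ℕP.≤-trans (ℕP.+-monoʳ-≤ (f x) E≤Δ) (f+Δ≤f[x+d]+B x d x₀≤x)) ⟩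
      2 * (f (x + d) + B)  ≡⟨ ℕP.*-distribˡ-+ 2 (f (x + d)) B ⟩
      2 * f (x + d) + 2 * B ≤⟨ ℕP.+-monoʳ-≤ (2 * f (x + d)) 2B≤E ⟩
      2 * f (x + d) + E    ∎)
      where
      open ℕP.≤-Reasoning
      Y = x + d
      B = C * suc e * d * Y ^ e
      E = d * Y ^ suc e
      ring : ∀ X E → 2 * X + E + E ≡ 2 * (X + E)
      ring = ℕSolver.solve-∀
      E≤Δ : E ≤ Δ[lcxᴰ] x d
      E≤Δ = ℕP.m+n≤o⇒m≤o∸n E (begin
        E + lc * x ^ D          ≤⟨ ℕP.+-monoˡ-≤ (lc * x ^ D) (ℕP.m≤n*m E lc) ⟩
        lc * E + lc * x ^ D     ≡⟨ trans (ℕP.+-comm (lc * E) _) (sym (ℕP.*-distribˡ-+ lc (x ^ D) E)) ⟩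
        lc * (x ^ D + E)        ≤⟨ ℕP.*-monoʳ-≤ lc ([x+d]^[1+t]-lower (suc e) x d) ⟩
        lc * Y ^ D              ∎)
      2B≤E : 2 * B ≤ E
      2B≤E = begin
        2 * (C * suc e * d * Y ^ e)   ≡⟨ ring′ C e d (Y ^ e) ⟩
        2 * (C * suc e) * (d * Y ^ e) ≤⟨ ℕP.*-monoˡ-≤ (d * Y ^ e) (ℕP.≤-trans
                                          (ℕP.*-monoʳ-≤ 2 (ℕP.*-monoʳ-≤ C (ℕP.n≤1+n (suc e))))
                                          (ℕP.≤-trans (ℕP.<⇒≤ x₀≤x) (ℕP.m≤m+n x d))) ⟩
        Y * (d * Y ^ e)               ≡⟨ ring″ Y d (Y ^ e) ⟩
        d * Y ^ suc e                 ∎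
        where
        ring′ : ∀ C e d P → 2 * (C * suc e * d * P) ≡ 2 * (C * suc e) * (d * P)
        ring′ = ℕSolver.solve-∀
        ring″ : ∀ Y d P → Y * (d * P) ≡ d * (Y * P)
        ring″ = ℕSolver.solve-∀

    f[x+d]≤ : ∀ x d → x₀ ≤ x → f (x + d) ≤ f x + (lc + C) * D * d * (x + d) ^ suc e
    f[x+d]≤ x d x₀≤x = begin
      f Y                      ≤⟨ f[x+d]≤f+Δ+B x d x₀≤x ⟩
      f x + Δ[lcxᴰ] x d + B    ≡⟨ ℕP.+-assoc (f x) _ B ⟩
      f x + (Δ[lcxᴰ] x d + B)  ≤⟨ ℕP.+-monoʳ-≤ (f x) (ℕP.+-mono-≤ Δ≤ B≤) ⟩
      f x + (lc * D * d * Y ^ suc e + C * D * d * Y ^ suc e) ≡⟨ cong (λ z → f x + z) (ring lc C D d (Y ^ suc e)) ⟩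
      f x + (lc + C) * D * d * Y ^ suc e ∎
      where
      open ℕP.≤-Reasoning
      Y = x + d
      B = C * suc e * d * Y ^ e
      ring : ∀ c C D d P → c * D * d * P + C * D * d * P ≡ (c + C) * D * d * P
      ring = ℕSolver.solve-∀
      Δ≤ : Δ[lcxᴰ] x d ≤ lc * D * d * Y ^ suc e
      Δ≤ = ℕP.m≤n+o⇒m∸n≤o (lc * Y ^ D) (lc * x ^ D) (begin
        lc * Y ^ D                          ≤⟨ ℕP.*-monoʳ-≤ lc ([x+d]^[1+t]-upper (suc e) x d) ⟩
        lc * (x ^ D + D * d * Y ^ suc e)    ≡⟨ ring′ lc (x ^ D) D d (Y ^ suc e) ⟩
        lc * x ^ D + lc * D * d * Y ^ suc e ∎)
        where
        ring′ : ∀ c X D d P → c * (X + D * d * P) ≡ c * X + c * D * d * P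
        ring′ = ℕSolver.solve-∀
      B≤ : B ≤ C * D * d * Y ^ suc e
      B≤ = ℕP.*-mono-≤ (ℕP.*-monoˡ-≤ d (ℕP.*-monoʳ-≤ C (ℕP.n≤1+n (suc e))))
                       (ℕP.m≤n*m (Y ^ e) Y {{ℕ.>-nonZero (ℕP.≤-trans (x₀≤x⇒1≤x x₀≤x) (ℕP.m≤m+n x d))}})

    f-mono : ∀ x d → x₀ ≤ x → f x ≤ f (x + d)
    f-mono x d x₀≤x = ℕP.*-cancelˡ-≤ 2 (ℕP.≤-trans (ℕP.m≤m+n (2 * f x) _) (2f+d[x+d]ᴰ⁻¹≤2f x d x₀≤x))

    f-strict : ∀ x d → x₀ ≤ x → 1 ≤ d → f x < f (x + d)
    f-strict x d x₀≤x d≥1 = ℕP.*-cancelˡ-< 2 (f x) (f (x + d)) (ℕP.<-≤-trans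
      (ℕP.m<m+n (2 * f x) (ℕP.*-mono-≤ d≥1 (ℕP.m^n>0 (x + d) {{ℕ.>-nonZero x+d≥1}} (suc e))))
      (2f+d[x+d]ᴰ⁻¹≤2f x d x₀≤x))
      where x+d≥1 = ℕP.≤-trans (x₀≤x⇒1≤x x₀≤x) (ℕP.m≤m+n x d)

    f-injective : ∀ {x y} → x₀ ≤ x → x₀ ≤ y → f x ≡ f y → x ≡ y
    f-injective {x} {y} x₀≤x x₀≤y fx≡fy with ℕP.<-cmp x y
    ... | tri< x<y _ _ = contradiction fx≡fy (ℕP.<⇒≢ (subst (λ z → f x < f z) (ℕP.m+[n∸m]≡n (ℕP.<⇒≤ x<y))
                           (f-strict x (y ∸ x) x₀≤x (ℕP.m<n⇒0<n∸m x<y))))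
    ... | tri≈ _ x≡y _ = x≡y
    ... | tri> _ _ y<x = contradiction (sym fx≡fy) (ℕP.<⇒≢ (subst (λ z → f y < f z) (ℕP.m+[n∸m]≡n (ℕP.<⇒≤ y<x))
                           (f-strict y (x ∸ y) x₀≤y (ℕP.m<n⇒0<n∸m y<x))))

module PairsOfSolutions where

  open import Data.Nat as ℕ using (ℕ; suc; z≤n; s≤s; _≤_; _<_; _+_; _*_; _^_; _∸_)
  import Data.Nat.Properties as ℕP
  import Data.Nat.Tactic.RingSolver as ℕSolver
  open import Data.Integer as ℤ using (ℤ; +_; ∣_∣)
  import Data.Integer.Properties as ℤP
  open import Data.Integer.Tactic.RingSolver using (solve-∀)
  open import Data.List using (List)
  open import Data.Sum using (inj₁; inj₂)
  open import Relation.Nullary using (contradiction)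
  open import Relation.Binary.PropositionalEquality
  open import Defs using (coeffℤ)
  open IntegerPolynomials
  open Growth

  ∣+m-+n∣≡m∸n : ∀ m n → n ≤ m → ∣ + m ℤ.- + n ∣ ≡ m ∸ n
  ∣+m-+n∣≡m∸n m n n≤m = cong ∣_∣ (trans (ℤP.m-n≡m⊖n m n) (ℤP.⊖-≥ n≤m))

  ∣A-B∣*Qᵉ≤∣Aᵉ⁺¹-Bᵉ⁺¹∣-ordered : ∀ e A B Q → Q ≤ B → B ≤ A →
    ∣ + A ℤ.- + B ∣ * Q ^ e ≤ ∣ + (A ^ suc e) ℤ.- + (B ^ suc e) ∣
  ∣A-B∣*Qᵉ≤∣Aᵉ⁺¹-Bᵉ⁺¹∣-ordered e A B Q Q≤B B≤A
    rewrite ∣+m-+n∣≡m∸n A B B≤A | ∣+m-+n∣≡m∸n (A ^ suc e) (B ^ suc e) (ℕP.^-monoˡ-≤ (suc e) B≤A) =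
    subst (λ A → (A ∸ B) * Q ^ e ≤ A ^ suc e ∸ B ^ suc e) (ℕP.m+[n∸m]≡n B≤A) (increment (A ∸ B))
    where
    open ℕP.≤-Reasoning
    increment : ∀ d → (B + d ∸ B) * Q ^ e ≤ (B + d) ^ suc e ∸ B ^ suc e
    increment d rewrite ℕP.m+n∸m≡n B d = ℕP.m+n≤o⇒m≤o∸n _ (begin
      d * Q ^ e + B ^ suc e          ≤⟨ ℕP.+-monoˡ-≤ (B ^ suc e) (ℕP.*-monoʳ-≤ d (ℕP.^-monoˡ-≤ e (ℕP.≤-trans Q≤B (ℕP.m≤m+n B d)))) ⟩
      d * (B + d) ^ e + B ^ suc e    ≡⟨ ℕP.+-comm _ (B ^ suc e) ⟩
      B ^ suc e + d * (B + d) ^ e    ≤⟨ [x+d]^[1+t]-lower e B d ⟩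
      (B + d) ^ suc e                ∎)

  ∣A-B∣*Qᵉ≤∣Aᵉ⁺¹-Bᵉ⁺¹∣ : ∀ e A B Q → Q ≤ A → Q ≤ B →
    ∣ + A ℤ.- + B ∣ * Q ^ e ≤ ∣ + (A ^ suc e) ℤ.- + (B ^ suc e) ∣
  ∣A-B∣*Qᵉ≤∣Aᵉ⁺¹-Bᵉ⁺¹∣ e A B Q Q≤A Q≤B with ℕP.≤-total A B
  ... | inj₁ A≤B rewrite ℤP.∣i-j∣≡∣j-i∣ (+ A) (+ B) | ℤP.∣i-j∣≡∣j-i∣ (+ (A ^ suc e)) (+ (B ^ suc e)) =
    ∣A-B∣*Qᵉ≤∣Aᵉ⁺¹-Bᵉ⁺¹∣-ordered e B A Q Q≤A A≤B
  ... | inj₂ B≤A = ∣A-B∣*Qᵉ≤∣Aᵉ⁺¹-Bᵉ⁺¹∣-ordered e A B Q Q≤B B≤A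

  module _ (C u u′ v v′ M M′ N N′ : ℤ) where

    -- What separates (u′ + C M′)(v + C N) from (u + C M)(v′ + C N′) beyond C² (M′ N - M N′).
    crossError : ℤ
    crossError = C ℤ.* (M′ ℤ.- M) ℤ.* v ℤ.- C ℤ.* M ℤ.* (v′ ℤ.- v) ℤ.+ C ℤ.* N ℤ.* (u′ ℤ.- u)
                 ℤ.- C ℤ.* (N′ ℤ.- N) ℤ.* u ℤ.+ (u′ ℤ.- u) ℤ.* v ℤ.- u ℤ.* (v′ ℤ.- v)

    cross⇒C²[M′N-MN′]≡-crossError :
      (u′ ℤ.+ C ℤ.* M′) ℤ.* (v ℤ.+ C ℤ.* N) ≡ (u ℤ.+ C ℤ.* M) ℤ.* (v′ ℤ.+ C ℤ.* N′) →
      C ℤ.* C ℤ.* (M′ ℤ.* N ℤ.- M ℤ.* N′) ≡ ℤ.- crossError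
    cross⇒C²[M′N-MN′]≡-crossError cross = begin
      C ℤ.* C ℤ.* (M′ ℤ.* N ℤ.- M ℤ.* N′)
        ≡⟨ ring C u u′ v v′ M M′ N N′ ⟩
      (u′ ℤ.+ C ℤ.* M′) ℤ.* (v ℤ.+ C ℤ.* N) ℤ.- (u ℤ.+ C ℤ.* M) ℤ.* (v′ ℤ.+ C ℤ.* N′) ℤ.- crossError
        ≡⟨ cong (λ z → z ℤ.- (u ℤ.+ C ℤ.* M) ℤ.* (v′ ℤ.+ C ℤ.* N′) ℤ.- crossError) cross ⟩
      (u ℤ.+ C ℤ.* M) ℤ.* (v′ ℤ.+ C ℤ.* N′) ℤ.- (u ℤ.+ C ℤ.* M) ℤ.* (v′ ℤ.+ C ℤ.* N′) ℤ.- crossError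
        ≡⟨ cancel ((u ℤ.+ C ℤ.* M) ℤ.* (v′ ℤ.+ C ℤ.* N′)) crossError ⟩
      ℤ.- crossError ∎
      where
      open ≡-Reasoning
      ring : ∀ C u u′ v v′ M M′ N N′ → C ℤ.* C ℤ.* (M′ ℤ.* N ℤ.- M ℤ.* N′) ≡
        (u′ ℤ.+ C ℤ.* M′) ℤ.* (v ℤ.+ C ℤ.* N) ℤ.- (u ℤ.+ C ℤ.* M) ℤ.* (v′ ℤ.+ C ℤ.* N′) ℤ.-
        (C ℤ.* (M′ ℤ.- M) ℤ.* v ℤ.- C ℤ.* M ℤ.* (v′ ℤ.- v) ℤ.+ C ℤ.* N ℤ.* (u′ ℤ.- u)
         ℤ.- C ℤ.* (N′ ℤ.- N) ℤ.* u ℤ.+ (u′ ℤ.- u) ℤ.* v ℤ.- u ℤ.* (v′ ℤ.- v))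
      ring = solve-∀
      cancel : ∀ Y S → Y ℤ.- Y ℤ.- S ≡ ℤ.- S
      cancel = solve-∀

    ∣crossError∣≤ : ∣ crossError ∣ ≤ ∣ C ∣ * ∣ M′ ℤ.- M ∣ * ∣ v ∣ + ∣ C ∣ * ∣ M ∣ * ∣ v′ ℤ.- v ∣
                                   + ∣ C ∣ * ∣ N ∣ * ∣ u′ ℤ.- u ∣ + ∣ C ∣ * ∣ N′ ℤ.- N ∣ * ∣ u ∣
                                   + ∣ u′ ℤ.- u ∣ * ∣ v ∣ + ∣ u ∣ * ∣ v′ ℤ.- v ∣
    ∣crossError∣≤ = ℕP.≤-trans
      (∣a-b+c-d+e-f∣≤ (C ℤ.* (M′ ℤ.- M) ℤ.* v) (C ℤ.* M ℤ.* (v′ ℤ.- v)) (C ℤ.* N ℤ.* (u′ ℤ.- u))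
                      (C ℤ.* (N′ ℤ.- N) ℤ.* u) ((u′ ℤ.- u) ℤ.* v) (u ℤ.* (v′ ℤ.- v))) (ℕP.≤-reflexive
      (cong₂ _+_ (cong₂ _+_ (cong₂ _+_ (cong₂ _+_ (cong₂ _+_ (∣x*y*z∣ C (M′ ℤ.- M) v) (∣x*y*z∣ C M (v′ ℤ.- v)))
        (∣x*y*z∣ C N (u′ ℤ.- u))) (∣x*y*z∣ C (N′ ℤ.- N) u)) (ℤP.abs-* (u′ ℤ.- u) v)) (ℤP.abs-* u (v′ ℤ.- v))))
      where
      ∣x*y*z∣ : ∀ x y z → ∣ x ℤ.* y ℤ.* z ∣ ≡ ∣ x ∣ * ∣ y ∣ * ∣ z ∣
      ∣x*y*z∣ x y z = trans (ℤP.abs-* (x ℤ.* y) z) (cong (_* ∣ z ∣) (ℤP.abs-* x y))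
      ∣a-b+c-d+e-f∣≤ : ∀ a b c d e f →
        ∣ a ℤ.- b ℤ.+ c ℤ.- d ℤ.+ e ℤ.- f ∣ ≤ ∣ a ∣ + ∣ b ∣ + ∣ c ∣ + ∣ d ∣ + ∣ e ∣ + ∣ f ∣
      ∣a-b+c-d+e-f∣≤ a b c d e f =
        ℕP.≤-trans (ℤP.∣i-j∣≤∣i∣+∣j∣ (a ℤ.- b ℤ.+ c ℤ.- d ℤ.+ e) f) (ℕP.+-monoˡ-≤ ∣ f ∣
        (ℕP.≤-trans (ℤP.∣i+j∣≤∣i∣+∣j∣ (a ℤ.- b ℤ.+ c ℤ.- d) e) (ℕP.+-monoˡ-≤ ∣ e ∣
        (ℕP.≤-trans (ℤP.∣i-j∣≤∣i∣+∣j∣ (a ℤ.- b ℤ.+ c) d) (ℕP.+-monoˡ-≤ ∣ d ∣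
        (ℕP.≤-trans (ℤP.∣i+j∣≤∣i∣+∣j∣ (a ℤ.- b) c) (ℕP.+-monoˡ-≤ ∣ c ∣ (ℤP.∣i-j∣≤∣i∣+∣j∣ a b))))))))

  module SolutionsOf (F : List ℤ) (e c : ℕ) (deg : HasDegree F (suc (suc e))) (lead : coeffℤ F (suc (suc e)) ≡ + suc c)
                   (a b : ℕ) (a≥1 : 1 ≤ a) (b≥1 : 1 ≤ b) where

    open GrowthOf F e c deg lead

    Solutionℕ : ℕ → ℕ → Set
    Solutionℕ m n = b * f m ≡ a * f n

    L : ℕ
    L = 2 * (a + b) * (lc + C)

    L≥1 : 1 ≤ L
    L≥1 = ℕP.*-mono-≤ (ℕP.*-mono-≤ {1} {2} (s≤s z≤n) (ℕP.≤-trans a≥1 (ℕP.m≤m+n a b))) (s≤s z≤n)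

    private
      comparable : ∀ {m n} a′ b′ → 1 ≤ a′ → b′ ≤ a + b → x₀ ≤ m → x₀ ≤ n → b′ * f m ≡ a′ * f n → n ≤ L * m
      comparable {m} {n} a′ b′ a′≥1 b′≤a+b x₀≤m x₀≤n sol = ^-root-≤ (suc e) n m L L≥1 (begin
        n ^ D                          ≤⟨ xᴰ≤2f n x₀≤n ⟩
        2 * f n                        ≤⟨ ℕP.*-monoʳ-≤ 2 (ℕP.m≤n*m (f n) a′ {{ℕ.>-nonZero a′≥1}}) ⟩
        2 * (a′ * f n)                 ≡⟨ cong (2 *_) (sym sol) ⟩
        2 * (b′ * f m)                 ≤⟨ ℕP.*-monoʳ-≤ 2 (ℕP.*-monoʳ-≤ b′ (f≤[lc+C]xᴰ m x₀≤m)) ⟩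
        2 * (b′ * ((lc + C) * m ^ D))  ≡⟨ ring b′ (lc + C) (m ^ D) ⟩
        2 * b′ * (lc + C) * m ^ D      ≤⟨ ℕP.*-monoˡ-≤ (m ^ D) (ℕP.*-monoˡ-≤ (lc + C) (ℕP.*-monoʳ-≤ 2 b′≤a+b)) ⟩
        L * m ^ D                      ∎)
        where
        open ℕP.≤-Reasoning
        ring : ∀ b C M → 2 * (b * (C * M)) ≡ 2 * b * C * M
        ring = ℕSolver.solve-∀

    n≤Lm : ∀ {m n} → x₀ ≤ m → x₀ ≤ n → Solutionℕ m n → n ≤ L * m
    n≤Lm = comparable a b a≥1 (ℕP.m≤n+m b a)

    m≤Ln : ∀ {m n} → x₀ ≤ m → x₀ ≤ n → Solutionℕ m n → m ≤ L * n
    m≤Ln x₀≤m x₀≤n sol = comparable b a b≥1 (ℕP.m≤m+n a b) x₀≤n x₀≤m (sym sol)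

    solution-order : ∀ m j n n′ → x₀ ≤ m → x₀ ≤ n → x₀ ≤ n′ → 1 ≤ j → Solutionℕ m n → Solutionℕ (m + j) n′ → n < n′
    solution-order m j n n′ x₀≤m x₀≤n x₀≤n′ j≥1 sol sol′ with ℕP.≤-<-connex n′ n
    ... | inj₂ n<n′ = n<n′
    ... | inj₁ n′≤n = contradiction (ℕP.*-cancelˡ-≤ b {{ℕ.>-nonZero b≥1}} (begin
        b * f (m + j)  ≡⟨ sol′ ⟩
        a * f n′       ≤⟨ ℕP.*-monoʳ-≤ a (subst (λ z → f n′ ≤ f z) (ℕP.m+[n∸m]≡n n′≤n) (f-mono n′ (n ∸ n′) x₀≤n′)) ⟩
        a * f n        ≡⟨ sym sol ⟩
        b * f m        ∎)) (ℕP.<⇒≱ (f-strict m j x₀≤m j≥1))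
      where open ℕP.≤-Reasoning

    kMax : ℕ → ℕ
    kMax K = 2 * b * (lc + C) * D * K * L ^ suc e

    -- Subtracting the two equations: a (f(n + k) - f(n)) = b (f(m + j) - f(m)); the left side
    -- grows like k n^(D-1), the right one like j m^(D-1), and m, n are comparable.
    k≤kMax : ∀ {m j n k} K → x₀ ≤ m → x₀ ≤ n → j ≤ K → Solutionℕ m n → Solutionℕ (m + j) (n + k) → k ≤ kMax K
    k≤kMax {m} {j} {n} {k} K x₀≤m x₀≤n j≤K sol sol′ =
      ℕP.*-cancelʳ-≤ k (kMax K) (Y ^ suc e) {{ℕP.m^n≢0 Y (suc e) {{ℕ.>-nonZero (x₀≤x⇒1≤x x₀≤Y)}}}} (begin
        k * Y ^ suc e                              ≤⟨ ℕP.m≤n*m _ a {{ℕ.>-nonZero a≥1}} ⟩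
        a * (k * Y ^ suc e)                        ≤⟨ increments ⟩
        2 * b * (lc + C) * D * j * X ^ suc e       ≤⟨ ℕP.*-mono-≤ (ℕP.*-monoʳ-≤ (2 * b * (lc + C) * D) j≤K) Xᵉ⁺¹≤ ⟩
        2 * b * (lc + C) * D * K * (L ^ suc e * Y ^ suc e) ≡⟨ sym (ℕP.*-assoc (2 * b * (lc + C) * D * K) (L ^ suc e) (Y ^ suc e)) ⟩
        kMax K * Y ^ suc e                         ∎)
      where
      open ℕP.≤-Reasoning
      X = m + j
      Y = n + k
      x₀≤X = ℕP.≤-trans x₀≤m (ℕP.m≤m+n m j)
      x₀≤Y = ℕP.≤-trans x₀≤n (ℕP.m≤m+n n k)
      Xᵉ⁺¹≤ : X ^ suc e ≤ L ^ suc e * Y ^ suc e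
      Xᵉ⁺¹≤ = ℕP.≤-trans (ℕP.^-monoˡ-≤ (suc e) (m≤Ln x₀≤X x₀≤Y sol′)) (ℕP.≤-reflexive (^-distribʳ-* L Y (suc e)))
      increments : a * (k * Y ^ suc e) ≤ 2 * b * (lc + C) * D * j * X ^ suc e
      increments = ℕP.+-cancelˡ-≤ (2 * (b * f m)) _ _ (begin
        2 * (b * f m) + a * (k * Y ^ suc e)  ≡⟨ cong (λ z → 2 * z + a * (k * Y ^ suc e)) sol ⟩
        2 * (a * f n) + a * (k * Y ^ suc e)  ≡⟨ ring a (f n) (k * Y ^ suc e) ⟩
        a * (2 * f n + k * Y ^ suc e)        ≤⟨ ℕP.*-monoʳ-≤ a (2f+d[x+d]ᴰ⁻¹≤2f n k x₀≤n) ⟩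
        a * (2 * f Y)                        ≡⟨ ring′ a (f Y) ⟩
        2 * (a * f Y)                        ≡⟨ cong (2 *_) (sym sol′) ⟩
        2 * (b * f X)                        ≤⟨ ℕP.*-monoʳ-≤ 2 (ℕP.*-monoʳ-≤ b (f[x+d]≤ m j x₀≤m)) ⟩
        2 * (b * (f m + (lc + C) * D * j * X ^ suc e)) ≡⟨ ring″ b (f m) (lc + C) D j (X ^ suc e) ⟩
        2 * (b * f m) + 2 * b * (lc + C) * D * j * X ^ suc e ∎)
        where
        ring : ∀ a f P → 2 * (a * f) + a * P ≡ a * (2 * f + P)
        ring = ℕSolver.solve-∀
        ring′ : ∀ a f → a * (2 * f) ≡ 2 * (a * f)
        ring′ = ℕSolver.solve-∀
        ring″ : ∀ b f C D j P → 2 * (b * (f + C * D * j * P)) ≡ 2 * (b * f) + 2 * b * C * D * j * P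
        ring″ = ℕSolver.solve-∀

    f-cross : ∀ {m n m′ n′} → Solutionℕ m n → Solutionℕ m′ n′ → f m′ * f n ≡ f m * f n′
    f-cross {m} {n} {m′} {n′} sol sol′ =
      ℕP.*-cancelˡ-≡ _ _ (b * a) {{ℕP.m*n≢0 b a {{ℕ.>-nonZero b≥1}} {{ℕ.>-nonZero a≥1}}}} (begin
      b * a * (f m′ * f n)      ≡⟨ ring b a (f m′) (f n) ⟩
      (b * f m′) * (a * f n)    ≡⟨ cong₂ _*_ sol′ (sym sol) ⟩
      (a * f n′) * (b * f m)    ≡⟨ ring′ a (f n′) b (f m) ⟩
      b * a * (f m * f n′)      ∎)
      where
      open ≡-Reasoning
      ring : ∀ b a x y → b * a * (x * y) ≡ (b * x) * (a * y)
      ring = ℕSolver.solve-∀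
      ring′ : ∀ a x b y → (a * x) * (b * y) ≡ b * a * (y * x)
      ring′ = ℕSolver.solve-∀

    ∣Δxᴰ∣≤ : ∀ x d → ∣ + ((x + d) ^ D) ℤ.- + (x ^ D) ∣ ≤ D * d * (x + d) ^ suc e
    ∣Δxᴰ∣≤ x d rewrite ∣+m-+n∣≡m∸n ((x + d) ^ D) (x ^ D) (ℕP.^-monoˡ-≤ D (ℕP.m≤m+n x d)) =
      ℕP.m≤n+o⇒m∸n≤o _ (x ^ D) ([x+d]^[1+t]-upper (suc e) x d)

    G : ℕ
    G = 2 * (L + 1) * (2 * (L + 1))

    wError : ℕ → ℕ → ℕ
    wError K K₂ = (2 * lc * C * D + C * C * D) * (K + K₂)

    wMax : ℕ → ℕ → ℕ
    wMax K K₂ = wError K K₂ * G ^ suc e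

    -- Cross-multiplying f(m + j) f(n) = f(m) f(n + k) cancels the leading terms up to
    -- O((m + n)^(2D - 2)), while their difference c²((m + j)^D n^D - m^D (n + k)^D) is at
    -- least |j n - k m| (m n)^(D - 1) in absolute value.
    module TwoSolutions {m j n k K K₂ : ℕ} (x₀≤m : x₀ ≤ m) (x₀≤n : x₀ ≤ n) (j≤m : j ≤ m) (k≤n : k ≤ n)
                        (j≤K : j ≤ K) (k≤K₂ : k ≤ K₂) (sol : Solutionℕ m n) (sol′ : Solutionℕ (m + j) (n + k)) where

      private
        m′ n′ Z E P Q : ℕ
        m′ = m + j
        n′ = n + k
        Z = m′ + n′
        E = Z ^ e
        P = Z ^ suc e
        Q = m * n
        x₀≤m′ = ℕP.≤-trans x₀≤m (ℕP.m≤m+n m j)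
        x₀≤n′ = ℕP.≤-trans x₀≤n (ℕP.m≤m+n n k)
        m≥1 = x₀≤x⇒1≤x x₀≤m
        n≤Lm′ = n≤Lm x₀≤m x₀≤n sol
        m≤Ln′ = m≤Ln x₀≤m x₀≤n sol
        u u′ v v′ : ℤ
        u = Rv m
        u′ = Rv m′
        v = Rv n
        v′ = Rv n′
        n≥1 = x₀≤x⇒1≤x x₀≤n
        m′≤Z = ℕP.m≤m+n m′ n′
        n′≤Z = ℕP.m≤n+m n′ m′
        m≤Z = ℕP.≤-trans (ℕP.m≤m+n m j) m′≤Z
        n≤Z = ℕP.≤-trans (ℕP.m≤m+n n k) n′≤Z
        M M′ N N′ : ℤ
        M = + (m ^ D)
        M′ = + (m′ ^ D)
        N = + (n ^ D)
        N′ = + (n′ ^ D)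
        Δ = M′ ℤ.* N ℤ.- M ℤ.* N′

      w : ℤ
      w = + (j * n) ℤ.- + (k * m)

      ∣w∣*Qᵉ⁺¹≤∣Δ∣ : ∣ w ∣ * Q ^ suc e ≤ ∣ Δ ∣
      ∣w∣*Qᵉ⁺¹≤∣Δ∣ = subst₂ (λ x y → ∣ x ∣ * Q ^ suc e ≤ ∣ y ∣) w≡ (sym Δ≡)
        (∣A-B∣*Qᵉ≤∣Aᵉ⁺¹-Bᵉ⁺¹∣ (suc e) (m′ * n) (m * n′) Q (ℕP.*-monoˡ-≤ n (ℕP.m≤m+n m j)) (ℕP.*-monoʳ-≤ m (ℕP.m≤m+n n k)))
        where
        Δ≡ : Δ ≡ + ((m′ * n) ^ D) ℤ.- + ((m * n′) ^ D)
        Δ≡ = cong₂ ℤ._-_ (trans (sym (ℤP.pos-* (m′ ^ D) (n ^ D))) (cong +_ (sym (^-distribʳ-* m′ n D))))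
                         (trans (sym (ℤP.pos-* (m ^ D) (n′ ^ D))) (cong +_ (sym (^-distribʳ-* m n′ D))))
        w≡ : + (m′ * n) ℤ.- + (m * n′) ≡ w
        w≡ rewrite ℤP.pos-* m′ n | ℤP.pos-* m n′ | ℤP.pos-+ m j | ℤP.pos-+ n k | ℤP.pos-* j n | ℤP.pos-* k m =
          ring (+ m) (+ j) (+ n) (+ k)
          where
          ring : ∀ m j n k → (m ℤ.+ j) ℤ.* n ℤ.- m ℤ.* (n ℤ.+ k) ≡ j ℤ.* n ℤ.- k ℤ.* m
          ring = solve-∀

      ∣Δ∣≤∣crossError∣ : ∣ Δ ∣ ≤ ∣ crossError (+ lc) u u′ v v′ M M′ N N′ ∣
      ∣Δ∣≤∣crossError∣ = ℕP.≤-trans (ℕP.m≤n*m ∣ Δ ∣ (lc * lc)) (ℕP.≤-reflexive (begin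
        lc * lc * ∣ Δ ∣                 ≡⟨ sym (ℤP.abs-* (+ lc ℤ.* + lc) Δ) ⟩
        ∣ + lc ℤ.* + lc ℤ.* Δ ∣         ≡⟨ cong ∣_∣ (cross⇒C²[M′N-MN′]≡-crossError (+ lc) u u′ v v′ M M′ N N′ cross) ⟩
        ∣ ℤ.- S ∣                       ≡⟨ ℤP.∣-i∣≡∣i∣ S ⟩
        ∣ S ∣                           ∎))
        where
        open ≡-Reasoning
        S = crossError (+ lc) u u′ v v′ M M′ N N′
        Fv≡ : ∀ x → Fv x ≡ Rv x ℤ.+ + lc ℤ.* + (x ^ D)
        Fv≡ x = trans (Fv≡Rv+lcxᴰ x) (cong (λ z → Rv x ℤ.+ z) (ℤP.pos-* lc (x ^ D)))
        +f≡ : ∀ x → x₀ ≤ x → + f x ≡ Rv x ℤ.+ + lc ℤ.* + (x ^ D)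
        +f≡ x x₀≤x = trans (sym (Fv≡+f x x₀≤x)) (Fv≡ x)
        cross : (Rv m′ ℤ.+ + lc ℤ.* M′) ℤ.* (Rv n ℤ.+ + lc ℤ.* N) ≡ (Rv m ℤ.+ + lc ℤ.* M) ℤ.* (Rv n′ ℤ.+ + lc ℤ.* N′)
        cross = begin
          (Rv m′ ℤ.+ + lc ℤ.* M′) ℤ.* (Rv n ℤ.+ + lc ℤ.* N) ≡⟨ sym (cong₂ ℤ._*_ (+f≡ m′ x₀≤m′) (+f≡ n x₀≤n)) ⟩
          + f m′ ℤ.* + f n                                 ≡⟨ sym (ℤP.pos-* (f m′) (f n)) ⟩
          + (f m′ * f n)                                   ≡⟨ cong +_ (f-cross sol sol′) ⟩
          + (f m * f n′)                                   ≡⟨ ℤP.pos-* (f m) (f n′) ⟩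
          + f m ℤ.* + f n′                                 ≡⟨ cong₂ ℤ._*_ (+f≡ m x₀≤m) (+f≡ n′ x₀≤n′) ⟩
          (Rv m ℤ.+ + lc ℤ.* M) ℤ.* (Rv n′ ℤ.+ + lc ℤ.* N′) ∎

      ∣ΔM∣≤ : ∣ M′ ℤ.- M ∣ ≤ D * K * P
      ∣ΔM∣≤ = ℕP.≤-trans (∣Δxᴰ∣≤ m j) (ℕP.*-mono-≤ (ℕP.*-monoʳ-≤ D j≤K) (ℕP.^-monoˡ-≤ (suc e) m′≤Z))

      ∣ΔN∣≤ : ∣ N′ ℤ.- N ∣ ≤ D * K₂ * P
      ∣ΔN∣≤ = ℕP.≤-trans (∣Δxᴰ∣≤ n k) (ℕP.*-mono-≤ (ℕP.*-monoʳ-≤ D k≤K₂) (ℕP.^-monoˡ-≤ (suc e) n′≤Z))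

      ∣u∣≤ : ∣ u ∣ ≤ C * P
      ∣u∣≤ = ℕP.≤-trans (∣Rv∣≤ m x₀≤m) (ℕP.*-monoʳ-≤ C (ℕP.^-monoˡ-≤ (suc e) m≤Z))

      ∣v∣≤ : ∣ v ∣ ≤ C * P
      ∣v∣≤ = ℕP.≤-trans (∣Rv∣≤ n x₀≤n) (ℕP.*-monoʳ-≤ C (ℕP.^-monoˡ-≤ (suc e) n≤Z))

      ∣Δu∣≤ : ∣ u′ ℤ.- u ∣ ≤ C * D * K * E
      ∣Δu∣≤ = ℕP.≤-trans (∣ΔRv∣≤ m j x₀≤m)
        (ℕP.*-mono-≤ (ℕP.*-mono-≤ (ℕP.*-monoʳ-≤ C (ℕP.n≤1+n (suc e))) j≤K) (ℕP.^-monoˡ-≤ e m′≤Z))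

      ∣Δv∣≤ : ∣ v′ ℤ.- v ∣ ≤ C * D * K₂ * E
      ∣Δv∣≤ = ℕP.≤-trans (∣ΔRv∣≤ n k x₀≤n)
        (ℕP.*-mono-≤ (ℕP.*-mono-≤ (ℕP.*-monoʳ-≤ C (ℕP.n≤1+n (suc e))) k≤K₂) (ℕP.^-monoˡ-≤ e n′≤Z))

      E≤P : E ≤ P
      E≤P = ℕP.m≤n*m E Z {{ℕ.>-nonZero (ℕP.≤-trans m≥1 m≤Z)}}

      ∣crossError∣≤wError*P² : ∣ crossError (+ lc) u u′ v v′ M M′ N N′ ∣ ≤ wError K K₂ * (P * P)
      ∣crossError∣≤wError*P² = begin
        ∣ crossError (+ lc) u u′ v v′ M M′ N N′ ∣
          ≤⟨ ∣crossError∣≤ (+ lc) u u′ v v′ M M′ N N′ ⟩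
        lc * ∣ M′ ℤ.- M ∣ * ∣ v ∣ + lc * m ^ D * ∣ v′ ℤ.- v ∣ + lc * n ^ D * ∣ u′ ℤ.- u ∣ +
          lc * ∣ N′ ℤ.- N ∣ * ∣ u ∣ + ∣ u′ ℤ.- u ∣ * ∣ v ∣ + ∣ u ∣ * ∣ v′ ℤ.- v ∣
          ≤⟨ ℕP.+-mono-≤ (ℕP.+-mono-≤ (ℕP.+-mono-≤ (ℕP.+-mono-≤ (ℕP.+-mono-≤
                (ℕP.*-mono-≤ (ℕP.*-monoʳ-≤ lc ∣ΔM∣≤) ∣v∣≤)
                (ℕP.*-mono-≤ (ℕP.*-monoʳ-≤ lc (ℕP.^-monoˡ-≤ D m≤Z)) ∣Δv∣≤))
                (ℕP.*-mono-≤ (ℕP.*-monoʳ-≤ lc (ℕP.^-monoˡ-≤ D n≤Z)) ∣Δu∣≤))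
                (ℕP.*-mono-≤ (ℕP.*-monoʳ-≤ lc ∣ΔN∣≤) ∣u∣≤))
                (ℕP.*-mono-≤ (ℕP.≤-trans ∣Δu∣≤ (ℕP.*-monoʳ-≤ (C * D * K) E≤P)) ∣v∣≤))
                (ℕP.*-mono-≤ ∣u∣≤ (ℕP.≤-trans ∣Δv∣≤ (ℕP.*-monoʳ-≤ (C * D * K₂) E≤P))) ⟩
        lc * (D * K * P) * (C * P) + lc * (Z * P) * (C * D * K₂ * E) + lc * (Z * P) * (C * D * K * E) +
          lc * (D * K₂ * P) * (C * P) + (C * D * K * P) * (C * P) + (C * P) * (C * D * K₂ * P)
          ≡⟨ ring lc D K K₂ C Z E ⟩
        wError K K₂ * (P * P) ∎
        where
        open ℕP.≤-Reasoning
        ring : ∀ lc D K K₂ C Z E →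
          lc * (D * K * (Z * E)) * (C * (Z * E)) + lc * (Z * (Z * E)) * (C * D * K₂ * E) +
          lc * (Z * (Z * E)) * (C * D * K * E) + lc * (D * K₂ * (Z * E)) * (C * (Z * E)) +
          (C * D * K * (Z * E)) * (C * (Z * E)) + (C * (Z * E)) * (C * D * K₂ * (Z * E))
          ≡ (2 * lc * C * D + C * C * D) * (K + K₂) * ((Z * E) * (Z * E))
        ring = ℕSolver.solve-∀

      P²≤Gᵉ⁺¹*Qᵉ⁺¹ : P * P ≤ G ^ suc e * Q ^ suc e
      P²≤Gᵉ⁺¹*Qᵉ⁺¹ = begin
        P * P                  ≡⟨ sym (^-distribʳ-* Z Z (suc e)) ⟩
        (Z * Z) ^ suc e        ≤⟨ ℕP.^-monoˡ-≤ (suc e) (ℕP.≤-trans (ℕP.*-mono-≤ Z≤[2L+2]m Z≤[2L+2]n) (ℕP.≤-reflexive (ring (L + 1) m n))) ⟩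
        (G * Q) ^ suc e        ≡⟨ ^-distribʳ-* G Q (suc e) ⟩
        G ^ suc e * Q ^ suc e  ∎
        where
        open ℕP.≤-Reasoning
        ring : ∀ L m n → 2 * L * m * (2 * L * n) ≡ 2 * L * (2 * L) * (m * n)
        ring = ℕSolver.solve-∀
        Z≤[2L+2]m : Z ≤ 2 * (L + 1) * m
        Z≤[2L+2]m = begin
          m + j + (n + k)          ≤⟨ ℕP.+-mono-≤ (ℕP.+-monoʳ-≤ m j≤m) (ℕP.+-mono-≤ n≤Lm′ (ℕP.≤-trans k≤n n≤Lm′)) ⟩
          m + m + (L * m + L * m)  ≡⟨ ring′ L m ⟩
          2 * (L + 1) * m          ∎
          where
          ring′ : ∀ L m → m + m + (L * m + L * m) ≡ 2 * (L + 1) * m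
          ring′ = ℕSolver.solve-∀
        Z≤[2L+2]n : Z ≤ 2 * (L + 1) * n
        Z≤[2L+2]n = begin
          m + j + (n + k)          ≤⟨ ℕP.+-mono-≤ (ℕP.+-mono-≤ m≤Ln′ (ℕP.≤-trans j≤m m≤Ln′)) (ℕP.+-monoʳ-≤ n k≤n) ⟩
          L * n + L * n + (n + n)  ≡⟨ ring′ L n ⟩
          2 * (L + 1) * n          ∎
          where
          ring′ : ∀ L n → L * n + L * n + (n + n) ≡ 2 * (L + 1) * n
          ring′ = ℕSolver.solve-∀

      ∣w∣≤wMax : ∣ w ∣ ≤ wMax K K₂
      ∣w∣≤wMax = ℕP.*-cancelʳ-≤ ∣ w ∣ (wMax K K₂) (Q ^ suc e)
        {{ℕP.m^n≢0 Q (suc e) {{ℕ.>-nonZero (ℕP.*-mono-≤ m≥1 n≥1)}}}} (begin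
        ∣ w ∣ * Q ^ suc e                       ≤⟨ ∣w∣*Qᵉ⁺¹≤∣Δ∣ ⟩
        ∣ Δ ∣                                   ≤⟨ ∣Δ∣≤∣crossError∣ ⟩
        ∣ crossError (+ lc) u u′ v v′ M M′ N N′ ∣ ≤⟨ ∣crossError∣≤wError*P² ⟩
        wError K K₂ * (P * P)                   ≤⟨ ℕP.*-monoʳ-≤ (wError K K₂) P²≤Gᵉ⁺¹*Qᵉ⁺¹ ⟩
        wError K K₂ * (G ^ suc e * Q ^ suc e)   ≡⟨ sym (ℕP.*-assoc (wError K K₂) (G ^ suc e) (Q ^ suc e)) ⟩
        wMax K K₂ * Q ^ suc e                   ∎)
        where open ℕP.≤-Reasoning

module Counting where

  open import Data.Nat as ℕ using (ℕ; zero; suc; z≤n; s≤s; _≤_; _<_; _+_; _*_; _∸_; _/_; _%_)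
  import Data.Nat.Properties as ℕP
  import Data.Nat.Tactic.RingSolver as ℕSolver
  open import Data.Nat.DivMod using (m≡m%n+[m/n]*n; m%n<n; m/n*n≤m)
  open import Data.Nat.ListAction using (sum)
  import Data.Nat.ListAction.Properties as ListActionP
  open import Data.List using (List; []; _∷_; map; length; _++_; filter; concatMap)
  import Data.List.Properties as ListP
  open import Data.Product using (_×_; _,_; ∃)
  open import Data.Sum using (inj₁; inj₂)
  open import Data.Empty using (⊥)
  open import Relation.Nullary using (¬_; Dec; yes; no; does; contradiction)
  open import Data.Bool using (true; false)
  open import Relation.Unary using (Pred; Decidable)
  open import Relation.Binary.PropositionalEquality
  open import Defs using (range1; pairs)

  sumTo : (ℕ → ℕ) → ℕ → ℕ
  sumTo g zero    = 0
  sumTo g (suc B) = sumTo g B + g (suc B)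

  sumTo-cong : ∀ {g h} B → (∀ m → g m ≡ h m) → sumTo g B ≡ sumTo h B
  sumTo-cong zero    g≗h = refl
  sumTo-cong (suc B) g≗h = cong₂ _+_ (sumTo-cong B g≗h) (g≗h (suc B))

  sumTo-+ : ∀ g B t → sumTo g (B + t) ≡ sumTo g B + sumTo (λ i → g (B + i)) t
  sumTo-+ g B zero    = trans (cong (sumTo g) (ℕP.+-identityʳ B)) (sym (ℕP.+-identityʳ _))
  sumTo-+ g B (suc t) rewrite ℕP.+-suc B t | sumTo-+ g B t = ℕP.+-assoc (sumTo g B) _ _

  sumTo-monoʳ : ∀ g {B B′} → B ≤ B′ → sumTo g B ≤ sumTo g B′
  sumTo-monoʳ g {B} {B′} B≤B′ = begin
    sumTo g B                                     ≤⟨ ℕP.m≤m+n _ _ ⟩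
    sumTo g B + sumTo (λ i → g (B + i)) (B′ ∸ B)  ≡⟨ sym (sumTo-+ g B (B′ ∸ B)) ⟩
    sumTo g (B + (B′ ∸ B))                        ≡⟨ cong (sumTo g) (ℕP.m+[n∸m]≡n B≤B′) ⟩
    sumTo g B′                                    ∎
    where open ℕP.≤-Reasoning

  sumTo≤*A : ∀ g A B → (∀ m → g m ≤ A) → sumTo g B ≤ B * A
  sumTo≤*A g A zero    g≤A = z≤n
  sumTo≤*A g A (suc B) g≤A =
    ℕP.≤-trans (ℕP.+-mono-≤ (sumTo≤*A g A B g≤A) (g≤A (suc B))) (ℕP.≤-reflexive (ℕP.+-comm (B * A) A))

  sumTo-zero : ∀ g t → (∀ i → 1 ≤ i → i ≤ t → g i ≡ 0) → sumTo g t ≡ 0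
  sumTo-zero g zero    _  = refl
  sumTo-zero g (suc t) g≡0 = cong₂ _+_ (sumTo-zero g t (λ i 1≤i i≤t → g≡0 i 1≤i (ℕP.m≤n⇒m≤1+n i≤t)))
                                       (g≡0 (suc t) (s≤s z≤n) ℕP.≤-refl)

  sumTo≤1 : ∀ g t → (∀ i → 1 ≤ i → i ≤ t → g i ≤ 1) →
            (∀ i i′ → 1 ≤ i → i < i′ → i′ ≤ t → 1 ≤ g i → 1 ≤ g i′ → ⊥) → sumTo g t ≤ 1
  sumTo≤1 g zero    _   _      = z≤n
  sumTo≤1 g (suc t) g≤1 unique with 1 ℕ.≤? g (suc t)
  ... | no  g≱1 = ℕP.≤-trans (ℕP.≤-reflexive (trans (cong (sumTo g t +_) (ℕP.n<1⇒n≡0 (ℕP.≰⇒> g≱1))) (ℕP.+-identityʳ _)))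
                   (sumTo≤1 g t (λ i 1≤i i≤t → g≤1 i 1≤i (ℕP.m≤n⇒m≤1+n i≤t))
                                (λ i i′ 1≤i i<i′ i′≤t → unique i i′ 1≤i i<i′ (ℕP.m≤n⇒m≤1+n i′≤t)))
  ... | yes g≥1 = subst (_≤ 1) (cong (_+ g (suc t)) (sym (sumTo-zero g t earlier≡0))) (g≤1 (suc t) (s≤s z≤n) ℕP.≤-refl)
    where
    earlier≡0 : ∀ i → 1 ≤ i → i ≤ t → g i ≡ 0
    earlier≡0 i 1≤i i≤t = ℕP.n<1⇒n≡0 (ℕP.≰⇒> (λ gᵢ≥1 → unique i (suc t) 1≤i (s≤s i≤t) ℕP.≤-refl gᵢ≥1 g≥1))

  1≤sumTo⇒∃ : ∀ g B → 1 ≤ sumTo g B → ∃ λ m → 1 ≤ m × m ≤ B × 1 ≤ g m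
  1≤sumTo⇒∃ g zero    ()
  1≤sumTo⇒∃ g (suc B) 1≤Σ with 1 ℕ.≤? g (suc B)
  ... | yes g≥1 = suc B , s≤s z≤n , ℕP.≤-refl , g≥1
  ... | no  g≱1 with 1≤sumTo⇒∃ g B (ℕP.≤-trans 1≤Σ (ℕP.≤-reflexive
                      (trans (cong (sumTo g B +_) (ℕP.n<1⇒n≡0 (ℕP.≰⇒> g≱1))) (ℕP.+-identityʳ _))))
  ...   | m , 1≤m , m≤B , gₘ≥1 = m , 1≤m , ℕP.m≤n⇒m≤1+n m≤B , gₘ≥1

  indicator : ∀ {p} {P : Set p} → Dec P → ℕ
  indicator (yes _) = 1
  indicator (no _)  = 0

  indicator≤1 : ∀ {p} {P : Set p} (P? : Dec P) → indicator P? ≤ 1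
  indicator≤1 (yes _) = ℕP.≤-refl
  indicator≤1 (no _)  = z≤n

  1≤indicator⇒ : ∀ {p} {P : Set p} (P? : Dec P) → 1 ≤ indicator P? → P
  1≤indicator⇒ (yes p) _ = p

  module _ {p} {P : Pred ℕ p} (P? : Decidable P) where

    sumTo-indicator≤ : ∀ x B → (∀ n n′ → x < n → x < n′ → P n → P n′ → n ≡ n′) →
                       sumTo (λ n → indicator (P? n)) B ≤ x + 1
    sumTo-indicator≤ x B unique with ℕP.≤-total B x
    ... | inj₁ B≤x = ℕP.≤-trans (sumTo≤*A _ 1 B (λ n → indicator≤1 (P? n)))
                       (ℕP.≤-trans (ℕP.≤-reflexive (ℕP.*-identityʳ B)) (ℕP.≤-trans B≤x (ℕP.m≤m+n x 1)))
    ... | inj₂ x≤B = subst (λ z → sumTo _ z ≤ x + 1) (ℕP.m+[n∸m]≡n x≤B) (begin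
      sumTo _ (x + (B ∸ x))                                      ≡⟨ sumTo-+ _ x (B ∸ x) ⟩
      sumTo _ x + sumTo (λ i → indicator (P? (x + i))) (B ∸ x)  ≤⟨ ℕP.+-mono-≤ below beyond ⟩
      x + 1                                                      ∎)
      where
      open ℕP.≤-Reasoning
      below : sumTo (λ n → indicator (P? n)) x ≤ x
      below = ℕP.≤-trans (sumTo≤*A _ 1 x (λ n → indicator≤1 (P? n))) (ℕP.≤-reflexive (ℕP.*-identityʳ x))
      beyond : sumTo (λ i → indicator (P? (x + i))) (B ∸ x) ≤ 1
      beyond = sumTo≤1 _ (B ∸ x) (λ i _ _ → indicator≤1 (P? (x + i)))
        (λ i i′ 1≤i i<i′ _ Pᵢ Pᵢ′ → ℕP.<-irrefl
          (unique (x + i) (x + i′) (ℕP.m<m+n x 1≤i) (ℕP.m<m+n x (ℕP.<-trans 1≤i i<i′))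
                  (1≤indicator⇒ (P? (x + i)) Pᵢ) (1≤indicator⇒ (P? (x + i′)) Pᵢ′))
          (ℕP.+-monoʳ-< x i<i′))

  module _ {a p} {A : Set a} {P : Pred A p} (P? : Decidable P) where

    length-filter-++ : ∀ xs ys → length (filter P? (xs ++ ys)) ≡ length (filter P? xs) + length (filter P? ys)
    length-filter-++ xs ys = trans (cong length (ListP.filter-++ P? xs ys)) (ListP.length-++ (filter P? xs))

    length-filter-[_] : ∀ x → length (filter P? (x ∷ [])) ≡ indicator (P? x)
    length-filter-[ x ] with P? x
    ... | yes _ = refl
    ... | no _  = refl

    length-filter-concatMap : ∀ {b} {B : Set b} (g : B → List A) xs →
      length (filter P? (concatMap g xs)) ≡ sum (map (λ x → length (filter P? (g x))) xs)
    length-filter-concatMap g []       = refl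
    length-filter-concatMap g (x ∷ xs) = trans (length-filter-++ (g x) (concatMap g xs))
      (cong (length (filter P? (g x)) +_) (length-filter-concatMap g xs))

    length-filter-map : ∀ {b} {B : Set b} (h : B → A) ys → length (filter P? (map h ys)) ≡ length (filter (λ y → P? (h y)) ys)
    length-filter-map h []       = refl
    length-filter-map h (y ∷ ys) with does (P? (h y))
    ... | true  = cong suc (length-filter-map h ys)
    ... | false = length-filter-map h ys

  length-filter-range1 : ∀ {p} {P : Pred ℕ p} (P? : Decidable P) B →
    length (filter P? (range1 B)) ≡ sumTo (λ n → indicator (P? n)) B
  length-filter-range1 P? zero    = refl
  length-filter-range1 P? (suc B) = trans (length-filter-++ P? (range1 B) (suc B ∷ []))
    (cong₂ _+_ (length-filter-range1 P? B) (length-filter-[_] P? (suc B)))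

  sum-map-range1 : ∀ g B → sum (map g (range1 B)) ≡ sumTo g B
  sum-map-range1 g zero    = refl
  sum-map-range1 g (suc B) = trans (cong sum (ListP.map-++ g (range1 B) (suc B ∷ [])))
    (trans (ListActionP.sum-++ (map g (range1 B)) (g (suc B) ∷ []))
           (cong₂ _+_ (sum-map-range1 g B) (ℕP.+-identityʳ (g (suc B)))))

  length-filter-pairs : ∀ {p} {P : Pred (ℕ × ℕ) p} (P? : Decidable P) B →
    length (filter P? (pairs B)) ≡ sumTo (λ m → sumTo (λ n → indicator (P? (m , n))) B) B
  length-filter-pairs P? B = trans (length-filter-concatMap P? (λ m → map (m ,_) (range1 B)) (range1 B))
    (trans (sum-map-range1 _ B) (sumTo-cong B (λ m → trans (length-filter-map P? (m ,_) (range1 B))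
      (length-filter-range1 (λ n → P? (m , n)) B))))

  -- Beyond X, g takes values in {0, 1} and its support is (K + 1)-separated, so every block
  -- of K + 1 consecutive arguments contributes at most 1.
  module Sparse (g : ℕ → ℕ) (A X K : ℕ) (g≤A : ∀ m → g m ≤ A) (g≤1 : ∀ m → X < m → g m ≤ 1)
                (gap : ∀ m m′ → X < m → m < m′ → m′ ≤ m + K → 1 ≤ g m → 1 ≤ g m′ → ⊥) where

    block≤1 : ∀ B → X ≤ B → sumTo (λ i → g (B + i)) (suc K) ≤ 1
    block≤1 B X≤B = sumTo≤1 _ (suc K) (λ i 1≤i _ → g≤1 (B + i) (X<B+ i 1≤i))
      (λ i i′ 1≤i i<i′ i′≤K+1 → gap (B + i) (B + i′) (X<B+ i 1≤i) (ℕP.+-monoʳ-< B i<i′)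
        (ℕP.≤-trans (ℕP.+-monoʳ-≤ B (ℕP.≤-trans i′≤K+1 (ℕP.+-monoˡ-≤ K 1≤i))) (ℕP.≤-reflexive (sym (ℕP.+-assoc B i K)))))
      where
      X<B+ : ∀ i → 1 ≤ i → X < B + i
      X<B+ i 1≤i = ℕP.≤-trans (s≤s X≤B) (ℕP.≤-trans (ℕP.≤-reflexive (ℕP.+-comm 1 B)) (ℕP.+-monoʳ-≤ B 1≤i))

    blocks : ∀ t → sumTo g (X + t * suc K) ≤ sumTo g X + t
    blocks zero    = ℕP.≤-reflexive (trans (cong (sumTo g) (ℕP.+-identityʳ X)) (sym (ℕP.+-identityʳ _)))
    blocks (suc t) = begin
      sumTo g (X + suc t * suc K)                              ≡⟨ cong (sumTo g) (ring X t (suc K)) ⟩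
      sumTo g (X + t * suc K + suc K)                          ≡⟨ sumTo-+ g (X + t * suc K) (suc K) ⟩
      sumTo g (X + t * suc K) + sumTo (λ i → g (X + t * suc K + i)) (suc K)
        ≤⟨ ℕP.+-mono-≤ (blocks t) (block≤1 (X + t * suc K) (ℕP.m≤m+n X _)) ⟩
      sumTo g X + t + 1                                        ≡⟨ trans (ℕP.+-assoc (sumTo g X) t 1) (cong (sumTo g X +_) (ℕP.+-comm t 1)) ⟩
      sumTo g X + suc t                                        ∎
      where
      open ℕP.≤-Reasoning
      ring : ∀ X t n → X + (n + t * n) ≡ X + t * n + n
      ring = ℕSolver.solve-∀

    sparse : ∀ B → suc K * sumTo g B ≤ suc K * (X * A + 1) + B
    sparse B = begin
      suc K * sumTo g B                       ≤⟨ ℕP.*-monoʳ-≤ (suc K) (ℕP.≤-trans (sumTo-monoʳ g B≤) (blocks (suc (B / suc K)))) ⟩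
      suc K * (sumTo g X + suc (B / suc K))   ≤⟨ ℕP.*-monoʳ-≤ (suc K) (ℕP.+-monoˡ-≤ _ (sumTo≤*A g A X g≤A)) ⟩
      suc K * (X * A + suc (B / suc K))       ≡⟨ ring (suc K) (X * A) (B / suc K) ⟩
      suc K * (X * A + 1) + B / suc K * suc K ≤⟨ ℕP.+-monoʳ-≤ _ (m/n*n≤m B (suc K)) ⟩
      suc K * (X * A + 1) + B                 ∎
      where
      open ℕP.≤-Reasoning
      ring : ∀ n a q → n * (a + suc q) ≡ n * (a + 1) + q * n
      ring = ℕSolver.solve-∀
      B≤ : B ≤ X + suc (B / suc K) * suc K
      B≤ = begin
        B                              ≡⟨ m≡m%n+[m/n]*n B (suc K) ⟩
        B % suc K + B / suc K * suc K  ≤⟨ ℕP.+-monoˡ-≤ _ (ℕP.<⇒≤ (m%n<n B (suc K))) ⟩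
        suc K + B / suc K * suc K      ≤⟨ ℕP.m≤n+m _ X ⟩
        X + suc (B / suc K) * suc K    ∎

  term≤sumTo : ∀ g {i} B → 1 ≤ i → i ≤ B → g i ≤ sumTo g B
  term≤sumTo g zero    (s≤s _) ()
  term≤sumTo g (suc B) 1≤i i≤1+B with ℕP.m≤n⇒m<n∨m≡n i≤1+B
  ... | inj₁ (s≤s i≤B) = ℕP.≤-trans (term≤sumTo g B 1≤i i≤B) (ℕP.m≤m+n _ _)
  ... | inj₂ refl      = ℕP.m≤n+m _ _

  indicator-cong : ∀ {p q} {P : Set p} {Q : Set q} (P? : Dec P) (Q? : Dec Q) → (P → Q) → (Q → P) → indicator P? ≡ indicator Q?
  indicator-cong (yes _) (yes _) _   _   = refl
  indicator-cong (no _)  (no _)  _   _   = refl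
  indicator-cong (yes p) (no ¬q) p⇒q _   = contradiction (p⇒q p) ¬q
  indicator-cong (no ¬p) (yes q) _   q⇒p = contradiction (q⇒p q) ¬p

module Reduction where

  open import Data.Nat as ℕ using (ℕ; zero; suc; z≤n; s≤s; _≤_; _<_; _+_; _*_; _^_; _∸_)
  import Data.Nat.Properties as ℕP
  import Data.Nat.Tactic.RingSolver as ℕSolver
  open import Data.Integer as ℤ using (ℤ; +_; -[1+_]; ∣_∣)
  import Data.Integer.Properties as ℤP
  open import Data.Integer.Tactic.RingSolver using (solve-∀)
  open import Data.Rational as ℚ using (ℚ; mkℚ; 0ℚ; 1ℚ)
  import Data.Rational.Properties as ℚP
  import Data.Rational.Unnormalised as ℚᵘ
  import Data.Rational.Unnormalised.Properties as ℚᵘP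
  open import Data.List using (List; map; length; take)
  import Data.List.Properties as ListP
  open import Data.Product using (_×_; _,_; ∃; proj₁; proj₂)
  open import Data.Sum using (_⊎_; inj₁; inj₂)
  open import Data.Empty using (⊥; ⊥-elim)
  open import Relation.Nullary using (¬_; Dec; contradiction)
  open import Relation.Binary.PropositionalEquality
  open import Algebra.Properties.Group ℚP.+-0-group using (⁻¹-involutive)
  open import Defs
  open IntegerPolynomials
  open RationalPolynomials hiding (_^_)
  open AffineInvariance
  open AuxiliaryPolynomials
  open Growth
  open PairsOfSolutions
  open Counting

  Solution : List ℤ → ℚ → ℕ → ℕ → Set
  Solution f q m n = ι (evalℤ f (+ m)) ≡ q ℚ.* ι (evalℤ f (+ n))

  solution? : ∀ f q m n → Dec (Solution f q m n)
  solution? f q m n = ι (evalℤ f (+ m)) ℚP.≟ q ℚ.* ι (evalℤ f (+ n))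

  count-cong : ∀ f g q → (∀ {m n} → Solution f q m n → Solution g q m n) →
               (∀ {m n} → Solution g q m n → Solution f q m n) → ∀ B → count f q B ≡ count g q B
  count-cong f g q f⇒g g⇒f B = trans (length-filter-pairs _ B) (trans
    (sumTo-cong B (λ m → sumTo-cong B (λ n → indicator-cong (solution? f q m n) (solution? g q m n) f⇒g g⇒f)))
    (sym (length-filter-pairs _ B)))

  littleO-cong : ∀ {F G} → (∀ B → F B ≡ G B) → LittleO-B G → LittleO-B F
  littleO-cong F≗G G-littleO ε ε>0 with G-littleO ε ε>0
  ... | B₀ , bound = B₀ , λ B B₀≤B → subst (λ z → ℕ→ℚ z ℚ.≤ ε ℚ.* ℕ→ℚ B) (sym (F≗G B)) (bound B B₀≤B)

  nonzero-sign : ∀ z → z ≢ + 0 → (∃ λ a′ → z ≡ + suc a′) ⊎ (∃ λ t → z ≡ -[1+ t ])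
  nonzero-sign (+ zero)  z≢0 = contradiction refl z≢0
  nonzero-sign (+ suc a′) _  = inj₁ (a′ , refl)
  nonzero-sign -[1+ t ]   _  = inj₂ (t , refl)

  positive⇒↥≡+suc : ∀ ε → 0ℚ ℚ.< ε → ∃ λ p → ℚ.↥ ε ≡ + suc p
  positive⇒↥≡+suc (mkℚ (+ suc p) _ _) _                      = p , refl
  positive⇒↥≡+suc (mkℚ (+ zero)  _ _) (ℚ.*<* (ℤ.+<+ ()))
  positive⇒↥≡+suc (mkℚ -[1+ _ ]  _ _) (ℚ.*<* ())

  ℕ→ℚ-≤-* : ∀ ε {p} → ℚ.↥ ε ≡ + p → ∀ n B → n * ℚ.↧ₙ ε ≤ p * B → ℕ→ℚ n ℚ.≤ ε ℚ.* ℕ→ℚ B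
  ℕ→ℚ-≤-* ε@(mkℚ _ d _) {p} refl n B n*d≤p*B rewrite ι-mkℚ (+ n) | ι-mkℚ (+ B) =
    ℚP.toℚᵘ-cancel-≤ (ℚᵘP.≤-respʳ-≃ (ℚᵘP.≃-sym (ℚP.toℚᵘ-homo-* ε (mkℚ (+ B) 0 (coprime-1 B))))
      (ℚᵘ.*≤* (subst₂ ℤ._≤_ (sym lhs) (sym rhs) (ℤ.+≤+ n*d≤p*B))))
    where
    lhs : + n ℤ.* + suc (d * 1) ≡ + (n * suc d)
    lhs rewrite ℕP.*-identityʳ d = sym (ℤP.pos-* n (suc d))
    rhs : + p ℤ.* + B ℤ.* + 1 ≡ + (p * B)
    rhs = trans (ℤP.*-identityʳ _) (sym (ℤP.pos-* p B))

  module Core (F : List ℤ) (e c : ℕ) (deg : HasDegree F (suc (suc e))) (lead : coeffℤ F (suc (suc e)) ≡ + suc c)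
              (lenF : length F ≤ suc (suc (suc e))) (¬power : ¬ ShiftedPower (suc (suc e)) (toℚpoly F))
              (q : ℚ) (q≢0 : q ≢ 0ℚ) (q≢1 : q ≢ 1ℚ) where

    open GrowthOf F e c deg lead
    open AuxiliaryPolynomial F D lenF q using (a; b; q*b≡a; Q; Q-root; Q≢0)

    Solutionℤ : ℕ → ℕ → Set
    Solutionℤ m n = + b ℤ.* Fv m ≡ a ℤ.* Fv n

    solution⇒solutionℤ : ∀ {m n} → Solution F q m n → Solutionℤ m n
    solution⇒solutionℤ {m} {n} sol = ι-injective (begin
      ι (+ b ℤ.* Fv m)              ≡⟨ ι-* (+ b) (Fv m) ⟩
      ι (+ b) ℚ.* ι (Fv m)          ≡⟨ cong (ι (+ b) ℚ.*_) sol ⟩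
      ι (+ b) ℚ.* (q ℚ.* ι (Fv n))  ≡⟨ sym (ℚP.*-assoc (ι (+ b)) q (ι (Fv n))) ⟩
      ι (+ b) ℚ.* q ℚ.* ι (Fv n)    ≡⟨ cong (ℚ._* ι (Fv n)) (trans (ℚP.*-comm (ι (+ b)) q) q*b≡a) ⟩
      ι a ℚ.* ι (Fv n)              ≡⟨ sym (ι-* a (Fv n)) ⟩
      ι (a ℤ.* Fv n)                ∎)
      where open ≡-Reasoning

    a≢0 : a ≢ + 0
    a≢0 a≡0 = q≢0 (ℚP.↥p≡0⇒p≡0 q a≡0)

    -- |F| is at most Fmax on [1, x₀), whereas b |F(m)| ≥ m / 2 beyond x₀.
    Fmax : ℕ
    Fmax = sumAbs F * x₀ ^ length F

    x₁ : ℕ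
    x₁ = x₀ + suc (2 * (∣ a ∣ * Fmax))

    x₁≤m⇒x₀≤m : ∀ {m} → x₁ ≤ m → x₀ ≤ m
    x₁≤m⇒x₀≤m = ℕP.≤-trans (ℕP.m≤m+n x₀ _)

    partner≥x₀ : ∀ {m n} → x₁ ≤ m → 1 ≤ n → Solutionℤ m n → x₀ ≤ n
    partner≥x₀ {m} {n} x₁≤m n≥1 sol with ℕP.≤-<-connex x₀ n
    ... | inj₁ x₀≤n = x₀≤n
    ... | inj₂ n<x₀ = contradiction x₁≤m (ℕP.<⇒≱ (begin-strict
      m                          ≤⟨ m≤m^[1+n] m (suc e) (x₀≤x⇒1≤x x₀≤m) ⟩
      m ^ D                      ≤⟨ xᴰ≤2f m x₀≤m ⟩
      2 * f m                    ≤⟨ ℕP.*-monoʳ-≤ 2 (ℕP.m≤n*m (f m) b) ⟩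
      2 * (b * f m)              ≡⟨ cong (2 *_) b*f≡ ⟩
      2 * (∣ a ∣ * ∣ Fv n ∣)     ≤⟨ ℕP.*-monoʳ-≤ 2 (ℕP.*-monoʳ-≤ ∣ a ∣ ∣Fv∣≤Fmax) ⟩
      2 * (∣ a ∣ * Fmax)         <⟨ ℕP.n<1+n _ ⟩
      suc (2 * (∣ a ∣ * Fmax))   ≤⟨ ℕP.m≤n+m _ x₀ ⟩
      x₁                         ∎))
      where
      open ℕP.≤-Reasoning
      x₀≤m = x₁≤m⇒x₀≤m x₁≤m
      b*f≡ : b * f m ≡ ∣ a ∣ * ∣ Fv n ∣
      b*f≡ = trans (sym (ℤP.abs-* (+ b) (Fv m))) (trans (cong ∣_∣ sol) (ℤP.abs-* a (Fv n)))
      ∣Fv∣≤Fmax : ∣ Fv n ∣ ≤ Fmax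
      ∣Fv∣≤Fmax = ℕP.≤-trans (∣evalℤ∣≤sumAbs*x^ (length F) F n (ℕP.n≤1+n _) n≥1)
                             (ℕP.*-monoʳ-≤ (sumAbs F) (ℕP.^-monoˡ-≤ (length F) (ℕP.<⇒≤ n<x₀)))

    unique-partner : ∀ {m n n′} → x₀ ≤ n → x₀ ≤ n′ → Solutionℤ m n → Solutionℤ m n′ → n ≡ n′
    unique-partner {m} {n} {n′} x₀≤n x₀≤n′ sol sol′ =
      f-injective x₀≤n x₀≤n′ (cong ∣_∣ (ℤP.*-cancelˡ-≡ a (Fv n) (Fv n′) {{ℤ.≢-nonZero a≢0}} (trans (sym sol) sol′)))

    negative⇒no-solution : ∀ {t} → a ≡ -[1+ t ] → ∀ {m n} → x₁ ≤ m → 1 ≤ n → Solutionℤ m n → ⊥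
    negative⇒no-solution {t} a≡ {m} {n} x₁≤m n≥1 sol = sign-mismatch (f m) (f n) (f≥1 n x₀≤n) (begin
      + b ℤ.* + f m       ≡⟨ cong (+ b ℤ.*_) (sym (Fv≡+f m (x₁≤m⇒x₀≤m x₁≤m))) ⟩
      + b ℤ.* Fv m        ≡⟨ sol ⟩
      a ℤ.* Fv n          ≡⟨ cong₂ ℤ._*_ a≡ (Fv≡+f n x₀≤n) ⟩
      -[1+ t ] ℤ.* + f n  ∎)
      where
      open ≡-Reasoning
      x₀≤n = partner≥x₀ x₁≤m n≥1 sol
      sign-mismatch : ∀ x y → 1 ≤ y → + b ℤ.* + x ≢ -[1+ t ] ℤ.* + y
      sign-mismatch x (suc y) _ eq with trans (ℤP.pos-* b x) eq
      ... | ()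

    ClosePairsExcludedBeyond : ℕ → ℕ → Set
    ClosePairsExcludedBeyond K X = ∀ {m m′ n n′} → X ≤ m → m < m′ → m′ ≤ m + K → 1 ≤ n → 1 ≤ n′ →
                                   Solutionℤ m n → Solutionℤ m′ n′ → ⊥

    module Positive (a′ : ℕ) (a≡ : a ≡ + suc a′) (K : ℕ) where

      open SolutionsOf F e c deg lead (suc a′) b (s≤s z≤n) (s≤s z≤n)

      solutionℤ⇒solutionℕ : ∀ {m n} → x₀ ≤ m → x₀ ≤ n → Solutionℤ m n → Solutionℕ m n
      solutionℤ⇒solutionℕ {m} {n} x₀≤m x₀≤n sol = ℤP.+-injective (begin
        + (b * f m)          ≡⟨ ℤP.pos-* b (f m) ⟩
        + b ℤ.* + f m        ≡⟨ cong (+ b ℤ.*_) (sym (Fv≡+f m x₀≤m)) ⟩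
        + b ℤ.* Fv m         ≡⟨ sol ⟩
        a ℤ.* Fv n           ≡⟨ cong₂ ℤ._*_ a≡ (Fv≡+f n x₀≤n) ⟩
        + suc a′ ℤ.* + f n   ≡⟨ sym (ℤP.pos-* (suc a′) (f n)) ⟩
        + (suc a′ * f n)     ∎)
        where open ≡-Reasoning

      K₂ W : ℕ
      K₂ = kMax K
      W = wMax K K₂

      -- Every |w| ≤ W is + i - + (W + 1) for some 1 ≤ i ≤ 2W + 1.
      rootBound : ℕ
      rootBound = sumTo (λ j → sumTo (λ k → sumTo (λ i → sumAbs (Q j k (+ i ℤ.- + suc W))) (suc (2 * W))) K₂) K

      root≤rootBound : ∀ {j k w n} → 1 ≤ j → j ≤ K → 1 ≤ k → k ≤ K₂ → ∣ w ∣ ≤ W → 1 ≤ n →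
                       evalℤ (Q j k w) (+ n) ≡ + 0 → n ≤ rootBound
      root≤rootBound {j} {k} {w} {n} 1≤j j≤K 1≤k k≤K₂ ∣w∣≤W 1≤n root with zero⊎hasDegree (Q j k w)
      ... | inj₁ Q≡0 = ⊥-elim (Q≢0 q≢1 (proj₁ deg) ¬power 1≤j 1≤k Q≡0)
      ... | inj₂ (d , Q-deg) = ℕP.≤-trans (root≤sumAbs (Q j k w) d n Q-deg 1≤n root) (begin
        sumAbs (Q j k w)                       ≡⟨ cong (λ z → sumAbs (Q j k z)) (sym w≡) ⟩
        sumAbs (Q j k (+ i ℤ.- + suc W))       ≤⟨ term≤sumTo _ (suc (2 * W)) (s≤s z≤n) i≤ ⟩
        sumTo _ (suc (2 * W))                  ≤⟨ term≤sumTo _ K₂ 1≤k k≤K₂ ⟩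
        sumTo _ K₂                             ≤⟨ term≤sumTo _ K 1≤j j≤K ⟩
        rootBound                              ∎)
        where
        open ℕP.≤-Reasoning
        i = suc ∣ w ℤ.+ + W ∣
        w+W≥0 : + 0 ℤ.≤ w ℤ.+ + W
        w+W≥0 = 0≤r+B w W ∣w∣≤W
        w≡ : + i ℤ.- + suc W ≡ w
        w≡ = trans (cong₂ ℤ._-_ (ℤP.pos-+ 1 ∣ w ℤ.+ + W ∣) (ℤP.pos-+ 1 W))
               (trans (cong (λ z → (+ 1 ℤ.+ z) ℤ.- (+ 1 ℤ.+ + W)) (ℤP.0≤i⇒+∣i∣≡i w+W≥0)) (ring w (+ W)))
          where
          ring : ∀ w W → (+ 1 ℤ.+ (w ℤ.+ W)) ℤ.- (+ 1 ℤ.+ W) ≡ w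
          ring = solve-∀
        i≤ : i ≤ suc (2 * W)
        i≤ = s≤s (ℕP.≤-trans (ℤP.∣i+j∣≤∣i∣+∣j∣ w (+ W))
                  (ℕP.≤-trans (ℕP.+-monoˡ-≤ W ∣w∣≤W) (ℕP.≤-reflexive (cong (λ z → W + z) (sym (ℕP.+-identityʳ W))))))

      X : ℕ
      X = x₁ + L * (rootBound + K₂) + K

      L*[rootBound+K₂]<X : L * (rootBound + K₂) < X
      L*[rootBound+K₂]<X = ℕP.<-≤-trans (ℕP.m<n+m _ {x₁} (ℕP.<-≤-trans (s≤s z≤n) (ℕP.m≤n+m _ x₀)))
                                        (ℕP.m≤m+n (x₁ + L * (rootBound + K₂)) K)

      x₁≤X : x₁ ≤ X
      x₁≤X = ℕP.≤-trans (ℕP.m≤m+n x₁ _) (ℕP.m≤m+n _ K)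

      -- The close pair gives a root n of some Q j k w with j, k, |w| bounded in terms of K.
      no-close-solutions : ClosePairsExcludedBeyond K X
      no-close-solutions {m} {m′} {n} {n′} X≤m m<m′ m′≤m+K 1≤n 1≤n′ sol sol′ =
        contradiction X≤m (ℕP.<⇒≱ (ℕP.≤-<-trans m≤L*[rootBound+K₂] L*[rootBound+K₂]<X))
        where
        x₁≤m = ℕP.≤-trans x₁≤X X≤m
        x₀≤m = x₁≤m⇒x₀≤m x₁≤m
        x₀≤n = partner≥x₀ x₁≤m 1≤n sol
        x₁≤m′ = ℕP.≤-trans x₁≤m (ℕP.<⇒≤ m<m′)
        x₀≤m′ = x₁≤m⇒x₀≤m x₁≤m′
        x₀≤n′ = partner≥x₀ x₁≤m′ 1≤n′ sol′
        j = m′ ∸ m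
        m+j≡m′ = ℕP.m+[n∸m]≡n (ℕP.<⇒≤ m<m′)
        1≤j = ℕP.m<n⇒0<n∸m m<m′
        j≤K = ℕP.m≤n+o⇒m∸n≤o m′ m m′≤m+K
        solℕ = solutionℤ⇒solutionℕ x₀≤m x₀≤n sol
        n<n′ = solution-order m j n n′ x₀≤m x₀≤n x₀≤n′ 1≤j solℕ
                 (solutionℤ⇒solutionℕ (subst (x₀ ≤_) (sym m+j≡m′) x₀≤m′) x₀≤n′ (subst (λ z → Solutionℤ z n′) (sym m+j≡m′) sol′))
        k = n′ ∸ n
        n+k≡n′ = ℕP.m+[n∸m]≡n (ℕP.<⇒≤ n<n′)
        1≤k = ℕP.m<n⇒0<n∸m n<n′
        solZ′ : Solutionℤ (m + j) (n + k)
        solZ′ = subst₂ Solutionℤ (sym m+j≡m′) (sym n+k≡n′) sol′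
        solℕ′ = solutionℤ⇒solutionℕ (ℕP.≤-trans x₀≤m (ℕP.m≤m+n m j)) (ℕP.≤-trans x₀≤n (ℕP.m≤m+n n k)) solZ′
        k≤K₂ = k≤kMax K x₀≤m x₀≤n j≤K solℕ solℕ′
        m≤Ln′ = m≤Ln x₀≤m x₀≤n solℕ
        K₂≤n : K₂ ≤ n
        K₂≤n with ℕP.≤-<-connex K₂ n
        ... | inj₁ K₂≤n = K₂≤n
        ... | inj₂ n<K₂ = contradiction X≤m (ℕP.<⇒≱ (ℕP.≤-<-trans m≤Ln′ (ℕP.≤-<-trans
                            (ℕP.*-monoʳ-≤ L (ℕP.≤-trans (ℕP.<⇒≤ n<K₂) (ℕP.m≤n+m K₂ rootBound))) L*[rootBound+K₂]<X)))
        j≤m = ℕP.≤-trans j≤K (ℕP.≤-trans (ℕP.m≤n+m K _) X≤m)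
        open TwoSolutions x₀≤m x₀≤n j≤m (ℕP.≤-trans k≤K₂ K₂≤n) j≤K k≤K₂ solℕ solℕ′
        km≡line : + k ℤ.* + m ≡ evalℤ (line w j) (+ n)
        km≡line rewrite ℤP.pos-* j n | ℤP.pos-* k m = ring (+ j) (+ n) (+ k) (+ m)
          where
          ring : ∀ j n k m → k ℤ.* m ≡ ℤ.- (j ℤ.* n ℤ.- k ℤ.* m) ℤ.+ n ℤ.* (j ℤ.+ n ℤ.* + 0)
          ring = solve-∀
        n≤rootBound = root≤rootBound 1≤j j≤K 1≤k k≤K₂ ∣w∣≤wMax 1≤n (Q-root j k w m n sol km≡line)
        m≤L*[rootBound+K₂] = ℕP.≤-trans m≤Ln′ (ℕP.*-monoʳ-≤ L (ℕP.≤-trans n≤rootBound (ℕP.m≤m+n rootBound K₂)))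

    close-pairs-excluded : ∀ K → ∃ λ X → x₁ ≤ X × ClosePairsExcludedBeyond K X
    close-pairs-excluded K with nonzero-sign a a≢0
    ... | inj₁ (a′ , a≡) = Positive.X a′ a≡ K , Positive.x₁≤X a′ a≡ K , Positive.no-close-solutions a′ a≡ K
    ... | inj₂ (t , a≡)  = x₁ , ℕP.≤-refl , λ x₁≤m _ _ 1≤n _ sol _ → negative⇒no-solution a≡ x₁≤m 1≤n sol

    row : ℕ → ℕ → ℕ
    row B m = sumTo (λ n → indicator (solution? F q m n)) B

    count≡sumTo-row : ∀ B → count F q B ≡ sumTo (row B) B
    count≡sumTo-row B = length-filter-pairs _ B

    row≤ : ∀ B m → row B m ≤ x₀ + 1
    row≤ B m = sumTo-indicator≤ (solution? F q m) x₀ B (λ n n′ x₀<n x₀<n′ sol sol′ →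
      unique-partner (ℕP.<⇒≤ x₀<n) (ℕP.<⇒≤ x₀<n′) (solution⇒solutionℤ sol) (solution⇒solutionℤ sol′))

    row≤1 : ∀ B m → x₁ ≤ m → row B m ≤ 1
    row≤1 B m x₁≤m = sumTo-indicator≤ (solution? F q m) 0 B (λ n n′ 1≤n 1≤n′ sol sol′ →
      unique-partner (partner≥x₀ x₁≤m 1≤n (solution⇒solutionℤ sol)) (partner≥x₀ x₁≤m 1≤n′ (solution⇒solutionℤ sol′))
                     (solution⇒solutionℤ sol) (solution⇒solutionℤ sol′))

    module Sparsity (K : ℕ) where

      X : ℕ
      X = proj₁ (close-pairs-excluded K)

      row-gap : ∀ B m m′ → X < m → m < m′ → m′ ≤ m + K → 1 ≤ row B m → 1 ≤ row B m′ → ⊥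
      row-gap B m m′ X<m m<m′ m′≤m+K 1≤row 1≤row′
        with 1≤sumTo⇒∃ _ B 1≤row | 1≤sumTo⇒∃ _ B 1≤row′
      ... | n , 1≤n , _ , solₙ | n′ , 1≤n′ , _ , solₙ′ =
        proj₂ (proj₂ (close-pairs-excluded K)) (ℕP.<⇒≤ X<m) m<m′ m′≤m+K 1≤n 1≤n′
          (solution⇒solutionℤ (1≤indicator⇒ (solution? F q m n) solₙ)) (solution⇒solutionℤ (1≤indicator⇒ (solution? F q m′ n′) solₙ′))

      count-bound : ∀ B → suc K * count F q B ≤ suc K * (X * (x₀ + 1) + 1) + B
      count-bound B = subst (λ z → suc K * z ≤ suc K * (X * (x₀ + 1) + 1) + B) (sym (count≡sumTo-row B))
        (Sparse.sparse (row B) (x₀ + 1) X K (row≤ B)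
          (λ m X<m → row≤1 B m (ℕP.≤-trans (proj₁ (proj₂ (close-pairs-excluded K))) (ℕP.<⇒≤ X<m))) (row-gap B) B)

    count-littleO : LittleO-B (count F q)
    count-littleO ε ε>0 = suc K * (X * (x₀ + 1) + 1) , bound
      where
      s = ℚ.↧ₙ ε
      K = 2 * s
      open Sparsity K
      p = proj₁ (positive⇒↥≡+suc ε ε>0)
      bound : ∀ B → suc K * (X * (x₀ + 1) + 1) ≤ B → ℕ→ℚ (count F q B) ℚ.≤ ε ℚ.* ℕ→ℚ B
      bound B B₀≤B = ℕ→ℚ-≤-* ε (proj₂ (positive⇒↥≡+suc ε ε>0)) (count F q B) B (ℕP.≤-trans (ℕP.*-cancelˡ-≤ 2 (begin
        2 * (count F q B * s)   ≡⟨ ring (count F q B) s ⟩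
        K * count F q B         ≤⟨ ℕP.m≤n+m (K * count F q B) (count F q B) ⟩
        suc K * count F q B     ≤⟨ count-bound B ⟩
        suc K * (X * (x₀ + 1) + 1) + B ≤⟨ ℕP.+-monoˡ-≤ B B₀≤B ⟩
        B + B                   ≡⟨ ring′ B ⟩
        2 * B                   ∎)) (ℕP.m≤m+n B (p * B)))
        where
        open ℕP.≤-Reasoning
        ring : ∀ c s → 2 * (c * s) ≡ 2 * s * c
        ring = ℕSolver.solve-∀
        ring′ : ∀ B → B + B ≡ 2 * B
        ring′ = ℕSolver.solve-∀

  count-≗ : ∀ f g q → (∀ x → evalℤ f x ≡ evalℤ g x) → ∀ B → count f q B ≡ count g q B
  count-≗ f g q f≗g = count-cong f g q (subst₂ (λ u v → ι u ≡ q ℚ.* ι v) (f≗g _) (f≗g _))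
                                       (subst₂ (λ u v → ι u ≡ q ℚ.* ι v) (sym (f≗g _)) (sym (f≗g _)))

  count-neg : ∀ f q B → count f q B ≡ count (map ℤ.-_ f) q B
  count-neg f q = count-cong f (map ℤ.-_ f) q
    (λ {m} {n} sol → begin
      ι (evalℤ (map ℤ.-_ f) (+ m))          ≡⟨ ι-evalℤ-neg m ⟩
      ℚ.- ι (evalℤ f (+ m))                 ≡⟨ cong ℚ.-_ sol ⟩
      ℚ.- (q ℚ.* ι (evalℤ f (+ n)))         ≡⟨ ℚP.neg-distribʳ-* q _ ⟩
      q ℚ.* ℚ.- ι (evalℤ f (+ n))           ≡⟨ cong (q ℚ.*_) (sym (ι-evalℤ-neg n)) ⟩
      q ℚ.* ι (evalℤ (map ℤ.-_ f) (+ n))    ∎)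
    (λ {m} {n} sol → ℚP.neg-injective (begin
      ℚ.- ι (evalℤ f (+ m))                 ≡⟨ sym (ι-evalℤ-neg m) ⟩
      ι (evalℤ (map ℤ.-_ f) (+ m))          ≡⟨ sol ⟩
      q ℚ.* ι (evalℤ (map ℤ.-_ f) (+ n))    ≡⟨ cong (q ℚ.*_) (ι-evalℤ-neg n) ⟩
      q ℚ.* ℚ.- ι (evalℤ f (+ n))           ≡⟨ sym (ℚP.neg-distribʳ-* q _) ⟩
      ℚ.- (q ℚ.* ι (evalℤ f (+ n)))         ∎))
    where
    open ≡-Reasoning
    ι-evalℤ-neg : ∀ x → ι (evalℤ (map ℤ.-_ f) (+ x)) ≡ ℚ.- ι (evalℤ f (+ x))
    ι-evalℤ-neg x = trans (cong ι (evalℤ-neg f (+ x))) (ι-neg (evalℤ f (+ x)))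

  module Normalise (f : List ℤ) (e : ℕ) (f-deg : HasDegree f (suc (suc e)))
                   (¬power : ¬ ShiftedPower (suc (suc e)) (toℚpoly f)) (q : ℚ) (q≢0 : q ≢ 0ℚ) (q≢1 : q ≢ 1ℚ) where

    private
      D = suc (suc e)

    -- Truncating f at its degree bounds its length by D + 1, and negating it makes the
    -- leading coefficient positive; neither changes the solutions.
    F : List ℤ
    F = take (suc D) f

    F≗f : ∀ i → coeffℤ F i ≡ coeffℤ f i
    F≗f = coeffℤ-truncate f D f-deg

    F-deg : HasDegree F D
    F-deg = hasDegree-cong f F (λ i → sym (F≗f i)) f-deg

    length-F : length F ≤ suc D
    length-F = length-take≤ (suc D) f

    evalQ-F : ∀ y → evalQ (toℚpoly F) y ≡ evalQ (toℚpoly f) y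
    evalQ-F y = evalQ-cong-coeff (toℚpoly F) (toℚpoly f) y (λ i →
      trans (coeffℚ-toℚpoly F i) (trans (cong ι (F≗f i)) (sym (coeffℚ-toℚpoly f i))))

    count-F : ∀ B → count f q B ≡ count F q B
    count-F = count-≗ f F q (λ x → sym (evalℤ-cong-coeff F f x F≗f))

    ¬power-F : ¬ ShiftedPower D (toℚpoly F)
    ¬power-F power = ¬power (shiftedPower-cong D (toℚpoly F) (toℚpoly f) (λ y → sym (evalQ-F y)) power)

    ¬power-−F : ¬ ShiftedPower D (toℚpoly (map ℤ.-_ F))
    ¬power-−F power = ¬power-F (shiftedPower-neg D (toℚpoly (map ℤ.-_ F)) (toℚpoly F) evalQ-F≡- power)
      where
      evalQ-F≡- : ∀ y → evalQ (toℚpoly F) y ≡ ℚ.- evalQ (toℚpoly (map ℤ.-_ F)) y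
      evalQ-F≡- y = trans (sym (⁻¹-involutive _)) (cong ℚ.-_ (sym (evalQ-toℚpoly-neg F y)))

    count-littleO : LittleO-B (count f q)
    count-littleO with nonzero-sign (coeffℤ f D) (proj₁ f-deg)
    ... | inj₁ (c , f-lead) = littleO-cong count-F
      (Core.count-littleO F e c F-deg (trans (F≗f D) f-lead) length-F ¬power-F q q≢0 q≢1)
    ... | inj₂ (c , f-lead) = littleO-cong (λ B → trans (count-F B) (count-neg F q B))
      (Core.count-littleO (map ℤ.-_ F) e c (hasDegree-neg F F-deg) −F-lead
                          (subst (_≤ suc D) (sym (ListP.length-map ℤ.-_ F)) length-F) ¬power-−F q q≢0 q≢1)
      where
      −F-lead : coeffℤ (map ℤ.-_ F) D ≡ + suc c
      −F-lead = trans (coeffℤ-neg F D) (cong ℤ.-_ (trans (F≗f D) f-lead))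

open import Data.Nat using (suc; zero; s≤s; _≤_)
open import Data.Nat.Properties using (≤-trans)
open import Data.Product using (_,_)
open import Data.Sum using (inj₁; inj₂)
open import Relation.Nullary using (contradiction)
open IntegerPolynomials using (HasDegree; zero⊎hasDegree; hasDegree-≥)
open AffineInvariance using (squarefree⇒¬shiftedPower)
open Reduction using (module Normalise)

lemma9p1 : (f : List ℤ) → SquarefreeQ (toℚpoly f) → DegreeAtLeast 2 f →
    (q : ℚ) → q ≢ 0ℚ → q ≢ 1ℚ →
    LittleO-B (count f q)
lemma9p1 f sqfree (k , 2≤k , fₖ≢0) q q≢0 q≢1 with zero⊎hasDegree f
... | inj₁ f≡0         = contradiction (f≡0 k) fₖ≢0
... | inj₂ (d , f-deg) = fromDegree d (≤-trans 2≤k (hasDegree-≥ f d k fₖ≢0 f-deg)) f-deg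
  where
  fromDegree : ∀ d → 2 ≤ d → HasDegree f d → LittleO-B (count f q)
  fromDegree (suc zero)    (s≤s ())
  fromDegree (suc (suc e)) 2≤d f-deg =
    Normalise.count-littleO f e f-deg (squarefree⇒¬shiftedPower (toℚpoly f) sqfree 2≤d) q q≢0 q≢1
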